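{- Let $0\le k\le n$ and $\sigma\in\mathcal{D}^B_k$. Then $$\sum_{\pi\in B_n,\ dp(\pi)=\sigma}(-1)^{\ell_B(\pi)}q^{\mathrm{fmaj}(\pi)}=(-1)^{\ell_B(\sigma)}q^{\mathrm{fmaj}(\sigma)}{n\brack k}_{q^2}.$$
   Context: $B_n$ is the group of signed permutations $\sigma=\sigma_1\cdots\sigma_n$ of $[n]$; $\mathcal{D}^B_k$ is the set of $\sigma\in B_k$ with $\sigma_i\ne i$ for all $i$ ($\mathcal{D}^B_0$ = empty word). $\ell_B(\sigma)=\mathrm{inv}(\sigma)-\sum_{i:\sigma_i<0}\sigma_i$ ($\mathrm{inv}$ in usual integer order). With the order $-1\prec-2\prec\cdots\prec-n\prec1\prec\cdots\prec n$, $\mathrm{maj}_\prec(\sigma)=\sum\{i:\sigma_{i+1}\prec\sigma_i\}$ and $\mathrm{fmaj}(\sigma)=2\mathrm{maj}_\prec(\sigma)+\#\{i:\sigma_i<0\}$. The reduction of a signed word whose absolute values are $a_1<\cdots<a_m$ replaces each entry $\pm a_j$ by $\pm j$. The derangement part $dp(\pi)$ of $\pi\in B_n$ is the reduction of the subword of entries $\pi_i$ with $\pi_i\ne i$. ${n\brack k}_q=\frac{[n]_q!}{[k]_q![n-k]_q!}$ with $[m]_q=1+\cdots+q^{m-1}$. -}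

module Defs where

open import Data.Bool using (Bool; true; false; _∧_; _∨_; not; if_then_else_)
open import Data.Nat as ℕ using (ℕ; zero; suc)
open import Data.Integer as ℤ using (ℤ; +_; -_; ∣_∣)
open import Data.List using (List; []; _∷_; map; filterᵇ; length; concatMap; foldr; upTo)
open import Data.List.Properties using (≡-dec)
open import Data.Product using (_×_; _,_; proj₁; proj₂)
open import Relation.Nullary.Decidable using (⌊_⌋)
open import Relation.Binary.PropositionalEquality using (_≡_)

-- Signed words are lists of integers; entry  ±a  stands for  ±a  (a ≥ 1).

_==_ : ℤ → ℤ → Bool
x == y = ⌊ x ℤ.≟ y ⌋

_<ᶻ_ : ℤ → ℤ → Bool
x <ᶻ y = not (y ℤ.≤ᵇ x)

isNeg : ℤ → Bool
isNeg x = x <ᶻ (+ 0)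

allᵇ : {A : Set} → (A → Bool) → List A → Bool
allᵇ p w = foldr (λ x b → p x ∧ b) true w

count : (ℤ → Bool) → List ℤ → ℕ
count p []      = 0
count p (x ∷ w) = (if p x then 1 else 0) ℕ.+ count p w

signedLetters : ℕ → List ℤ
signedLetters n = concatMap (λ i → (+ suc i) ∷ (- (+ suc i)) ∷ []) (upTo n)

words : ℕ → List ℤ → List (List ℤ)
words zero    al = [] ∷ []
words (suc m) al = concatMap (λ w → map (_∷ w) al) (words m al)

isSignedPerm : ℕ → List ℤ → Bool
isSignedPerm n w =
  (length w ℕ.≡ᵇ n) ∧ allᵇ (λ i → count (λ x → ∣ x ∣ ℕ.≡ᵇ suc i) w ℕ.≡ᵇ 1) (upTo n)

B : ℕ → List (List ℤ)
B n = filterᵇ (isSignedPerm n) (words n (signedLetters n))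

withPosFrom : ℕ → List ℤ → List (ℕ × ℤ)
withPosFrom i []      = []
withPosFrom i (x ∷ w) = (i , x) ∷ withPosFrom (suc i) w

withPos : List ℤ → List (ℕ × ℤ)
withPos = withPosFrom 1

isFixed : ℕ × ℤ → Bool
isFixed (i , x) = x == (+ i)

noFixedPoints : List ℤ → Bool
noFixedPoints σ = allᵇ (λ p → not (isFixed p)) (withPos σ)

IsDerangementB : ℕ → List ℤ → Set
IsDerangementB k σ = (isSignedPerm k σ ∧ noFixedPoints σ) ≡ true

-- reduction: ±a_j ↦ ±j where a_1 < … < a_m are the absolute values
reduce : List ℤ → List ℤ
reduce w = map red w
  where
  red : ℤ → ℤ
  red x = if isNeg x
          then - (+ count (λ y → ∣ y ∣ ℕ.≤ᵇ ∣ x ∣) w)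
          else + count (λ y → ∣ y ∣ ℕ.≤ᵇ ∣ x ∣) w

dp : List ℤ → List ℤ
dp π = reduce (map proj₂ (filterᵇ (λ p → not (isFixed p)) (withPos π)))

inv : List ℤ → ℕ
inv []      = 0
inv (x ∷ w) = count (λ y → y <ᶻ x) w ℕ.+ inv w

negAbsSum : List ℤ → ℕ
negAbsSum []      = 0
negAbsSum (x ∷ w) = (if isNeg x then ∣ x ∣ else 0) ℕ.+ negAbsSum w

ℓB : List ℤ → ℕ
ℓB σ = inv σ ℕ.+ negAbsSum σ

_≺_ : ℤ → ℤ → Bool
x ≺ y = (isNeg x ∧ not (isNeg y))
      ∨ (isNeg x ∧ isNeg y ∧ (∣ x ∣ ℕ.<ᵇ ∣ y ∣))
      ∨ (not (isNeg x) ∧ not (isNeg y) ∧ (x <ᶻ y))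

majFrom : ℕ → List ℤ → ℕ
majFrom i []            = 0
majFrom i (x ∷ [])      = 0
majFrom i (x ∷ y ∷ w)   = (if y ≺ x then i else 0) ℕ.+ majFrom (suc i) (y ∷ w)

maj≺ : List ℤ → ℕ
maj≺ = majFrom 1

fmaj : List ℤ → ℕ
fmaj σ = 2 ℕ.* maj≺ σ ℕ.+ count isNeg σ

weight : ℤ → List ℤ → ℤ
weight q σ = ((- (+ 1)) ℤ.^ ℓB σ) ℤ.* (q ℤ.^ fmaj σ)

sumℤ : List ℤ → ℤ
sumℤ = foldr ℤ._+_ (+ 0)

lhsSum : ℕ → List ℤ → ℤ → ℤ
lhsSum n σ q = sumℤ (map (weight q) (filterᵇ (λ π → ⌊ ≡-dec ℤ._≟_ (dp π) σ ⌋) (B n)))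

qint : ℕ → ℤ → ℤ
qint m x = sumℤ (map (λ j → x ℤ.^ j) (upTo m))

qfact : ℕ → ℤ → ℤ
qfact zero    x = + 1
qfact (suc m) x = qfact m x ℤ.* qint (suc m) x

-- A signed permutation π with dp π = σ is determined by σ and the lengths of the runs of
-- fixed points before, between and after its letters, a weak composition of n − k into
-- k + 1 parts.  Fixed points are positive, and deleting one changes ℓB by an even number,
-- so every such π has the sign (-1)^ℓB and the negative entries of σ.  Reading π as σ
-- interleaved with holes, a descent between two letters is decided by ≺ on them, and one
-- next to a fixed point by whether the neighbouring letter exceeds its position; both are
-- invariant under standardisation, so maj≺ π is a major index computed from σ and the runs.
-- Summing q^(2·maj) over all interleavings of n − k holes into σ gives
-- q^(2·maj σ) [n choose k]_{q²}, by induction on σ using the two Pascal recurrences.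

module Submission where

open import Defs
open import Data.Nat using (ℕ; _≤_; _∸_)
open import Data.Integer using (ℤ; _*_)
open import Data.List using (List)
open import Relation.Binary.PropositionalEquality using (_≡_)

module Lists where

  open import Data.Integer using (ℤ; _+_; _*_)
  open import Data.Integer.Properties
    using (+-identityˡ; +-assoc; *-zeroʳ; *-distribˡ-+; +-0-commutativeMonoid)
  open import Data.Bool using (Bool; true; false; not)
  open import Data.List using (List; []; _∷_; map; _++_; filterᵇ)
  open import Data.List.Relation.Unary.All using (All; []; _∷_)
  open import Data.List.Relation.Binary.Permutation.Propositional
    using (_↭_; ↭⇒↭ₛ; prep; ↭-sym; ↭-trans) renaming (refl to ↭-[])
  import Data.List.Relation.Binary.Permutation.Propositional.Properties as ↭
  open import Data.List.Relation.Binary.Permutation.Setoid.Properties using (foldr-commMonoid)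
  open import Algebra.Bundles using (CommutativeMonoid)
  open import Data.List.Relation.Unary.Unique.Propositional using (Unique)
  open import Data.List.Membership.Propositional using (_∈_)
  open import Data.List.Relation.Unary.Any using (here; there)
  open import Data.List.Properties using (∷-injectiveˡ; ∷-injectiveʳ)
  open import Data.List.Membership.Propositional.Properties.WithK using (unique∧set⇒bag)
  open import Data.List.Relation.Binary.BagAndSetEquality using (∼bag⇒↭)
  open import Function using (_∘_)
  open import Function.Bundles using (_⇔_)
  open import Relation.Binary.PropositionalEquality

  module _ {X : Set} where

    ∑ : (X → ℤ) → List X → ℤ
    ∑ f xs = sumℤ (map f xs)

    ∑-++ : ∀ (f : X → ℤ) xs ys → ∑ f (xs ++ ys) ≡ ∑ f xs + ∑ f ys
    ∑-++ f []       ys = sym (+-identityˡ _)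
    ∑-++ f (x ∷ xs) ys = trans (cong (_+_ (f x)) (∑-++ f xs ys)) (sym (+-assoc (f x) _ _))

    ∑-*ˡ : ∀ c (f : X → ℤ) xs → ∑ (λ x → c * f x) xs ≡ c * ∑ f xs
    ∑-*ˡ c f []       = sym (*-zeroʳ c)
    ∑-*ˡ c f (x ∷ xs) = trans (cong (_+_ (c * f x)) (∑-*ˡ c f xs)) (sym (*-distribˡ-+ c (f x) _))

    ∑-cong : ∀ {f g : X → ℤ} {xs} → All (λ x → f x ≡ g x) xs → ∑ f xs ≡ ∑ g xs
    ∑-cong []       = refl
    ∑-cong (p ∷ ps) = cong₂ _+_ p (∑-cong ps)

    ∑-↭ : ∀ (f : X → ℤ) {xs ys} → xs ↭ ys → ∑ f xs ≡ ∑ f ys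
    ∑-↭ f p = foldr-commMonoid ℤ-setoid isCommutativeMonoid (↭⇒↭ₛ (↭.map⁺ f p))
      where open CommutativeMonoid +-0-commutativeMonoid using (isCommutativeMonoid) renaming (setoid to ℤ-setoid)

  ∑-map : ∀ {X Y : Set} (f : Y → ℤ) (g : X → Y) xs → ∑ f (map g xs) ≡ ∑ (λ x → f (g x)) xs
  ∑-map f g []       = refl
  ∑-map f g (x ∷ xs) = cong (_+_ (f (g x))) (∑-map f g xs)

  map≡id⇒fixed : ∀ {X : Set} (f : X → X) {xs} → map f xs ≡ xs → ∀ {x} → x ∈ xs → f x ≡ x
  map≡id⇒fixed f {_ ∷ _} e (here refl) = ∷-injectiveˡ e
  map≡id⇒fixed f {_ ∷ _} e (there x∈)  = map≡id⇒fixed f (∷-injectiveʳ e) x∈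

  unique-same-∈⇒↭ : ∀ {X : Set} {xs ys : List X} → Unique xs → Unique ys → (∀ {z} → z ∈ xs ⇔ z ∈ ys) → xs ↭ ys
  unique-same-∈⇒↭ uxs uys same = ∼bag⇒↭ (unique∧set⇒bag uxs uys same)

  module _ {A : Set} where

    filterᵇ-partition-↭ : ∀ (p : A → Bool) xs → xs ↭ filterᵇ p xs ++ filterᵇ (not ∘ p) xs
    filterᵇ-partition-↭ p []       = ↭-[]
    filterᵇ-partition-↭ p (x ∷ xs) with p x
    ... | true  = prep x (filterᵇ-partition-↭ p xs)
    ... | false = ↭-trans (prep x (filterᵇ-partition-↭ p xs)) (↭-sym (↭.shift x (filterᵇ p xs) _))

    filterᵇ-all : ∀ (p : A → Bool) xs → All (λ x → p x ≡ true) (filterᵇ p xs)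
    filterᵇ-all p []       = []
    filterᵇ-all p (x ∷ xs) with p x in px
    ... | true  = px ∷ filterᵇ-all p xs
    ... | false = filterᵇ-all p xs

    ++-cancelˡ-↭ : ∀ (zs : List A) {xs ys} → zs ++ xs ↭ zs ++ ys → xs ↭ ys
    ++-cancelˡ-↭ []       p = p
    ++-cancelˡ-↭ (z ∷ zs) p = ++-cancelˡ-↭ zs (↭.drop-∷ p)

module BooleanOrder where

  open import Data.Bool using (true; false; not)
  open import Data.Nat using (_≤_; _<_; _≤ᵇ_; _<ᵇ_; _≡ᵇ_)
  open import Data.Nat.Properties
    using (_≤?_; _<?_; _≟_; <⇒≱; ≤⇒≯; ≤ᵇ⇒≤; <ᵇ⇒<; ≡ᵇ⇒≡; ≰⇒>; <-cmp; ≤-refl; <⇒≤)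
  open import Data.Bool.Properties using (T-≡)
  open import Function using (case_of_)
  open import Function.Bundles using (Equivalence)
  open import Relation.Binary.Definitions using (tri<; tri≈; tri>)
  open import Relation.Nullary.Decidable using (dec-true; dec-false)
  open import Relation.Binary.PropositionalEquality

  ≤ᵇ-true : ∀ {m n} → m ≤ n → (m ≤ᵇ n) ≡ true
  ≤ᵇ-true {m} {n} = dec-true (m ≤? n)

  ≤ᵇ-false : ∀ {m n} → n < m → (m ≤ᵇ n) ≡ false
  ≤ᵇ-false {m} {n} n<m = dec-false (m ≤? n) (<⇒≱ n<m)

  <ᵇ-true : ∀ {m n} → m < n → (m <ᵇ n) ≡ true
  <ᵇ-true {m} {n} = dec-true (m <? n)

  <ᵇ-false : ∀ {m n} → n ≤ m → (m <ᵇ n) ≡ false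
  <ᵇ-false {m} {n} n≤m = dec-false (m <? n) (≤⇒≯ n≤m)

  ≡ᵇ-true : ∀ {m n} → m ≡ n → (m ≡ᵇ n) ≡ true
  ≡ᵇ-true {m} {n} = dec-true (m ≟ n)

  ≡ᵇ-false : ∀ {m n} → m ≢ n → (m ≡ᵇ n) ≡ false
  ≡ᵇ-false {m} {n} = dec-false (m ≟ n)

  ≤ᵇ-true⁻ : ∀ {m n} → (m ≤ᵇ n) ≡ true → m ≤ n
  ≤ᵇ-true⁻ {m} {n} e = ≤ᵇ⇒≤ m n (Equivalence.from T-≡ e)

  <ᵇ-true⁻ : ∀ {m n} → (m <ᵇ n) ≡ true → m < n
  <ᵇ-true⁻ {m} {n} e = <ᵇ⇒< m n (Equivalence.from T-≡ e)

  ≡ᵇ-true⁻ : ∀ {m n} → (m ≡ᵇ n) ≡ true → m ≡ n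
  ≡ᵇ-true⁻ {m} {n} e = ≡ᵇ⇒≡ m n (Equivalence.from T-≡ e)

  ≤ᵇ-false⁻ : ∀ {m n} → (m ≤ᵇ n) ≡ false → n < m
  ≤ᵇ-false⁻ e = ≰⇒> λ m≤n → case trans (sym (≤ᵇ-true m≤n)) e of λ ()

  not-≤ᵇ : ∀ m n → not (m ≤ᵇ n) ≡ (n <ᵇ m)
  not-≤ᵇ m n with <-cmp n m
  ... | tri< n<m _ _ = trans (cong not (≤ᵇ-false n<m)) (sym (<ᵇ-true n<m))
  ... | tri≈ _ refl _ = trans (cong not (≤ᵇ-true {m} ≤-refl)) (sym (<ᵇ-false {m} ≤-refl))
  ... | tri> _ _ m<n = trans (cong not (≤ᵇ-true (<⇒≤ m<n))) (sym (<ᵇ-false (<⇒≤ m<n)))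

module Counting where

  open import Data.Bool using (Bool; true; false; if_then_else_)
  open import Data.Nat using (ℕ; _+_; _≤_; _<_; z≤n; s≤s; _≡ᵇ_)
  open import Data.Nat.Properties using (+-assoc; +-comm; m≤n⇒m≤1+n; m<n⇒m<1+n)
  open import Data.Integer using (ℤ)
  open import Data.List using (List; []; _∷_; map; _++_; length)
  open import Data.List.Relation.Unary.All as All using (All; []; _∷_)
  open import Data.List.Relation.Unary.Unique.Propositional using (Unique)
  open import Data.List.Relation.Unary.AllPairs using ([]; _∷_)
  open import Data.List.Membership.Propositional using (_∈_; _∉_)
  open import Data.List.Relation.Unary.Any using (here; there)
  open import Data.List.Relation.Binary.Permutation.Propositional
    using (_↭_; refl; prep; swap; trans)
  open import Function using (_∘_)
  open import Data.Empty using (⊥-elim)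
  open BooleanOrder using (≡ᵇ-true; ≡ᵇ-false; ≡ᵇ-true⁻)
  open import Data.Nat.Tactic.RingSolver using (solve-∀)
  open import Relation.Binary.PropositionalEquality
    using (_≡_; _≢_; refl; sym; cong; cong₂; module ≡-Reasoning) renaming (trans to ≡-trans)

  ⟦_⟧ : Bool → ℕ
  ⟦ b ⟧ = if b then 1 else 0

  countᵇ : {A : Set} → (A → Bool) → List A → ℕ
  countᵇ p []      = 0
  countᵇ p (x ∷ w) = ⟦ p x ⟧ + countᵇ p w

  count≡countᵇ : ∀ (p : ℤ → Bool) w → count p w ≡ countᵇ p w
  count≡countᵇ p []      = refl
  count≡countᵇ p (x ∷ w) = cong (⟦ p x ⟧ +_) (count≡countᵇ p w)

  module _ {A : Set} where

    countᵇ-++ : ∀ (p : A → Bool) xs ys → countᵇ p (xs ++ ys) ≡ countᵇ p xs + countᵇ p ys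
    countᵇ-++ p []       ys = refl
    countᵇ-++ p (x ∷ xs) ys = ≡-trans (cong (⟦ p x ⟧ +_) (countᵇ-++ p xs ys)) (sym (+-assoc ⟦ p x ⟧ _ _))

    countᵇ-↭ : ∀ (p : A → Bool) {xs ys} → xs ↭ ys → countᵇ p xs ≡ countᵇ p ys
    countᵇ-↭ p refl         = refl
    countᵇ-↭ p (prep x r)   = cong (⟦ p x ⟧ +_) (countᵇ-↭ p r)
    countᵇ-↭ p (swap {xs} {ys} x y r) = begin
      ⟦ p x ⟧ + (⟦ p y ⟧ + countᵇ p xs) ≡⟨ sym (+-assoc ⟦ p x ⟧ _ _) ⟩
      ⟦ p x ⟧ + ⟦ p y ⟧ + countᵇ p xs   ≡⟨ cong₂ _+_ (+-comm ⟦ p x ⟧ ⟦ p y ⟧) (countᵇ-↭ p r) ⟩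
      ⟦ p y ⟧ + ⟦ p x ⟧ + countᵇ p ys   ≡⟨ +-assoc ⟦ p y ⟧ _ _ ⟩
      ⟦ p y ⟧ + (⟦ p x ⟧ + countᵇ p ys) ∎
      where open ≡-Reasoning
    countᵇ-↭ p (trans r s)  = ≡-trans (countᵇ-↭ p r) (countᵇ-↭ p s)

    countᵇ-cong : ∀ {p q : A → Bool} {xs} → All (λ x → p x ≡ q x) xs → countᵇ p xs ≡ countᵇ q xs
    countᵇ-cong []       = refl
    countᵇ-cong (e ∷ es) = cong₂ _+_ (cong ⟦_⟧ e) (countᵇ-cong es)

    countᵇ-none : ∀ (p : A → Bool) {xs} → All (λ x → p x ≡ false) xs → countᵇ p xs ≡ 0
    countᵇ-none p {[]}     []       = refl
    countᵇ-none p {x ∷ xs} (e ∷ es) = cong₂ _+_ (cong ⟦_⟧ e) (countᵇ-none p es)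

    countᵇ-all : ∀ (p : A → Bool) {xs} → All (λ x → p x ≡ true) xs → countᵇ p xs ≡ length xs
    countᵇ-all p {[]}     []       = refl
    countᵇ-all p {x ∷ xs} (e ∷ es) = cong₂ _+_ (cong ⟦_⟧ e) (countᵇ-all p es)

    countᵇ-+ : ∀ (p q r : A → Bool) {xs} → All (λ x → ⟦ p x ⟧ + ⟦ q x ⟧ ≡ ⟦ r x ⟧) xs →
               countᵇ p xs + countᵇ q xs ≡ countᵇ r xs
    countᵇ-+ p q r {[]}     []       = refl
    countᵇ-+ p q r {x ∷ xs} (e ∷ es) = begin
      ⟦ p x ⟧ + countᵇ p xs + (⟦ q x ⟧ + countᵇ q xs) ≡⟨ +-interchange ⟦ p x ⟧ (countᵇ p xs) ⟦ q x ⟧ (countᵇ q xs) ⟩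
      ⟦ p x ⟧ + ⟦ q x ⟧ + (countᵇ p xs + countᵇ q xs) ≡⟨ cong₂ _+_ e (countᵇ-+ p q r es) ⟩
      ⟦ r x ⟧ + countᵇ r xs                           ∎
      where
      open ≡-Reasoning
      +-interchange : ∀ a b c d → a + b + (c + d) ≡ a + c + (b + d)
      +-interchange = solve-∀

    countᵇ-mono : ∀ (p q : A → Bool) → (∀ y → p y ≡ true → q y ≡ true) → ∀ xs → countᵇ p xs ≤ countᵇ q xs
    countᵇ-mono p q p⇒q [] = z≤n
    countᵇ-mono p q p⇒q (x ∷ xs) with p x in px | q x in qx
    ... | true  | true  = s≤s (countᵇ-mono p q p⇒q xs)
    ... | true  | false with () ← ≡-trans (sym (p⇒q x px)) qx
    ... | false | true  = m≤n⇒m≤1+n (countᵇ-mono p q p⇒q xs)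
    ... | false | false = countᵇ-mono p q p⇒q xs

    countᵇ-mono-< : ∀ (p q : A → Bool) → (∀ y → p y ≡ true → q y ≡ true) →
                    ∀ {xs y} → y ∈ xs → p y ≡ false → q y ≡ true → countᵇ p xs < countᵇ q xs
    countᵇ-mono-< p q p⇒q {x ∷ xs} (here refl) py qy rewrite py | qy = s≤s (countᵇ-mono p q p⇒q xs)
    countᵇ-mono-< p q p⇒q {x ∷ xs} (there y∈xs) py qy with p x in px | q x in qx
    ... | true  | true  = s≤s (countᵇ-mono-< p q p⇒q y∈xs py qy)
    ... | true  | false with () ← ≡-trans (sym (p⇒q x px)) qx
    ... | false | true  = m<n⇒m<1+n (countᵇ-mono-< p q p⇒q y∈xs py qy)
    ... | false | false = countᵇ-mono-< p q p⇒q y∈xs py qy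

  countᵇ-map : ∀ {A B : Set} (p : B → Bool) (f : A → B) xs → countᵇ p (map f xs) ≡ countᵇ (p ∘ f) xs
  countᵇ-map p f []       = refl
  countᵇ-map p f (x ∷ xs) = cong (⟦ p (f x) ⟧ +_) (countᵇ-map p f xs)

  countᵇ-≡ᵇ-∉ : ∀ {a xs} → a ∉ xs → countᵇ (_≡ᵇ a) xs ≡ 0
  countᵇ-≡ᵇ-∉ {a} {xs} a∉xs = countᵇ-none (_≡ᵇ a) (All.tabulate λ {x} x∈xs → ≡ᵇ-false {x} λ { refl → a∉xs x∈xs })

  countᵇ-≡ᵇ-unique : ∀ {a xs} → Unique xs → a ∈ xs → countᵇ (_≡ᵇ a) xs ≡ 1
  countᵇ-≡ᵇ-unique {a} {_ ∷ xs} (a∉xs ∷ _) (here refl) =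
    cong₂ _+_ (cong ⟦_⟧ (≡ᵇ-true {a} refl)) (countᵇ-≡ᵇ-∉ {a} {xs} λ a∈xs → All.lookup a∉xs a∈xs refl)
  countᵇ-≡ᵇ-unique {a} {x ∷ _} (x≢xs ∷ u) (there a∈xs) =
    cong₂ _+_ (cong ⟦_⟧ (≡ᵇ-false {x} λ { refl → All.lookup x≢xs a∈xs refl })) (countᵇ-≡ᵇ-unique u a∈xs)

  ∈-from-countᵇ : ∀ {a} L → countᵇ (_≡ᵇ a) L ≢ 0 → a ∈ L
  ∈-from-countᵇ []      c≢0 = ⊥-elim (c≢0 refl)
  ∈-from-countᵇ {a} (x ∷ L) c≢0 with x ≡ᵇ a in x≡a
  ... | true  = here (sym (≡ᵇ-true⁻ x≡a))
  ... | false = there (∈-from-countᵇ L c≢0)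

module Ranges where

  open import Data.Nat using (ℕ; zero; suc; _+_; _≤_; _<_; z≤n; s≤s; _≡ᵇ_)
  open import Data.Nat.Properties
    using (≤-refl; <⇒≤; +-suc; +-identityʳ; m<m+n; <-irrefl; m≤n⇒m<n∨m≡n; <-≤-trans; suc-injective)
  open import Data.List using (List; []; _∷_; map; _++_; length; applyUpTo; upTo)
  open import Data.List.Properties using (map-∘; map-id; length-++)
  open import Data.List.Membership.Propositional.Properties using (∈-∃++)
  open import Data.List.Relation.Binary.Permutation.Propositional using (_↭_; ↭-refl; ↭-trans; prep)
  import Data.List.Relation.Binary.Permutation.Propositional.Properties as ↭
  open import Data.List.Membership.Propositional using (_∈_)
  open import Data.List.Relation.Unary.Any using (here; there)
  import Data.List.Relation.Unary.All as All
  open import Data.List.Relation.Unary.Unique.Propositional using (Unique)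
  open import Data.List.Relation.Unary.AllPairs using ([]; _∷_)
  open import Data.Product using (_×_; _,_; proj₁)
  open import Data.Sum using (inj₁; inj₂)
  open import Data.Empty using (⊥-elim)
  open import Function using (_∘_; id; case_of_)
  open import Relation.Binary.PropositionalEquality
  open BooleanOrder using (≡ᵇ-false)
  open Counting

  range : ℕ → ℕ → List ℕ
  range i zero    = []
  range i (suc n) = i ∷ range (suc i) n

  map-suc-range : ∀ i n → map suc (range i n) ≡ range (suc i) n
  map-suc-range i zero    = refl
  map-suc-range i (suc n) = cong (suc i ∷_) (map-suc-range (suc i) n)

  applyUpTo≡map-range : ∀ {B : Set} (f : ℕ → B) n → applyUpTo f n ≡ map f (range 0 n)
  applyUpTo≡map-range f zero    = refl
  applyUpTo≡map-range f (suc n) = cong (f 0 ∷_) (begin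
    applyUpTo (f ∘ suc) n       ≡⟨ applyUpTo≡map-range (f ∘ suc) n ⟩
    map (f ∘ suc) (range 0 n)   ≡⟨ map-∘ (range 0 n) ⟩
    map f (map suc (range 0 n)) ≡⟨ cong (map f) (map-suc-range 0 n) ⟩
    map f (range 1 n)           ∎)
    where open ≡-Reasoning

  upTo≡range : ∀ n → upTo n ≡ range 0 n
  upTo≡range n = trans (applyUpTo≡map-range id n) (map-id (range 0 n))

  length-range : ∀ i n → length (range i n) ≡ n
  length-range i zero    = refl
  length-range i (suc n) = cong suc (length-range (suc i) n)

  ∈-range⁻ : ∀ {x} i n → x ∈ range i n → i ≤ x × x < i + n
  ∈-range⁻ i (suc n) (here refl) = ≤-refl , m<m+n i (s≤s z≤n)
  ∈-range⁻ {x} i (suc n) (there x∈) with i<x , x<i+n ← ∈-range⁻ (suc i) n x∈ =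
    <⇒≤ i<x , subst (x <_) (sym (+-suc i n)) x<i+n

  ∈-range⁺ : ∀ {x} i n → i ≤ x → x < i + n → x ∈ range i n
  ∈-range⁺ {x} i zero    i≤x x<i+0 = ⊥-elim (<-irrefl refl (<-≤-trans (subst (x <_) (+-identityʳ i) x<i+0) i≤x))
  ∈-range⁺ {x} i (suc n) i≤x x<i+n with m≤n⇒m<n∨m≡n i≤x
  ... | inj₂ refl = here refl
  ... | inj₁ i<x  = there (∈-range⁺ (suc i) n i<x (subst (x <_) (+-suc i n) x<i+n))

  range-++ : ∀ i m n → range i (m + n) ≡ range i m ++ range (i + m) n
  range-++ i zero    n = cong (λ j → range j n) (sym (+-identityʳ i))
  range-++ i (suc m) n = cong (i ∷_) (trans (range-++ (suc i) m n) (cong (λ j → range (suc i) m ++ range j n) (sym (+-suc i m))))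

  range-unique : ∀ i n → Unique (range i n)
  range-unique i zero    = []
  range-unique i (suc n) = All.tabulate (λ x∈ i≡x → <-irrefl i≡x (proj₁ (∈-range⁻ (suc i) n x∈))) ∷ range-unique (suc i) n

  ↭-range-from-counts : ∀ n i L → length L ≡ n → (∀ a → i ≤ a → a < i + n → countᵇ (_≡ᵇ a) L ≡ 1) → L ↭ range i n
  ↭-range-from-counts zero    i []  _ _    = ↭-refl
  ↭-range-from-counts (suc n) i L   l once
    with A , B , refl ← ∈-∃++ (∈-from-countᵇ L λ c≡0 → case trans (sym c≡0) (once i ≤-refl (m<m+n i (s≤s z≤n))) of λ ())
    = ↭-trans (↭.shift i A B) (prep i (↭-range-from-counts n (suc i) (A ++ B) lengthAB onceAB))
    where
    lengthAB : length (A ++ B) ≡ n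
    lengthAB = suc-injective (begin
      suc (length (A ++ B))       ≡⟨ cong suc (length-++ A) ⟩
      suc (length A + length B)   ≡⟨ +-suc (length A) (length B) ⟨
      length A + length (i ∷ B)   ≡⟨ length-++ A ⟨
      length (A ++ i ∷ B)         ≡⟨ l ⟩
      suc n                       ∎)
      where open ≡-Reasoning
    onceAB : ∀ a → suc i ≤ a → a < suc i + n → countᵇ (_≡ᵇ a) (A ++ B) ≡ 1
    onceAB a i<a a<i+n = begin
      countᵇ (_≡ᵇ a) (A ++ B)
        ≡⟨ countᵇ-++ (_≡ᵇ a) A B ⟩
      countᵇ (_≡ᵇ a) A + countᵇ (_≡ᵇ a) B
        ≡⟨ cong (λ c → countᵇ (_≡ᵇ a) A + (⟦ c ⟧ + countᵇ (_≡ᵇ a) B)) (≡ᵇ-false {i} λ i≡a → <-irrefl i≡a i<a) ⟨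
      countᵇ (_≡ᵇ a) A + countᵇ (_≡ᵇ a) (i ∷ B)
        ≡⟨ countᵇ-++ (_≡ᵇ a) A (i ∷ B) ⟨
      countᵇ (_≡ᵇ a) (A ++ i ∷ B)
        ≡⟨ once a (<⇒≤ i<a) (subst (a <_) (sym (+-suc i n)) a<i+n) ⟩
      1 ∎
      where open ≡-Reasoning

module Ranks where

  open import Data.Bool using (true)
  open import Data.Nat as ℕ using (ℕ; zero; suc; _≤_; _<_; z≤n; s≤s; _≤ᵇ_; _<ᵇ_)
  import Data.Nat.Properties as ℕ
  open import Data.List using (List; []; _∷_; map; length)
  open import Data.List.Properties using (map-∘; map-cong-local)
  open import Data.List.Relation.Unary.All as All using (All; []; _∷_)
  open import Data.List.Relation.Unary.AllPairs using (AllPairs; []; _∷_)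
  open import Data.List.Relation.Unary.Any using (here; there)
  open import Data.List.Membership.Propositional using (_∈_)
  open import Data.List.Membership.Propositional.Properties using (∈-map⁺)
  open import Function using (_∘_)
  open import Relation.Binary.Definitions using (tri<; tri≈; tri>)
  open import Relation.Binary.PropositionalEquality
  open Lists using (map≡id⇒fixed)
  open BooleanOrder
  open Counting
  open Ranges

  rank : List ℕ → ℕ → ℕ
  rank P a = countᵇ (_≤ᵇ a) P

  -- unrank P j is the j-th element of P, counting from 1 (and 0 out of range).
  unrank : List ℕ → ℕ → ℕ
  unrank []      r             = 0
  unrank (p ∷ P) zero          = 0
  unrank (p ∷ P) (suc zero)    = p
  unrank (p ∷ P) (suc (suc r)) = unrank P (suc r)

  private
    ≤ᵇ-trans : ∀ {a b} → a ≤ b → ∀ y → (y ≤ᵇ a) ≡ true → (y ≤ᵇ b) ≡ true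
    ≤ᵇ-trans a≤b y y≤a = ≤ᵇ-true (ℕ.≤-trans (≤ᵇ-true⁻ {y} y≤a) a≤b)

  rank-mono : ∀ P {a b} → a ≤ b → rank P a ≤ rank P b
  rank-mono P a≤b = countᵇ-mono _ _ (≤ᵇ-trans a≤b) P

  rank-mono-< : ∀ P {a b} → b ∈ P → a < b → rank P a < rank P b
  rank-mono-< P {a} {b} b∈P a<b =
    countᵇ-mono-< _ _ (≤ᵇ-trans (ℕ.<⇒≤ a<b)) b∈P (≤ᵇ-false a<b) (≤ᵇ-true (ℕ.≤-refl {b}))

  rank-<ᵇ : ∀ P {a b} → b ∈ P → (rank P a <ᵇ rank P b) ≡ (a <ᵇ b)
  rank-<ᵇ P {a} {b} b∈P with ℕ.<-cmp a b
  ... | tri< a<b _ _ = trans (<ᵇ-true (rank-mono-< P b∈P a<b)) (sym (<ᵇ-true a<b))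
  ... | tri≈ _ refl _ = trans (<ᵇ-false {rank P a} ℕ.≤-refl) (sym (<ᵇ-false {a} ℕ.≤-refl))
  ... | tri> _ _ b<a = trans (<ᵇ-false (rank-mono P (ℕ.<⇒≤ b<a))) (sym (<ᵇ-false (ℕ.<⇒≤ b<a)))

  rank-pos : ∀ P {b} → b ∈ P → 1 ≤ rank P b
  rank-pos (p ∷ P) {b} (here refl) rewrite ≤ᵇ-true (ℕ.≤-refl {b}) = s≤s z≤n
  rank-pos (p ∷ P) {b} (there b∈P) = ℕ.≤-trans (rank-pos P b∈P) (ℕ.m≤n+m (rank P b) ⟦ p ≤ᵇ b ⟧)

  rank-head : ∀ p P → All (p <_) P → rank (p ∷ P) p ≡ 1
  rank-head p P p<P rewrite ≤ᵇ-true (ℕ.≤-refl {p}) = cong suc (countᵇ-none _ (All.map ≤ᵇ-false p<P))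

  rank-tail : ∀ p P {d} → p ≤ d → rank (p ∷ P) d ≡ suc (rank P d)
  rank-tail p P p≤d rewrite ≤ᵇ-true p≤d = refl

  map-rank-increasing : ∀ P → AllPairs _<_ P → map (rank P) P ≡ range 1 (length P)
  map-rank-increasing []      []           = refl
  map-rank-increasing (p ∷ P) (p<P ∷ incr) = cong₂ _∷_ (rank-head p P p<P) (begin
    map (rank (p ∷ P)) P        ≡⟨ map-cong-local (All.map (λ p<d → rank-tail p P (ℕ.<⇒≤ p<d)) p<P) ⟩
    map (suc ∘ rank P) P        ≡⟨ map-∘ P ⟩
    map suc (map (rank P) P)    ≡⟨ cong (map suc) (map-rank-increasing P incr) ⟩
    map suc (range 1 (length P)) ≡⟨ map-suc-range 1 (length P) ⟩
    range 2 (length P)          ∎)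
    where open ≡-Reasoning

  unrank-rank : ∀ P → AllPairs _<_ P → ∀ {d} → d ∈ P → unrank P (rank P d) ≡ d
  unrank-rank (p ∷ P) (p<P ∷ _) (here refl) rewrite rank-head p P p<P = refl
  unrank-rank (p ∷ P) (p<P ∷ incr) {d} (there d∈P)
    rewrite rank-tail p P (ℕ.<⇒≤ (All.lookup p<P d∈P)) with rank P d in r | rank-pos P d∈P
  ... | suc _ | _ = trans (cong (unrank P) (sym r)) (unrank-rank P incr d∈P)

  map-unrank-range : ∀ P → map (unrank P) (range 1 (length P)) ≡ P
  map-unrank-range []      = refl
  map-unrank-range (p ∷ P) = cong (p ∷_) (trans (shift 0 (length P)) (map-unrank-range P))
    where
    shift : ∀ i n → map (unrank (p ∷ P)) (range (suc (suc i)) n) ≡ map (unrank P) (range (suc i) n)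
    shift i zero    = refl
    shift i (suc n) = cong (unrank P (suc i) ∷_) (shift (suc i) n)

  unrank-∈ : ∀ P {j} → j ∈ range 1 (length P) → unrank P j ∈ P
  unrank-∈ P {j} j∈ = subst (unrank P j ∈_) (map-unrank-range P) (∈-map⁺ (unrank P) j∈)

  rank-unrank : ∀ P → AllPairs _<_ P → ∀ {j} → j ∈ range 1 (length P) → rank P (unrank P j) ≡ j
  rank-unrank P incr = map≡id⇒fixed (rank P ∘ unrank P) (begin
    map (rank P ∘ unrank P) (range 1 (length P))       ≡⟨ map-∘ (range 1 (length P)) ⟩
    map (rank P) (map (unrank P) (range 1 (length P))) ≡⟨ cong (map (rank P)) (map-unrank-range P) ⟩
    map (rank P) P                                     ≡⟨ map-rank-increasing P incr ⟩
    range 1 (length P)                                 ∎)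
    where open ≡-Reasoning

module QBinomial where

  open import Data.Nat as ℕ using (ℕ; zero; suc)
  import Data.Nat.Properties as ℕ
  open import Data.Integer using (ℤ; +_; _+_; _*_; _^_)
  open import Data.Integer.Properties using (*-zeroʳ; *-distribˡ-+; ^-distribˡ-+-*; *-identityˡ; *-identityʳ)
  open import Data.Integer.Tactic.RingSolver using (solve-∀)
  open import Data.List using (upTo; _++_)
  open import Relation.Binary.PropositionalEquality
  open ≡-Reasoning
  open Lists
  open Ranges

  -- qbinom Q a b = [a + b choose a]_Q.
  qbinom : ℤ → ℕ → ℕ → ℤ
  qbinom Q zero    b       = + 1
  qbinom Q (suc a) zero    = + 1
  qbinom Q (suc a) (suc b) = qbinom Q a (suc b) + Q ^ suc a * qbinom Q (suc a) b

  qbinom-0ʳ : ∀ Q a → qbinom Q a 0 ≡ + 1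
  qbinom-0ʳ Q zero    = refl
  qbinom-0ʳ Q (suc a) = refl

  qbinom-pascal′ : ∀ Q a b → qbinom Q (suc a) (suc b) ≡ Q ^ suc b * qbinom Q a (suc b) + qbinom Q (suc a) b
  qbinom-pascal′ Q zero zero = ring Q
    where
    ring : ∀ Q → + 1 + Q * + 1 * + 1 ≡ Q * + 1 * + 1 + + 1
    ring = solve-∀
  qbinom-pascal′ Q zero (suc b) = begin
    + 1 + Q * + 1 * qbinom Q 1 (suc b)
      ≡⟨ cong (λ t → + 1 + Q * + 1 * t) (qbinom-pascal′ Q zero b) ⟩
    + 1 + Q * + 1 * (Q ^ suc b * + 1 + qbinom Q 1 b)
      ≡⟨ ring Q (Q ^ b) (qbinom Q 1 b) ⟩
    Q * (Q * Q ^ b) * + 1 + (+ 1 + Q * + 1 * qbinom Q 1 b) ∎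
    where
    ring : ∀ Q X Y → + 1 + Q * + 1 * (Q * X * + 1 + Y) ≡ Q * (Q * X) * + 1 + (+ 1 + Q * + 1 * Y)
    ring = solve-∀
  qbinom-pascal′ Q (suc a) zero = begin
    qbinom Q a 1 + Q ^ suc a * + 1 + Q ^ suc (suc a) * + 1
      ≡⟨ cong (λ t → t + Q ^ suc (suc a) * + 1) (qbinom-pascal′ Q a zero) ⟩
    Q * + 1 * qbinom Q a 1 + + 1 + Q * Q ^ suc a * + 1
      ≡⟨ ring Q (Q ^ suc a) (qbinom Q a 1) ⟩
    Q * + 1 * (qbinom Q a 1 + Q ^ suc a * + 1) + + 1 ∎
    where
    ring : ∀ Q X Y → Q * + 1 * Y + + 1 + Q * X * + 1 ≡ Q * + 1 * (Y + X * + 1) + + 1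
    ring = solve-∀
  qbinom-pascal′ Q (suc a) (suc b) = begin
    qbinom Q (suc a) (suc (suc b)) + Q ^ suc (suc a) * qbinom Q (suc (suc a)) (suc b)
      ≡⟨ cong₂ (λ s t → s + Q ^ suc (suc a) * t) (qbinom-pascal′ Q a (suc b)) (qbinom-pascal′ Q (suc a) b) ⟩
    Q ^ suc (suc b) * Z + Y + Q ^ suc (suc a) * (Q ^ suc b * Y + V)
      ≡⟨ ring Q (Q ^ a) (Q ^ b) Z Y V ⟩
    Q ^ suc (suc b) * (Z + Q ^ suc a * Y) + (Y + Q ^ suc (suc a) * V)
      ∎
    where
    Z : ℤ
    Z = qbinom Q a (suc (suc b))
    Y : ℤ
    Y = qbinom Q (suc a) (suc b)
    V : ℤ
    V = qbinom Q (suc (suc a)) b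
    ring : ∀ Q A B Z Y V →
      Q * (Q * B) * Z + Y + Q * (Q * A) * (Q * B * Y + V) ≡ Q * (Q * B) * (Z + Q * A * Y) + (Y + Q * (Q * A) * V)
    ring = solve-∀

  ∑-pow-shift : ∀ x a i n → ∑ (x ^_) (range (a ℕ.+ i) n) ≡ x ^ a * ∑ (x ^_) (range i n)
  ∑-pow-shift x a i zero    = sym (*-zeroʳ (x ^ a))
  ∑-pow-shift x a i (suc n) = begin
    x ^ (a ℕ.+ i) + ∑ (x ^_) (range (suc (a ℕ.+ i)) n)
      ≡⟨ cong₂ _+_ (^-distribˡ-+-* x a i) (cong (λ j → ∑ (x ^_) (range j n)) (sym (ℕ.+-suc a i))) ⟩
    x ^ a * x ^ i + ∑ (x ^_) (range (a ℕ.+ suc i) n)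
      ≡⟨ cong (_+_ (x ^ a * x ^ i)) (∑-pow-shift x a (suc i) n) ⟩
    x ^ a * x ^ i + x ^ a * ∑ (x ^_) (range (suc i) n)
      ≡⟨ *-distribˡ-+ (x ^ a) (x ^ i) _ ⟨
    x ^ a * (x ^ i + ∑ (x ^_) (range (suc i) n)) ∎

  qint-+ : ∀ a b x → qint (a ℕ.+ b) x ≡ qint a x + x ^ a * qint b x
  qint-+ a b x = begin
    ∑ (x ^_) (upTo (a ℕ.+ b))
      ≡⟨ cong (∑ (x ^_)) (trans (upTo≡range (a ℕ.+ b)) (range-++ 0 a b)) ⟩
    ∑ (x ^_) (range 0 a ++ range a b)
      ≡⟨ ∑-++ (x ^_) (range 0 a) (range a b) ⟩
    ∑ (x ^_) (range 0 a) + ∑ (x ^_) (range a b)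
      ≡⟨ cong (_+_ (∑ (x ^_) (range 0 a))) (trans (cong (λ j → ∑ (x ^_) (range j b)) (sym (ℕ.+-identityʳ a))) (∑-pow-shift x a 0 b)) ⟩
    ∑ (x ^_) (range 0 a) + x ^ a * ∑ (x ^_) (range 0 b)
      ≡⟨ cong₂ (λ s t → ∑ (x ^_) s + x ^ a * ∑ (x ^_) t) (sym (upTo≡range a)) (sym (upTo≡range b)) ⟩
    qint a x + x ^ a * qint b x ∎

  qbinom-qfact : ∀ Q a b → qbinom Q a b * qfact a Q * qfact b Q ≡ qfact (a ℕ.+ b) Q
  qbinom-qfact Q zero    b    = trans (cong (_* qfact b Q) (*-identityˡ (+ 1))) (*-identityˡ (qfact b Q))
  qbinom-qfact Q (suc a) zero = trans (*-identityʳ _) (trans (*-identityˡ _) (cong (λ n → qfact n Q) (sym (ℕ.+-identityʳ (suc a)))))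
  qbinom-qfact Q (suc a) (suc b) = begin
    (P₀ + Q ^ suc a * P₁) * (Fa * Ia) * (Fb * Ib)
      ≡⟨ ring₁ P₀ (Q ^ suc a) P₁ Fa Ia Fb Ib ⟩
    P₀ * Fa * (Fb * Ib) * Ia + Q ^ suc a * (P₁ * (Fa * Ia) * Fb * Ib)
      ≡⟨ cong₂ (λ s t → s * Ia + Q ^ suc a * (t * Ib)) (qbinom-qfact Q a (suc b)) (qbinom-qfact Q (suc a) b) ⟩
    qfact (a ℕ.+ suc b) Q * Ia + Q ^ suc a * (qfact (suc (a ℕ.+ b)) Q * Ib)
      ≡⟨ cong (λ n → qfact n Q * Ia + Q ^ suc a * (qfact (suc (a ℕ.+ b)) Q * Ib)) (ℕ.+-suc a b) ⟩
    F * Ia + Q ^ suc a * (F * Ib)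
      ≡⟨ ring₂ F Ia (Q ^ suc a) Ib ⟩
    F * (Ia + Q ^ suc a * Ib)
      ≡⟨ cong (F *_) (qint-+ (suc a) (suc b) Q) ⟨
    F * qint (suc a ℕ.+ suc b) Q
      ≡⟨ cong (λ n → qfact n Q * qint (suc a ℕ.+ suc b) Q) (sym (ℕ.+-suc a b)) ⟩
    qfact (suc a ℕ.+ suc b) Q ∎
    where
    P₀ : ℤ
    P₀ = qbinom Q a (suc b)
    P₁ : ℤ
    P₁ = qbinom Q (suc a) b
    Fa : ℤ
    Fa = qfact a Q
    Ia : ℤ
    Ia = qint (suc a) Q
    Fb : ℤ
    Fb = qfact b Q
    Ib : ℤ
    Ib = qint (suc b) Q
    F : ℤ
    F = qfact (suc (a ℕ.+ b)) Q
    ring₁ : ∀ P₀ A P₁ Fa Ia Fb Ib → (P₀ + A * P₁) * (Fa * Ia) * (Fb * Ib)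
              ≡ P₀ * Fa * (Fb * Ib) * Ia + A * (P₁ * (Fa * Ia) * Fb * Ib)
    ring₁ = solve-∀
    ring₂ : ∀ F Ia A Ib → F * Ia + A * (F * Ib) ≡ F * (Ia + A * Ib)
    ring₂ = solve-∀

module Compositions where

  open import Data.Nat using (ℕ; zero; suc)
  open import Data.Nat.Properties using (+-identityʳ; suc-injective)
  open import Data.Nat.ListAction using (sum)
  open import Data.List using (List; []; _∷_; map; _++_; length; reverse)
  open import Data.List.Relation.Unary.All as All using (All; []; _∷_)
  import Data.List.Relation.Unary.All.Properties as All
  open import Data.List.Relation.Unary.Any using (here)
  open import Data.List.Membership.Propositional using (_∈_)
  open import Data.List.Membership.Propositional.Properties using (∈-map⁺; ∈-map⁻; ∈-++⁺ˡ; ∈-++⁺ʳ)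
  open import Data.List.Relation.Unary.Unique.Propositional using (Unique)
  open import Data.List.Relation.Unary.AllPairs using ([]; _∷_)
  import Data.List.Relation.Unary.Unique.Propositional.Properties as Unique
  open import Data.List.Properties using (∷-injectiveʳ; length-reverse; reverse-injective; reverse-involutive)
  open import Data.Nat.ListAction.Properties using (sum-↭)
  open import Data.List.Relation.Binary.Permutation.Propositional using (_↭_)
  open import Data.List.Relation.Binary.Permutation.Propositional.Properties using (↭-reverse)
  open import Data.Product using (_×_; _,_)
  open import Data.Empty using (⊥)
  open import Function.Bundles using (mk⇔)
  open import Relation.Binary.PropositionalEquality
  open Lists using (unique-same-∈⇒↭)

  incHead : List ℕ → List ℕ
  incHead []      = []
  incHead (s ∷ g) = suc s ∷ g

  IsComposition : ℕ → ℕ → List ℕ → Set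
  IsComposition m k g = length g ≡ suc k × sum g ≡ m

  compositions : ℕ → ℕ → List (List ℕ)
  compositions m       zero    = (m ∷ []) ∷ []
  compositions zero    (suc k) = map (0 ∷_) (compositions zero k)
  compositions (suc m) (suc k) = map (0 ∷_) (compositions (suc m) k) ++ map incHead (compositions m (suc k))

  compositions-sound : ∀ m k → All (IsComposition m k) (compositions m k)
  compositions-sound m       zero    = (refl , +-identityʳ m) ∷ []
  compositions-sound zero    (suc k) = All.gmap⁺ (λ (l , s) → cong suc l , s) (compositions-sound zero k)
  compositions-sound (suc m) (suc k) =
    All.++⁺ (All.gmap⁺ (λ (l , s) → cong suc l , s) (compositions-sound (suc m) k))
            (All.gmap⁺ (λ {g} → inc {g}) (compositions-sound m (suc k)))
    where
    inc : ∀ {g} → IsComposition m (suc k) g → IsComposition (suc m) (suc k) (incHead g)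
    inc {s ∷ g} (l , e) = l , cong suc e

  compositions-complete : ∀ m k g → IsComposition m k g → g ∈ compositions m k
  compositions-complete m zero (s ∷ []) (_ , e) = here (cong (_∷ []) (trans (sym (+-identityʳ s)) e))
  compositions-complete zero (suc k) (0 ∷ g) (l , e) =
    ∈-map⁺ (0 ∷_) (compositions-complete zero k g (suc-injective l , e))
  compositions-complete (suc m) (suc k) (0 ∷ g) (l , e) =
    ∈-++⁺ˡ (∈-map⁺ (0 ∷_) (compositions-complete (suc m) k g (suc-injective l , e)))
  compositions-complete (suc m) (suc k) (suc s ∷ g) (l , e) =
    ∈-++⁺ʳ _ (∈-map⁺ incHead (compositions-complete m (suc k) (s ∷ g) (l , suc-injective e)))

  incHead-injective : ∀ {g h} → incHead g ≡ incHead h → g ≡ h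
  incHead-injective {[]}    {[]}    _    = refl
  incHead-injective {_ ∷ _} {_ ∷ _} refl = refl

  compositions-unique : ∀ m k → Unique (compositions m k)
  compositions-unique m zero = [] ∷ []
  compositions-unique zero (suc k) = Unique.map⁺ ∷-injectiveʳ (compositions-unique zero k)
  compositions-unique (suc m) (suc k) =
    Unique.++⁺ (Unique.map⁺ ∷-injectiveʳ (compositions-unique (suc m) k))
               (Unique.map⁺ incHead-injective (compositions-unique m (suc k)))
               disjoint
    where
    disjoint : ∀ {v} → v ∈ map (0 ∷_) (compositions (suc m) k) × v ∈ map incHead (compositions m (suc k)) → ⊥
    disjoint (v∈₀ , v∈₁) with ∈-map⁻ (0 ∷_) v∈₀ | ∈-map⁻ incHead v∈₁
    ... | _ , _ , refl | []    , _ , ()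
    ... | _ , _ , refl | _ ∷ _ , _ , ()

  reverse-composition : ∀ {m k g} → IsComposition m k g → IsComposition m k (reverse g)
  reverse-composition {g = g} (l , s) = trans (length-reverse g) l , trans (sum-↭ (↭-reverse g)) s

  map-reverse-compositions : ∀ m k → map reverse (compositions m k) ↭ compositions m k
  map-reverse-compositions m k =
    unique-same-∈⇒↭ (Unique.map⁺ reverse-injective (compositions-unique m k)) (compositions-unique m k)
                    (mk⇔ to from)
    where
    complete : ∀ {g} → g ∈ compositions m k → reverse g ∈ compositions m k
    complete {g} g∈ = compositions-complete m k (reverse g) (reverse-composition {g = g} (All.lookup (compositions-sound m k) g∈))
    to : ∀ {g} → g ∈ map reverse (compositions m k) → g ∈ compositions m k
    to g∈ with h , h∈ , refl ← ∈-map⁻ reverse g∈ = complete h∈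
    from : ∀ {g} → g ∈ compositions m k → g ∈ map reverse (compositions m k)
    from {g} g∈ = subst (_∈ map reverse (compositions m k)) (reverse-involutive g) (∈-map⁺ reverse (complete g∈))

module Interleaving where

  open import Data.Bool using (Bool; true; false; not; if_then_else_)
  open import Data.Nat as ℕ using (ℕ; zero; suc)
  import Data.Nat.Properties as ℕ
  open import Data.Nat.ListAction using (sum)
  open import Data.Integer using (ℤ; +_; _+_; _*_; _^_)
  open import Data.Integer.Properties
    using (+-identityʳ; *-zeroʳ; *-identityˡ; *-identityʳ; *-distribˡ-+; +-comm; ^-distribˡ-+-*)
  open import Data.Integer.Tactic.RingSolver using (solve-∀)
  open import Data.List using (List; []; _∷_; map; _++_; length; replicate; reverse)
  open import Data.List.Properties
    using (++-assoc; reverse-++; unfold-reverse; length-reverse; reverse-involutive; reverse-map; length-map;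
           map-cong; length-replicate)
  open import Data.List.Relation.Unary.All as All using (All)
  open import Data.Maybe using (Maybe; just; nothing)
  open import Data.Product using (_×_; _,_; proj₁; proj₂)
  open import Relation.Binary.PropositionalEquality
  open Compositions
  open Lists
  open QBinomial

  pick : Bool → ℕ → ℕ
  pick b n = if b then n else 0

  pick-0 : ∀ b → pick b 0 ≡ 0
  pick-0 true  = refl
  pick-0 false = refl

  -- Words over Maybe A; nothing is a hole, standing for a fixed point.
  interleave : {A : Set} → List ℕ → List A → List (Maybe A)
  interleave []          u       = []
  interleave (zero ∷ g)  []      = []
  interleave (zero ∷ g)  (x ∷ u) = just x ∷ interleave g u
  interleave (suc s ∷ g) u       = nothing ∷ interleave (s ∷ g) u

  module _ {A : Set} where

    holes : ℕ → List (Maybe A)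
    holes n = replicate n nothing

    length-interleave : ∀ g (u : List A) → length g ≡ suc (length u) → length (interleave g u) ≡ sum g ℕ.+ length u
    length-interleave (zero ∷ [])  []      _ = refl
    length-interleave (zero ∷ g)   (x ∷ u) l =
      trans (cong suc (length-interleave g u (ℕ.suc-injective l))) (sym (ℕ.+-suc (sum g) (length u)))
    length-interleave (suc s ∷ g)  u       l = cong suc (length-interleave (s ∷ g) u l)

    length-interleave-composition : ∀ {m} (u : List A) g → IsComposition m (length u) g →
                                    length (interleave g u) ≡ m ℕ.+ length u
    length-interleave-composition u g (l , s) = trans (length-interleave g u l) (cong (ℕ._+ length u) s)

    interleave-∷ : ∀ n g (x : A) u → interleave (n ∷ g) (x ∷ u) ≡ holes n ++ just x ∷ interleave g u
    interleave-∷ zero    g x u = refl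
    interleave-∷ (suc n) g x u = cong (nothing ∷_) (interleave-∷ n g x u)

    interleave-holes : ∀ n → interleave (n ∷ []) [] ≡ holes n
    interleave-holes zero    = refl
    interleave-holes (suc n) = cong (nothing ∷_) (interleave-holes n)

    interleave-∷ʳ : ∀ g (u : List A) n x → length g ≡ suc (length u) →
                    interleave (g ++ n ∷ []) (u ++ x ∷ []) ≡ interleave g u ++ just x ∷ holes n
    interleave-∷ʳ (m ∷ []) [] n x _ = begin
      interleave (m ∷ n ∷ []) (x ∷ [])
        ≡⟨ interleave-∷ m (n ∷ []) x [] ⟩
      holes m ++ just x ∷ interleave (n ∷ []) []
        ≡⟨ cong₂ (λ s t → s ++ just x ∷ t) (sym (interleave-holes m)) (interleave-holes n) ⟩
      interleave (m ∷ []) [] ++ just x ∷ holes n ∎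
      where open ≡-Reasoning
    interleave-∷ʳ (m ∷ g) (y ∷ u) n x l = begin
      interleave (m ∷ g ++ n ∷ []) (y ∷ u ++ x ∷ [])
        ≡⟨ interleave-∷ m (g ++ n ∷ []) y (u ++ x ∷ []) ⟩
      holes m ++ just y ∷ interleave (g ++ n ∷ []) (u ++ x ∷ [])
        ≡⟨ cong (λ t → holes m ++ just y ∷ t) (interleave-∷ʳ g u n x (ℕ.suc-injective l)) ⟩
      holes m ++ just y ∷ interleave g u ++ just x ∷ holes n
        ≡⟨ ++-assoc (holes m) (just y ∷ interleave g u) (just x ∷ holes n) ⟨
      (holes m ++ just y ∷ interleave g u) ++ just x ∷ holes n
        ≡⟨ cong (_++ just x ∷ holes n) (interleave-∷ m g y u) ⟨
      interleave (m ∷ g) (y ∷ u) ++ just x ∷ holes n ∎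
      where open ≡-Reasoning

    reverse-holes : ∀ n → reverse (holes n) ≡ holes n
    reverse-holes zero    = refl
    reverse-holes (suc n) = begin
      reverse (nothing ∷ holes n)   ≡⟨ unfold-reverse nothing (holes n) ⟩
      reverse (holes n) ++ holes 1  ≡⟨ cong (_++ holes 1) (reverse-holes n) ⟩
      holes n ++ holes 1            ≡⟨ replicate-∷ʳ n ⟩
      holes (suc n)                 ∎
      where
      open ≡-Reasoning
      replicate-∷ʳ : ∀ n → holes n ++ holes 1 ≡ holes (suc n)
      replicate-∷ʳ zero    = refl
      replicate-∷ʳ (suc n) = cong (nothing ∷_) (replicate-∷ʳ n)

    reverse-interleave : ∀ g (u : List A) → length g ≡ suc (length u) →
                         reverse (interleave g u) ≡ interleave (reverse g) (reverse u)
    reverse-interleave (n ∷ []) [] _ = begin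
      reverse (interleave (n ∷ []) []) ≡⟨ cong reverse (interleave-holes n) ⟩
      reverse (holes n)                ≡⟨ reverse-holes n ⟩
      holes n                          ≡⟨ interleave-holes n ⟨
      interleave (n ∷ []) []           ∎
      where open ≡-Reasoning
    reverse-interleave (n ∷ g) (x ∷ u) l = begin
      reverse (interleave (n ∷ g) (x ∷ u))
        ≡⟨ cong reverse (interleave-∷ n g x u) ⟩
      reverse (holes n ++ just x ∷ interleave g u)
        ≡⟨ reverse-++ (holes n) (just x ∷ interleave g u) ⟩
      reverse (just x ∷ interleave g u) ++ reverse (holes n)
        ≡⟨ cong₂ _++_ (unfold-reverse (just x) (interleave g u)) (reverse-holes n) ⟩
      (reverse (interleave g u) ++ just x ∷ []) ++ holes n
        ≡⟨ ++-assoc (reverse (interleave g u)) (just x ∷ []) (holes n) ⟩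
      reverse (interleave g u) ++ just x ∷ holes n
        ≡⟨ cong (_++ just x ∷ holes n) (reverse-interleave g u l′) ⟩
      interleave (reverse g) (reverse u) ++ just x ∷ holes n
        ≡⟨ interleave-∷ʳ (reverse g) (reverse u) n x l″ ⟨
      interleave (reverse g ++ n ∷ []) (reverse u ++ x ∷ [])
        ≡⟨ cong₂ interleave (unfold-reverse n g) (unfold-reverse x u) ⟨
      interleave (reverse (n ∷ g)) (reverse (x ∷ u)) ∎
      where
      open ≡-Reasoning
      l′ : length g ≡ suc (length u)
      l′ = ℕ.suc-injective l
      l″ : length (reverse g) ≡ suc (length (reverse u))
      l″ = trans (length-reverse g) (trans l′ (cong suc (sym (length-reverse u))))

  module Major {A : Set} (descent : A → A → Bool) (exceeds : A → Bool) where

    descentᴹ : Maybe A → Maybe A → Bool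
    descentᴹ nothing  nothing  = false
    descentᴹ (just x) nothing  = exceeds x
    descentᴹ nothing  (just y) = not (exceeds y)
    descentᴹ (just x) (just y) = descent x y

    pmaj : ℕ → List (Maybe A) → ℕ
    pmaj i []          = 0
    pmaj i (a ∷ [])    = 0
    pmaj i (a ∷ b ∷ w) = pick (descentᴹ a b) i ℕ.+ pmaj (suc i) (b ∷ w)

    pmajʳ : List (Maybe A) → ℕ
    pmajʳ []          = 0
    pmajʳ (b ∷ [])    = 0
    pmajʳ (b ∷ a ∷ w) = pick (descentᴹ a b) (suc (length w)) ℕ.+ pmajʳ (a ∷ w)

    pmaj-∷ʳ : ∀ i r a b → pmaj i ((r ++ a ∷ []) ++ b ∷ []) ≡ pmaj i (r ++ a ∷ []) ℕ.+ pick (descentᴹ a b) (i ℕ.+ length r)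
    pmaj-∷ʳ i [] a b = trans (ℕ.+-identityʳ _) (cong (pick (descentᴹ a b)) (sym (ℕ.+-identityʳ i)))
    pmaj-∷ʳ i (c ∷ []) a b = begin
      pick (descentᴹ c a) i ℕ.+ (pick (descentᴹ a b) (suc i) ℕ.+ 0)
        ≡⟨ cong (pick (descentᴹ c a) i ℕ.+_) (trans (ℕ.+-identityʳ _) (cong (pick (descentᴹ a b)) (ℕ.+-comm 1 i))) ⟩
      pick (descentᴹ c a) i ℕ.+ pick (descentᴹ a b) (i ℕ.+ 1)
        ≡⟨ cong (ℕ._+ pick (descentᴹ a b) (i ℕ.+ 1)) (ℕ.+-identityʳ _) ⟨
      pick (descentᴹ c a) i ℕ.+ 0 ℕ.+ pick (descentᴹ a b) (i ℕ.+ 1) ∎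
      where open ≡-Reasoning
    pmaj-∷ʳ i (c ∷ d ∷ r) a b = begin
      pick (descentᴹ c d) i ℕ.+ pmaj (suc i) (((d ∷ r) ++ a ∷ []) ++ b ∷ [])
        ≡⟨ cong (pick (descentᴹ c d) i ℕ.+_) (pmaj-∷ʳ (suc i) (d ∷ r) a b) ⟩
      pick (descentᴹ c d) i ℕ.+ (pmaj (suc i) ((d ∷ r) ++ a ∷ []) ℕ.+ pick (descentᴹ a b) (suc i ℕ.+ suc (length r)))
        ≡⟨ ℕ.+-assoc (pick (descentᴹ c d) i) _ _ ⟨
      pick (descentᴹ c d) i ℕ.+ pmaj (suc i) ((d ∷ r) ++ a ∷ []) ℕ.+ pick (descentᴹ a b) (suc i ℕ.+ suc (length r))
        ≡⟨ cong (λ n → pick (descentᴹ c d) i ℕ.+ pmaj (suc i) ((d ∷ r) ++ a ∷ []) ℕ.+ pick (descentᴹ a b) n) (ℕ.+-suc i (suc (length r))) ⟨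
      pick (descentᴹ c d) i ℕ.+ pmaj (suc i) ((d ∷ r) ++ a ∷ []) ℕ.+ pick (descentᴹ a b) (i ℕ.+ suc (suc (length r)))
        ∎
      where open ≡-Reasoning

    pmajʳ≡pmaj-reverse : ∀ w → pmajʳ w ≡ pmaj 1 (reverse w)
    pmajʳ≡pmaj-reverse []          = refl
    pmajʳ≡pmaj-reverse (b ∷ [])    = refl
    pmajʳ≡pmaj-reverse (b ∷ a ∷ w) = begin
      pick (descentᴹ a b) (suc (length w)) ℕ.+ pmajʳ (a ∷ w)
        ≡⟨ cong (pick (descentᴹ a b) (suc (length w)) ℕ.+_) (pmajʳ≡pmaj-reverse (a ∷ w)) ⟩
      pick (descentᴹ a b) (suc (length w)) ℕ.+ pmaj 1 (reverse (a ∷ w))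
        ≡⟨ ℕ.+-comm (pick (descentᴹ a b) (suc (length w))) _ ⟩
      pmaj 1 (reverse (a ∷ w)) ℕ.+ pick (descentᴹ a b) (suc (length w))
        ≡⟨ cong₂ (λ v n → pmaj 1 v ℕ.+ pick (descentᴹ a b) (suc n)) (unfold-reverse a w) (sym (length-reverse w)) ⟩
      pmaj 1 (reverse w ++ a ∷ []) ℕ.+ pick (descentᴹ a b) (1 ℕ.+ length (reverse w))
        ≡⟨ pmaj-∷ʳ 1 (reverse w) a b ⟨
      pmaj 1 ((reverse w ++ a ∷ []) ++ b ∷ [])
        ≡⟨ cong (λ v → pmaj 1 (v ++ b ∷ [])) (unfold-reverse a w) ⟨
      pmaj 1 (reverse (a ∷ w) ++ b ∷ [])
        ≡⟨ cong (pmaj 1) (unfold-reverse b (a ∷ w)) ⟨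
      pmaj 1 (reverse (b ∷ a ∷ w))
        ∎
      where open ≡-Reasoning

    Compatible : A → A → Set
    Compatible x y = (exceeds x ≡ true → exceeds y ≡ false → descent x y ≡ true)
                   × (exceeds x ≡ false → exceeds y ≡ true → descent x y ≡ false)

    pmajʳ-holes : ∀ r → pmajʳ (holes r) ≡ 0
    pmajʳ-holes zero          = refl
    pmajʳ-holes (suc zero)    = refl
    pmajʳ-holes (suc (suc r)) = pmajʳ-holes (suc r)

    -- Induction along the reversed word: pmajʳ weights a descent by its distance from the
    -- end, so dropping the first entry leaves the other weights unchanged.  Interleavings
    -- are sorted by whether they start with a letter or a hole, and both parts have closed
    -- forms that add up by the two Pascal recurrences.
    module GeneratingFunction (compatible : ∀ x y → Compatible x y) (Q : ℤ) where

      weightʳ : List (Maybe A) → ℤ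
      weightʳ w = Q ^ pmajʳ w

      letterMajʳ : List A → ℕ
      letterMajʳ u = pmajʳ (map just u)

      interleavingSum : List A → ℕ → ℤ
      interleavingSum u r = ∑ (λ g → weightʳ (interleave g u)) (compositions r (length u))

      letterFirstSum : A → List A → ℕ → ℤ
      letterFirstSum x u r = ∑ (λ g → weightʳ (just x ∷ interleave g u)) (compositions r (length u))

      holeFirstSum : A → List A → ℕ → ℤ
      holeFirstSum x u zero    = + 0
      holeFirstSum x u (suc r) = ∑ (λ g → weightʳ (nothing ∷ interleave g (x ∷ u))) (compositions r (suc (length u)))

      weightʳ-incHead : ∀ g (v : List A) → weightʳ (interleave (incHead g) v) ≡ weightʳ (nothing ∷ interleave g v)
      weightʳ-incHead []      v = refl
      weightʳ-incHead (s ∷ g) v = refl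

      weightʳ-hole-incHead : ∀ g (v : List A) → weightʳ (nothing ∷ interleave (incHead g) v) ≡ weightʳ (nothing ∷ interleave g v)
      weightʳ-hole-incHead []      v = refl
      weightʳ-hole-incHead (s ∷ g) v = refl

      ∑-weightʳ-∷∷ : ∀ a b u m →
        ∑ (λ g → weightʳ (a ∷ b ∷ interleave g u)) (compositions m (length u))
          ≡ Q ^ pick (descentᴹ b a) (suc (m ℕ.+ length u)) * ∑ (λ g → weightʳ (b ∷ interleave g u)) (compositions m (length u))
      ∑-weightʳ-∷∷ a b u m =
        trans (∑-cong (All.map (λ {g} c → step g c) (compositions-sound m (length u))))
              (∑-*ˡ (Q ^ pick (descentᴹ b a) (suc (m ℕ.+ length u))) (λ g → weightʳ (b ∷ interleave g u)) (compositions m (length u)))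
        where
        step : ∀ g → IsComposition m (length u) g →
               weightʳ (a ∷ b ∷ interleave g u) ≡ Q ^ pick (descentᴹ b a) (suc (m ℕ.+ length u)) * weightʳ (b ∷ interleave g u)
        step g c = trans (^-distribˡ-+-* Q (pick (descentᴹ b a) (suc (length (interleave g u)))) _)
                         (cong (λ n → Q ^ pick (descentᴹ b a) (suc n) * weightʳ (b ∷ interleave g u))
                               (length-interleave-composition u g c))

      interleavingSum-split : ∀ x u r → interleavingSum (x ∷ u) r ≡ letterFirstSum x u r + holeFirstSum x u r
      interleavingSum-split x u zero =
        trans (∑-map (λ g → weightʳ (interleave g (x ∷ u))) (0 ∷_) (compositions 0 (length u))) (sym (+-identityʳ _))
      interleavingSum-split x u (suc r) =
        trans (∑-++ (λ g → weightʳ (interleave g (x ∷ u))) (map (0 ∷_) (compositions (suc r) (length u))) _)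
              (cong₂ _+_ (∑-map (λ g → weightʳ (interleave g (x ∷ u))) (0 ∷_) (compositions (suc r) (length u)))
                         (trans (∑-map (λ g → weightʳ (interleave g (x ∷ u))) incHead (compositions r (suc (length u))))
                                (cong sumℤ (map-cong (λ g → weightʳ-incHead g (x ∷ u)) (compositions r (suc (length u)))))))

      holeFirstSum-suc : ∀ x u r →
        holeFirstSum x u (suc r) ≡ Q ^ pick (exceeds x) (suc (r ℕ.+ length u)) * letterFirstSum x u r + holeFirstSum x u r
      holeFirstSum-suc x u zero =
        trans (∑-map (λ g → weightʳ (nothing ∷ interleave g (x ∷ u))) (0 ∷_) (compositions 0 (length u)))
              (trans (∑-weightʳ-∷∷ nothing (just x) u 0) (sym (+-identityʳ _)))
      holeFirstSum-suc x u (suc r) =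
        trans (∑-++ (λ g → weightʳ (nothing ∷ interleave g (x ∷ u))) (map (0 ∷_) (compositions (suc r) (length u))) _)
              (cong₂ _+_ (trans (∑-map (λ g → weightʳ (nothing ∷ interleave g (x ∷ u))) (0 ∷_) (compositions (suc r) (length u)))
                                (∑-weightʳ-∷∷ nothing (just x) u (suc r)))
                         (trans (∑-map (λ g → weightʳ (nothing ∷ interleave g (x ∷ u))) incHead (compositions r (suc (length u))))
                                (cong sumℤ (map-cong (λ g → weightʳ-hole-incHead g (x ∷ u)) (compositions r (suc (length u)))))))

      letterFirstSum-[] : ∀ x r → letterFirstSum x [] r ≡ Q ^ pick (not (exceeds x)) r
      letterFirstSum-[] x r = trans (+-identityʳ _) (cong (Q ^_) (pmajʳ-letter-holes r))
        where
        pmajʳ-letter-holes : ∀ r → pmajʳ (just x ∷ interleave (r ∷ []) []) ≡ pick (not (exceeds x)) r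
        pmajʳ-letter-holes zero    = sym (pick-0 (not (exceeds x)))
        pmajʳ-letter-holes (suc r) = begin
          pick (not (exceeds x)) (suc (length (interleave {A} (r ∷ []) []))) ℕ.+ pmajʳ (nothing ∷ interleave {A} (r ∷ []) [])
            ≡⟨ cong₂ (λ v w → pick (not (exceeds x)) (suc (length v)) ℕ.+ pmajʳ (nothing ∷ w)) (interleave-holes r) (interleave-holes r) ⟩
          pick (not (exceeds x)) (suc (length (holes {A} r))) ℕ.+ pmajʳ (holes {A} (suc r))
            ≡⟨ cong₂ (λ n m → pick (not (exceeds x)) (suc n) ℕ.+ m) (length-replicate r) (pmajʳ-holes (suc r)) ⟩
          pick (not (exceeds x)) (suc r) ℕ.+ 0
            ≡⟨ ℕ.+-identityʳ _ ⟩
          pick (not (exceeds x)) (suc r)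
            ∎
          where open ≡-Reasoning

      letterFirstSum-∷ : ∀ x y u r → letterFirstSum x (y ∷ u) r ≡
        Q ^ pick (descent y x) (suc (r ℕ.+ length u)) * letterFirstSum y u r
          + Q ^ pick (not (exceeds x)) (r ℕ.+ suc (length u)) * holeFirstSum y u r
      letterFirstSum-∷ x y u zero =
        trans (∑-map (λ g → weightʳ (just x ∷ interleave g (y ∷ u))) (0 ∷_) (compositions 0 (length u)))
              (trans (∑-weightʳ-∷∷ (just x) (just y) u 0)
                     (sym (trans (cong (_+_ (Q ^ pick (descent y x) (suc (length u)) * letterFirstSum y u 0))
                                        (*-zeroʳ (Q ^ pick (not (exceeds x)) (suc (length u)))))
                                  (+-identityʳ _))))
      letterFirstSum-∷ x y u (suc r) =
        trans (∑-++ (λ g → weightʳ (just x ∷ interleave g (y ∷ u))) (map (0 ∷_) (compositions (suc r) (length u))) _)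
              (cong₂ _+_ (trans (∑-map (λ g → weightʳ (just x ∷ interleave g (y ∷ u))) (0 ∷_) (compositions (suc r) (length u)))
                                (∑-weightʳ-∷∷ (just x) (just y) u (suc r)))
                         holeFirst)
        where
        step : ∀ g → IsComposition r (suc (length u)) g →
               weightʳ (just x ∷ interleave (incHead g) (y ∷ u))
                 ≡ Q ^ pick (not (exceeds x)) (suc r ℕ.+ suc (length u)) * weightʳ (nothing ∷ interleave g (y ∷ u))
        step (s ∷ g) c = trans (^-distribˡ-+-* Q (pick (not (exceeds x)) (suc (length (interleave (s ∷ g) (y ∷ u))))) _)
          (cong (λ n → Q ^ pick (not (exceeds x)) (suc n) * weightʳ (nothing ∷ interleave (s ∷ g) (y ∷ u)))
                (length-interleave-composition (y ∷ u) (s ∷ g) c))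
        holeFirst : ∑ (λ g → weightʳ (just x ∷ interleave g (y ∷ u))) (map incHead (compositions r (suc (length u))))
                      ≡ Q ^ pick (not (exceeds x)) (suc r ℕ.+ suc (length u)) * holeFirstSum y u (suc r)
        holeFirst = trans (∑-map (λ g → weightʳ (just x ∷ interleave g (y ∷ u))) incHead (compositions r (suc (length u))))
                          (trans (∑-cong (All.map (λ {g} → step g) (compositions-sound r (suc (length u)))))
                                 (∑-*ˡ (Q ^ pick (not (exceeds x)) (suc r ℕ.+ suc (length u))) (λ g → weightʳ (nothing ∷ interleave g (y ∷ u)))
                                       (compositions r (suc (length u)))))

      letterFirstClosed : Bool → ℕ → ℕ → ℤ
      letterFirstClosed true  k r = qbinom Q r k
      letterFirstClosed false k r = Q ^ r * qbinom Q r k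

      holeFirstClosed : Bool → ℕ → ℕ → ℤ
      holeFirstClosed b     k zero    = + 0
      holeFirstClosed true  k (suc r) = Q ^ suc k * qbinom Q r (suc k)
      holeFirstClosed false k (suc r) = qbinom Q r (suc k)

      private
        Q^suc-+ : ∀ r k → Q ^ suc (r ℕ.+ k) ≡ Q * (Q ^ r * Q ^ k)
        Q^suc-+ r k = cong (Q *_) (^-distribˡ-+-* Q r k)
        Q^+-suc : ∀ r k → Q ^ (r ℕ.+ suc k) ≡ Q ^ r * (Q * Q ^ k)
        Q^+-suc r k = ^-distribˡ-+-* Q r (suc k)

      holeFirstClosed-suc : ∀ b k m M →
        Q ^ pick b (suc (m ℕ.+ k)) * (M * letterFirstClosed b k m) + M * holeFirstClosed b k m ≡ M * holeFirstClosed b k (suc m)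
      holeFirstClosed-suc true k zero M = ring Q (Q ^ k) M
        where
        ring : ∀ Q K M → Q * K * (M * + 1) + M * + 0 ≡ M * (Q * K * + 1)
        ring = solve-∀
      holeFirstClosed-suc true k (suc m) M =
        trans (cong (λ z → z * (M * qbinom Q (suc m) k) + M * holeFirstClosed true k (suc m)) (Q^suc-+ (suc m) k))
        (ring Q (Q ^ suc m) (Q ^ k) M (qbinom Q (suc m) k) (qbinom Q m (suc k)))
        where
        ring : ∀ Q A K M P1 P0 → Q * (A * K) * (M * P1) + M * (Q * K * P0) ≡ M * (Q * K * (P0 + A * P1))
        ring = solve-∀
      holeFirstClosed-suc false k zero M = ring M
        where
        ring : ∀ M → + 1 * (M * (+ 1 * + 1)) + M * + 0 ≡ M * + 1
        ring = solve-∀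
      holeFirstClosed-suc false k (suc m) M = ring (Q ^ suc m) M (qbinom Q (suc m) k) (qbinom Q m (suc k))
        where
        ring : ∀ A M P1 P0 → + 1 * (M * (A * P1)) + M * P0 ≡ M * (P0 + A * P1)
        ring = solve-∀

      closed-sum : ∀ b k r → letterFirstClosed b k r + holeFirstClosed b k r ≡ qbinom Q r (suc k)
      closed-sum true  k zero    = refl
      closed-sum true  k (suc m) = trans (+-comm (qbinom Q (suc m) k) (Q ^ suc k * qbinom Q m (suc k))) (sym (qbinom-pascal′ Q m k))
      closed-sum false k zero    = refl
      closed-sum false k (suc m) = +-comm (Q ^ suc m * qbinom Q (suc m) k) (qbinom Q m (suc k))

      letterFirstClosed-∷-0 : ∀ a b c k M →
        Q ^ pick c (suc k) * (M * letterFirstClosed a k 0) + Q ^ pick (not b) (suc k) * (M * holeFirstClosed a k 0)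
          ≡ Q ^ pick c (suc k) * M * letterFirstClosed b (suc k) 0
      letterFirstClosed-∷-0 a b c k M = begin
        C * (M * letterFirstClosed a k 0) + D * (M * + 0)
          ≡⟨ cong (λ t → C * (M * t) + D * (M * + 0)) (letterFirstClosed-0 a k) ⟩
        C * (M * + 1) + D * (M * + 0)
          ≡⟨ ring C D M ⟩
        C * M * + 1
          ≡⟨ cong (C * M *_) (letterFirstClosed-0 b (suc k)) ⟨
        C * M * letterFirstClosed b (suc k) 0 ∎
        where
        open ≡-Reasoning
        C : ℤ
        C = Q ^ pick c (suc k)
        D : ℤ
        D = Q ^ pick (not b) (suc k)
        letterFirstClosed-0 : ∀ a k → letterFirstClosed a k 0 ≡ + 1
        letterFirstClosed-0 true  k = refl
        letterFirstClosed-0 false k = refl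
        ring : ∀ C D M → C * (M * + 1) + D * (M * + 0) ≡ C * M * + 1
        ring = solve-∀

      letterFirstClosed-∷-exceeding : ∀ a c k m → (a ≡ false → c ≡ false) → ∀ M →
        Q ^ pick c (suc (suc m ℕ.+ k)) * (M * letterFirstClosed a k (suc m))
          + Q ^ pick false (suc m ℕ.+ suc k) * (M * holeFirstClosed a k (suc m))
          ≡ Q ^ pick c (suc k) * M * letterFirstClosed true (suc k) (suc m)
      letterFirstClosed-∷-exceeding true false k m _ M =
        trans (ring Q (Q ^ k) M (qbinom Q (suc m) k) (qbinom Q m (suc k))) (cong (λ z → + 1 * M * z) (sym (qbinom-pascal′ Q m k)))
        where
        ring : ∀ Q K M P1 P0 → + 1 * (M * P1) + + 1 * (M * (Q * K * P0)) ≡ + 1 * M * (Q * K * P0 + P1)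
        ring = solve-∀
      letterFirstClosed-∷-exceeding true true k m _ M =
        trans (cong (λ z → z * (M * qbinom Q (suc m) k) + + 1 * (M * (Q ^ suc k * qbinom Q m (suc k)))) (Q^suc-+ (suc m) k))
              (ring Q (Q ^ k) M (Q ^ suc m) (qbinom Q (suc m) k) (qbinom Q m (suc k)))
        where
        ring : ∀ Q K M A P1 P0 → Q * (A * K) * (M * P1) + + 1 * (M * (Q * K * P0)) ≡ Q * K * M * (P0 + A * P1)
        ring = solve-∀
      letterFirstClosed-∷-exceeding false false k m _ M = ring M (Q ^ suc m) (qbinom Q (suc m) k) (qbinom Q m (suc k))
        where
        ring : ∀ M A P1 P0 → + 1 * (M * (A * P1)) + + 1 * (M * P0) ≡ + 1 * M * (P0 + A * P1)
        ring = solve-∀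
      letterFirstClosed-∷-exceeding false true k m forbidden M with () ← forbidden refl

      letterFirstClosed-∷-nonexceeding : ∀ a c k m → (a ≡ true → c ≡ true) → ∀ M →
        Q ^ pick c (suc (suc m ℕ.+ k)) * (M * letterFirstClosed a k (suc m))
          + Q ^ pick true (suc m ℕ.+ suc k) * (M * holeFirstClosed a k (suc m))
          ≡ Q ^ pick c (suc k) * M * letterFirstClosed false (suc k) (suc m)
      letterFirstClosed-∷-nonexceeding true true k m _ M =
        trans (cong₂ (λ y z → y * (M * qbinom Q (suc m) k) + z * (M * (Q ^ suc k * qbinom Q m (suc k))))
                     (Q^suc-+ (suc m) k) (Q^+-suc (suc m) k))
          (trans (ring Q (Q ^ k) M (Q ^ suc m) (qbinom Q (suc m) k) (qbinom Q m (suc k)))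
                 (cong (λ z → Q * Q ^ k * M * (Q ^ suc m * z)) (sym (qbinom-pascal′ Q m k))))
        where
        ring : ∀ Q K M A P1 P0 → Q * (A * K) * (M * P1) + A * (Q * K) * (M * (Q * K * P0))
                              ≡ Q * K * M * (A * (Q * K * P0 + P1))
        ring = solve-∀
      letterFirstClosed-∷-nonexceeding false false k m _ M =
        trans (cong (λ z → + 1 * (M * (Q ^ suc m * qbinom Q (suc m) k)) + z * (M * qbinom Q m (suc k))) (Q^+-suc (suc m) k))
          (trans (ring Q (Q ^ k) M (Q ^ suc m) (qbinom Q (suc m) k) (qbinom Q m (suc k)))
                 (cong (λ z → + 1 * M * (Q ^ suc m * z)) (sym (qbinom-pascal′ Q m k))))
        where
        ring : ∀ Q K M A P1 P0 → + 1 * (M * (A * P1)) + A * (Q * K) * (M * P0)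
                              ≡ + 1 * M * (A * (Q * K * P0 + P1))
        ring = solve-∀
      letterFirstClosed-∷-nonexceeding false true k m _ M =
        trans (cong₂ (λ y z → y * (M * (Q ^ suc m * qbinom Q (suc m) k)) + z * (M * qbinom Q m (suc k)))
                     (Q^suc-+ (suc m) k) (Q^+-suc (suc m) k))
              (ring Q (Q ^ k) M (Q ^ suc m) (qbinom Q (suc m) k) (qbinom Q m (suc k)))
        where
        ring : ∀ Q K M A P1 P0 → Q * (A * K) * (M * (A * P1)) + A * (Q * K) * (M * P0)
                              ≡ Q * K * M * (A * (P0 + A * P1))
        ring = solve-∀
      letterFirstClosed-∷-nonexceeding true false k m forced M with () ← forced refl

      letterFirstClosed-∷ : ∀ a b c k r → (a ≡ true → b ≡ false → c ≡ true) → (a ≡ false → b ≡ true → c ≡ false) → ∀ M →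
        Q ^ pick c (suc (r ℕ.+ k)) * (M * letterFirstClosed a k r) + Q ^ pick (not b) (r ℕ.+ suc k) * (M * holeFirstClosed a k r)
          ≡ Q ^ pick c (suc k) * M * letterFirstClosed b (suc k) r
      letterFirstClosed-∷ a b     c k zero    _      _         M = letterFirstClosed-∷-0 a b c k M
      letterFirstClosed-∷ a true  c k (suc m) _      forbidden M = letterFirstClosed-∷-exceeding a c k m (λ a≡f → forbidden a≡f refl) M
      letterFirstClosed-∷ a false c k (suc m) forced _         M = letterFirstClosed-∷-nonexceeding a c k m (λ a≡t → forced a≡t refl) M

      letterFirstClosed-[] : ∀ b r → Q ^ pick (not b) r ≡ + 1 * letterFirstClosed b 0 r
      letterFirstClosed-[] true r = cong (+ 1 *_) (sym (qbinom-0ʳ Q r))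
      letterFirstClosed-[] false r =
        trans (sym (*-identityʳ (Q ^ r))) (trans (cong (Q ^ r *_) (sym (qbinom-0ʳ Q r))) (sym (*-identityˡ _)))

      letterFirstSum-closed : ∀ x u r → letterFirstSum x u r ≡ Q ^ letterMajʳ (x ∷ u) * letterFirstClosed (exceeds x) (length u) r
      holeFirstSum-closed   : ∀ x u r → holeFirstSum x u r ≡ Q ^ letterMajʳ (x ∷ u) * holeFirstClosed (exceeds x) (length u) r

      holeFirstSum-closed x u zero    = sym (*-zeroʳ (Q ^ letterMajʳ (x ∷ u)))
      holeFirstSum-closed x u (suc r) = begin
        holeFirstSum x u (suc r)
          ≡⟨ holeFirstSum-suc x u r ⟩
        Q ^ pick (exceeds x) (suc (r ℕ.+ length u)) * letterFirstSum x u r + holeFirstSum x u r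
          ≡⟨ cong₂ (λ s t → Q ^ pick (exceeds x) (suc (r ℕ.+ length u)) * s + t) (letterFirstSum-closed x u r) (holeFirstSum-closed x u r) ⟩
        Q ^ pick (exceeds x) (suc (r ℕ.+ length u)) * (M * letterFirstClosed (exceeds x) (length u) r) + M * holeFirstClosed (exceeds x) (length u) r
          ≡⟨ holeFirstClosed-suc (exceeds x) (length u) r M ⟩
        M * holeFirstClosed (exceeds x) (length u) (suc r)
          ∎
        where
        open ≡-Reasoning
        M : ℤ
        M = Q ^ letterMajʳ (x ∷ u)

      letterFirstSum-closed x []      r = trans (letterFirstSum-[] x r) (letterFirstClosed-[] (exceeds x) r)
      letterFirstSum-closed x (y ∷ u) r = begin
        letterFirstSum x (y ∷ u) r
          ≡⟨ letterFirstSum-∷ x y u r ⟩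
        Q ^ pick (descent y x) (suc (r ℕ.+ length u)) * letterFirstSum y u r + Q ^ pick (not (exceeds x)) (r ℕ.+ suc (length u)) * holeFirstSum y u r
          ≡⟨ cong₂ (λ s t → Q ^ pick (descent y x) (suc (r ℕ.+ length u)) * s + Q ^ pick (not (exceeds x)) (r ℕ.+ suc (length u)) * t)
                   (letterFirstSum-closed y u r) (holeFirstSum-closed y u r) ⟩
        Q ^ pick (descent y x) (suc (r ℕ.+ length u)) * (M * letterFirstClosed (exceeds y) (length u) r)
          + Q ^ pick (not (exceeds x)) (r ℕ.+ suc (length u)) * (M * holeFirstClosed (exceeds y) (length u) r)
          ≡⟨ letterFirstClosed-∷ (exceeds y) (exceeds x) (descent y x) (length u) r (proj₁ (compatible y x)) (proj₂ (compatible y x)) M ⟩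
        Q ^ pick (descent y x) (suc (length u)) * M * letterFirstClosed (exceeds x) (suc (length u)) r
          ≡⟨ cong (λ n → Q ^ pick (descent y x) (suc n) * M * letterFirstClosed (exceeds x) (suc (length u)) r) (length-map just u) ⟨
        Q ^ pick (descent y x) (suc (length (map just u))) * M * letterFirstClosed (exceeds x) (suc (length u)) r
          ≡⟨ cong (_* letterFirstClosed (exceeds x) (suc (length u)) r) (^-distribˡ-+-* Q (pick (descent y x) (suc (length (map just u)))) _) ⟨
        Q ^ letterMajʳ (x ∷ y ∷ u) * letterFirstClosed (exceeds x) (suc (length u)) r
          ∎
        where
        open ≡-Reasoning
        M : ℤ
        M = Q ^ letterMajʳ (y ∷ u)

      interleavingSum-closed : ∀ u r → interleavingSum u r ≡ Q ^ letterMajʳ u * qbinom Q r (length u)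
      interleavingSum-closed []      r = begin
        Q ^ pmajʳ (interleave (r ∷ []) []) + + 0 ≡⟨ +-identityʳ _ ⟩
        Q ^ pmajʳ (interleave (r ∷ []) [])       ≡⟨ cong (λ w → Q ^ pmajʳ w) (interleave-holes r) ⟩
        Q ^ pmajʳ (holes r)                      ≡⟨ cong (Q ^_) (pmajʳ-holes r) ⟩
        + 1                                      ≡⟨ trans (*-identityˡ _) (qbinom-0ʳ Q r) ⟨
        + 1 * qbinom Q r 0                       ∎
        where open ≡-Reasoning
      interleavingSum-closed (x ∷ u) r = begin
        interleavingSum (x ∷ u) r
          ≡⟨ interleavingSum-split x u r ⟩
        letterFirstSum x u r + holeFirstSum x u r
          ≡⟨ cong₂ _+_ (letterFirstSum-closed x u r) (holeFirstSum-closed x u r) ⟩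
        M * letterFirstClosed (exceeds x) (length u) r + M * holeFirstClosed (exceeds x) (length u) r
          ≡⟨ *-distribˡ-+ M _ _ ⟨
        M * (letterFirstClosed (exceeds x) (length u) r + holeFirstClosed (exceeds x) (length u) r)
          ≡⟨ cong (M *_) (closed-sum (exceeds x) (length u) r) ⟩
        M * qbinom Q r (suc (length u))
          ∎
        where
        open ≡-Reasoning
        M : ℤ
        M = Q ^ letterMajʳ (x ∷ u)

      ∑-pmaj-interleave : ∀ m u → ∑ (λ g → Q ^ pmaj 1 (interleave g u)) (compositions m (length u))
                                   ≡ Q ^ pmaj 1 (map just u) * qbinom Q m (length u)
      ∑-pmaj-interleave m u = begin
        ∑ F (compositions m k)
          ≡⟨ ∑-↭ F (map-reverse-compositions m k) ⟨
        ∑ F (map reverse (compositions m k))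
          ≡⟨ ∑-map F reverse (compositions m k) ⟩
        ∑ (λ g → F (reverse g)) (compositions m k)
          ≡⟨ ∑-cong (All.map (λ {g} c → reversed g c) (compositions-sound m k)) ⟩
        ∑ (λ g → weightʳ (interleave g (reverse u))) (compositions m k)
          ≡⟨ cong (λ n → ∑ (λ g → weightʳ (interleave g (reverse u))) (compositions m n)) (length-reverse u) ⟨
        interleavingSum (reverse u) m
          ≡⟨ interleavingSum-closed (reverse u) m ⟩
        Q ^ letterMajʳ (reverse u) * qbinom Q m (length (reverse u))
          ≡⟨ cong₂ (λ a b → Q ^ a * qbinom Q m b) letterMajʳ-reverse (length-reverse u) ⟩
        Q ^ pmaj 1 (map just u) * qbinom Q m k
          ∎
        where
        open ≡-Reasoning
        k : ℕ
        k = length u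
        F : List ℕ → ℤ
        F = λ g → Q ^ pmaj 1 (interleave g u)
        reversed : ∀ g → IsComposition m k g → F (reverse g) ≡ weightʳ (interleave g (reverse u))
        reversed g (l , _) = cong (Q ^_) (begin
          pmaj 1 (interleave (reverse g) u)
            ≡⟨ cong (pmaj 1) (reverse-involutive (interleave (reverse g) u)) ⟨
          pmaj 1 (reverse (reverse (interleave (reverse g) u)))
            ≡⟨ pmajʳ≡pmaj-reverse (reverse (interleave (reverse g) u)) ⟨
          pmajʳ (reverse (interleave (reverse g) u))
            ≡⟨ cong pmajʳ (reverse-interleave (reverse g) u (trans (length-reverse g) l)) ⟩
          pmajʳ (interleave (reverse (reverse g)) (reverse u))
            ≡⟨ cong (λ h → pmajʳ (interleave h (reverse u))) (reverse-involutive g) ⟩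
          pmajʳ (interleave g (reverse u)) ∎)
        letterMajʳ-reverse : letterMajʳ (reverse u) ≡ pmaj 1 (map just u)
        letterMajʳ-reverse = begin
          pmajʳ (map just (reverse u))           ≡⟨ pmajʳ≡pmaj-reverse (map just (reverse u)) ⟩
          pmaj 1 (reverse (map just (reverse u))) ≡⟨ cong (λ w → pmaj 1 (reverse w)) (reverse-map just u) ⟩
          pmaj 1 (reverse (reverse (map just u))) ≡⟨ cong (pmaj 1) (reverse-involutive (map just u)) ⟩
          pmaj 1 (map just u)                     ∎

module SignedPermutations where

  open import Data.Bool using (Bool; true; _∧_)
  open import Data.Bool.Properties using (∧-conicalˡ; ∧-conicalʳ; T-≡)
  open import Data.Nat using (ℕ; zero; suc; _+_; _≤_; _<_; z≤n; s≤s; _≡ᵇ_)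
  open import Data.Nat.Properties using (suc-injective)
  open import Data.Integer using (ℤ; +_; -[1+_]; -_; ∣_∣)
  open import Data.List using (List; []; _∷_; map; length; upTo; concatMap)
  open import Data.List.Properties using (length-map; ∷-injectiveˡ; ∷-injectiveʳ)
  open import Data.List.Relation.Unary.All as All using (All; []; _∷_)
  import Data.List.Relation.Unary.All.Properties as All
  import Data.List.Relation.Unary.AllPairs as AllPairs
  import Data.List.Relation.Unary.AllPairs.Properties as AllPairs
  open import Data.List.Relation.Unary.Any as Any using (Any; here; there)
  open import Data.List.Membership.Propositional using (_∈_)
  open import Data.List.Membership.Propositional.Properties
    using (∈-upTo⁺; ∈-upTo⁻; ∈-map⁺; ∈-map⁻; ∈-concatMap⁺; ∈-filter⁺; ∈-filter⁻)
  open import Data.List.Relation.Binary.Permutation.Propositional using (_↭_)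
  import Data.List.Relation.Binary.Permutation.Propositional.Properties as ↭
  open import Data.List.Relation.Unary.Unique.Propositional using (Unique)
  import Data.List.Relation.Unary.Unique.Propositional.Properties as Unique
  open import Data.Product using (_,_; proj₂)
  open import Function using (_∘_)
  open import Function.Bundles using (Equivalence)
  open import Relation.Nullary.Decidable using (T?)
  open import Relation.Binary.PropositionalEquality
  open BooleanOrder
  open Counting
  open Ranges

  IsSignedPerm : ℕ → List ℤ → Set
  IsSignedPerm n π = map ∣_∣ π ↭ range 1 n

  length-signedPerm : ∀ {n π} → IsSignedPerm n π → length π ≡ n
  length-signedPerm {n} {π} sp = trans (sym (length-map ∣_∣ π)) (trans (↭.↭-length sp) (length-range 1 n))

  allᵇ⁻ : ∀ {A : Set} (p : A → Bool) xs → allᵇ p xs ≡ true → ∀ {x} → x ∈ xs → p x ≡ true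
  allᵇ⁻ p (y ∷ xs) h (here refl) = ∧-conicalˡ _ _ h
  allᵇ⁻ p (y ∷ xs) h (there x∈)  = allᵇ⁻ p xs (∧-conicalʳ _ _ h) x∈

  allᵇ⁺ : ∀ {A : Set} (p : A → Bool) xs → (∀ {x} → x ∈ xs → p x ≡ true) → allᵇ p xs ≡ true
  allᵇ⁺ p []       h = refl
  allᵇ⁺ p (y ∷ xs) h = cong₂ _∧_ (h (here refl)) (allᵇ⁺ p xs (h ∘ there))

  count-abs≡countᵇ : ∀ a π → count (λ x → ∣ x ∣ ≡ᵇ a) π ≡ countᵇ (_≡ᵇ a) (map ∣_∣ π)
  count-abs≡countᵇ a π = trans (count≡countᵇ _ π) (sym (countᵇ-map (_≡ᵇ a) ∣_∣ π))

  isSignedPerm⇒IsSignedPerm : ∀ n π → isSignedPerm n π ≡ true → IsSignedPerm n π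
  isSignedPerm⇒IsSignedPerm n π h =
    ↭-range-from-counts n 1 (map ∣_∣ π) (trans (length-map ∣_∣ π) (≡ᵇ-true⁻ (∧-conicalˡ _ _ h))) once
    where
    once : ∀ a → 1 ≤ a → a < 1 + n → countᵇ (_≡ᵇ a) (map ∣_∣ π) ≡ 1
    once (suc i) _ (s≤s i<n) = trans (sym (count-abs≡countᵇ (suc i) π))
      (≡ᵇ-true⁻ (allᵇ⁻ (λ i → count (λ x → ∣ x ∣ ≡ᵇ suc i) π ≡ᵇ 1) (upTo n) (∧-conicalʳ _ _ h) (∈-upTo⁺ i<n)))

  IsSignedPerm⇒isSignedPerm : ∀ n π → IsSignedPerm n π → isSignedPerm n π ≡ true
  IsSignedPerm⇒isSignedPerm n π sp = cong₂ _∧_ (≡ᵇ-true (length-signedPerm sp)) (allᵇ⁺ _ (upTo n) once)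
    where
    once : ∀ {i} → i ∈ upTo n → (count (λ x → ∣ x ∣ ≡ᵇ suc i) π ≡ᵇ 1) ≡ true
    once {i} i∈ = ≡ᵇ-true (begin
      count (λ x → ∣ x ∣ ≡ᵇ suc i) π
        ≡⟨ count-abs≡countᵇ (suc i) π ⟩
      countᵇ (_≡ᵇ suc i) (map ∣_∣ π)
        ≡⟨ countᵇ-↭ (_≡ᵇ suc i) sp ⟩
      countᵇ (_≡ᵇ suc i) (range 1 n)
        ≡⟨ countᵇ-≡ᵇ-unique (range-unique 1 n) (∈-range⁺ 1 n (s≤s z≤n) (s≤s (∈-upTo⁻ i∈))) ⟩
      1 ∎)
      where open ≡-Reasoning

  unique-concatMap : ∀ {A B : Set} (f : A → List B) {xs} → Unique xs → (∀ x → Unique (f x)) →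
                     (∀ {x y v} → v ∈ f x → v ∈ f y → x ≡ y) → Unique (concatMap f xs)
  unique-concatMap f uxs uf same =
    Unique.concat⁺ (All.map⁺ (All.tabulate λ {x} _ → uf x))
                   (AllPairs.map⁺ {f = f} (AllPairs.map (λ x≢y {v} (v∈fx , v∈fy) → x≢y (same v∈fx v∈fy)) uxs))

  words-unique : ∀ {al : List ℤ} m → Unique al → Unique (words m al)
  words-unique zero    ual = [] AllPairs.∷ AllPairs.[]
  words-unique {al} (suc m) ual = unique-concatMap (λ w → map (_∷ w) al) (words-unique m ual)
    (λ w → Unique.map⁺ ∷-injectiveˡ ual) same-tail
    where
    same-tail : ∀ {w w′ v} → v ∈ map (_∷ w) al → v ∈ map (_∷ w′) al → w ≡ w′
    same-tail v∈ v∈′ with _ , _ , refl ← ∈-map⁻ _ v∈ | _ , _ , e ← ∈-map⁻ _ v∈′ = ∷-injectiveʳ e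

  ∈-words : ∀ {al : List ℤ} m w → length w ≡ m → All (_∈ al) w → w ∈ words m al
  ∈-words zero    []      _ []         = here refl
  ∈-words (suc m) (x ∷ w) l (x∈ ∷ w∈) =
    ∈-concatMap⁺ (λ v → map (_∷ v) _) (Any.map (λ { refl → ∈-map⁺ (_∷ w) x∈ }) (∈-words m w (suc-injective l) w∈))

  signedLetters-unique : ∀ n → Unique (signedLetters n)
  signedLetters-unique n = unique-concatMap (λ i → + suc i ∷ - (+ suc i) ∷ []) (Unique.upTo⁺ n)
    (λ i → ((λ ()) ∷ []) AllPairs.∷ [] AllPairs.∷ AllPairs.[]) same-letter
    where
    same-letter : ∀ {i j v} → v ∈ + suc i ∷ - (+ suc i) ∷ [] → v ∈ + suc j ∷ - (+ suc j) ∷ [] → i ≡ j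
    same-letter (here refl)         (here refl)         = refl
    same-letter (there (here refl)) (there (here refl)) = refl
    same-letter (here refl)         (there (here ()))
    same-letter (there (here refl)) (here ())

  ∈-signedLetters : ∀ n x → ∣ x ∣ ∈ range 1 n → x ∈ signedLetters n
  ∈-signedLetters n x ∣x∣∈ with ∈-range⁻ 1 n ∣x∣∈
  ∈-signedLetters n (+ suc a)  _ | _ , s≤s a<n =
    ∈-concatMap⁺ (λ i → + suc i ∷ - (+ suc i) ∷ []) (Any.map (λ { refl → here refl }) (∈-upTo⁺ a<n))
  ∈-signedLetters n -[1+ a ]   _ | _ , s≤s a<n =
    ∈-concatMap⁺ (λ i → + suc i ∷ - (+ suc i) ∷ []) (Any.map (λ { refl → there (here refl) }) (∈-upTo⁺ a<n))

  ∈-B⁺ : ∀ {n π} → IsSignedPerm n π → π ∈ B n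
  ∈-B⁺ {n} {π} sp = ∈-filter⁺ (T? ∘ isSignedPerm n) π∈words (Equivalence.from T-≡ (IsSignedPerm⇒isSignedPerm n π sp))
    where
    π∈words : π ∈ words n (signedLetters n)
    π∈words = ∈-words n π (length-signedPerm sp)
      (All.tabulate λ x∈ → ∈-signedLetters n _ (↭.∈-resp-↭ sp (∈-map⁺ ∣_∣ x∈)))

  ∈-B⁻ : ∀ {n π} → π ∈ B n → IsSignedPerm n π
  ∈-B⁻ {n} {π} π∈ = isSignedPerm⇒IsSignedPerm n π
    (Equivalence.to T-≡ (proj₂ (∈-filter⁻ (T? ∘ isSignedPerm n) {xs = words n (signedLetters n)} π∈)))

  B-unique : ∀ n → Unique (B n)
  B-unique n = Unique.filter⁺ (T? ∘ isSignedPerm n) (words-unique n (signedLetters-unique n))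

module SignedOrder where

  open import Data.Bool using (Bool; true; false; not; if_then_else_; _∧_)
  open import Data.Bool.Properties using (not-injective; ∨-identityʳ)
  open import Data.Nat using (ℕ; zero; suc; _≤_; _<_; _<ᵇ_; _≤ᵇ_)
  open import Data.Integer using (ℤ; +_; -[1+_]; -_; ∣_∣)
  open import Relation.Binary.PropositionalEquality
  open BooleanOrder

  +<ᶻ+-true : ∀ {a b} → a < b → ((+ a) <ᶻ (+ b)) ≡ true
  +<ᶻ+-true a<b = cong not (≤ᵇ-false a<b)

  +<ᶻ+-false : ∀ {a b} → b ≤ a → ((+ a) <ᶻ (+ b)) ≡ false
  +<ᶻ+-false b≤a = cong not (≤ᵇ-true b≤a)

  +<ᶻ+-true⁻ : ∀ {a b} → ((+ a) <ᶻ (+ b)) ≡ true → a < b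
  +<ᶻ+-true⁻ e = ≤ᵇ-false⁻ (not-injective e)

  +<ᶻ+-false⁻ : ∀ {a b} → ((+ a) <ᶻ (+ b)) ≡ false → b ≤ a
  +<ᶻ+-false⁻ e = ≤ᵇ-true⁻ (not-injective e)

  tiebreak : Bool → Bool → Bool → Bool
  tiebreak true  false _ = true
  tiebreak false true  _ = false
  tiebreak _     _     c = c

  ≺-via-abs : ∀ x y → (y ≺ x) ≡ tiebreak (isNeg y) (isNeg x) (∣ y ∣ <ᵇ ∣ x ∣)
  ≺-via-abs (+ a)    (+ b)    = not-≤ᵇ a b
  ≺-via-abs (+ a)    -[1+ b ] = refl
  ≺-via-abs -[1+ a ] (+ b)    = refl
  ≺-via-abs -[1+ a ] -[1+ b ] = ∨-identityʳ (b <ᵇ a)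

  <ᶻ-via-abs : ∀ x y →
    (y <ᶻ x) ≡ tiebreak (isNeg y) (isNeg x) (if isNeg y then ∣ x ∣ <ᵇ ∣ y ∣ else ∣ y ∣ <ᵇ ∣ x ∣)
  <ᶻ-via-abs (+ a)    (+ b)    = not-≤ᵇ a b
  <ᶻ-via-abs (+ a)    -[1+ b ] = refl
  <ᶻ-via-abs -[1+ a ] (+ b)    = refl
  <ᶻ-via-abs -[1+ a ] -[1+ b ] = not-≤ᵇ b a

  +<ᶻ-via-abs : ∀ P t → ((+ P) <ᶻ t) ≡ not (isNeg t) ∧ (P <ᵇ ∣ t ∣)
  +<ᶻ-via-abs P (+ b)    = not-≤ᵇ b P
  +<ᶻ-via-abs P -[1+ a ] = refl

  withSignOf : ℤ → ℕ → ℤ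
  withSignOf x r = if isNeg x then - (+ r) else + r

  withSignOf-cong : ∀ x y r → isNeg x ≡ isNeg y → withSignOf x r ≡ withSignOf y r
  withSignOf-cong x y r = cong (λ b → if b then - (+ r) else + r)

  isNeg-withSignOf : ∀ x {r} → 1 ≤ r → isNeg (withSignOf x r) ≡ isNeg x
  isNeg-withSignOf (+ a)    {suc r} _ = refl
  isNeg-withSignOf -[1+ a ] {suc r} _ = refl

  ∣withSignOf∣ : ∀ x r → ∣ withSignOf x r ∣ ≡ r
  ∣withSignOf∣ (+ a)    r       = refl
  ∣withSignOf∣ -[1+ a ] zero    = refl
  ∣withSignOf∣ -[1+ a ] (suc r) = refl

  withSignOf-∣∣ : ∀ x → withSignOf x ∣ x ∣ ≡ x
  withSignOf-∣∣ (+ a)    = refl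
  withSignOf-∣∣ -[1+ a ] = refl

module FixedPoints where

  open import Data.Bool using (Bool; true; false; not; if_then_else_)
  open import Data.Nat as ℕ using (ℕ; zero; suc; _≤_)
  import Data.Nat.Properties as ℕ
  open import Data.Integer as ℤ using (ℤ; +_; -[1+_]; ∣_∣)
  open import Data.List using (List; []; _∷_; map; filterᵇ)
  open import Data.Maybe using (Maybe; just; nothing)
  open import Data.Product using (_×_; _,_; proj₂; ∃₂)
  open import Data.Sum using (inj₁; inj₂)
  open import Data.Unit using (⊤)
  open import Data.Empty using (⊥-elim)
  open import Relation.Nullary using (yes; no)
  open import Relation.Binary.Definitions using (tri<; tri≈; tri>)
  open import Relation.Binary.PropositionalEquality
  open SignedOrder
  open Compositions using (incHead)
  open Interleaving

  isFixed-true⁻ : ∀ i x → isFixed (i , x) ≡ true → x ≡ + i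
  isFixed-true⁻ i x h with x ℤ.≟ + i
  ... | yes x≡i = x≡i

  isFixed-refl : ∀ i → isFixed (i , + i) ≡ true
  isFixed-refl i with + i ℤ.≟ + i
  ... | yes _   = refl
  ... | no  i≢i = ⊥-elim (i≢i refl)

  isFixed-false : ∀ i x → x ≢ + i → isFixed (i , x) ≡ false
  isFixed-false i x x≢i with x ℤ.≟ + i
  ... | yes x≡i = ⊥-elim (x≢i x≡i)
  ... | no  _   = refl

  isFixed-false⁻ : ∀ i x → isFixed (i , x) ≡ false → x ≢ + i
  isFixed-false⁻ i x h refl with () ← trans (sym h) (isFixed-refl i)

  -- An entry of a word as (position, value).
  Letter : Set
  Letter = ℕ × ℤ

  exceeds : Letter → Bool
  exceeds (j , t) = (+ j) <ᶻ t

  -- When exactly one of two adjacent non-fixed entries exceeds its position, y ≺ x is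
  -- forced (see ≺-letters below); building this into the relation makes every pair of
  -- letters compatible.
  descentᴸ : Letter → Letter → Bool
  descentᴸ x y = tiebreak (exceeds x) (exceeds y) (proj₂ y ≺ proj₂ x)

  open Major descentᴸ exceeds public

  compatibleᴸ : ∀ x y → Compatible x y
  compatibleᴸ x y = forced , forbidden
    where
    forced : exceeds x ≡ true → exceeds y ≡ false → descentᴸ x y ≡ true
    forced ex ey rewrite ex | ey = refl
    forbidden : exceeds x ≡ false → exceeds y ≡ true → descentᴸ x y ≡ false
    forbidden ex ey rewrite ex | ey = refl

  view : ℕ → ℤ → Maybe Letter
  view i x = if isFixed (i , x) then nothing else just (i , x)

  holeView : ℕ → List ℤ → List (Maybe Letter)
  holeView i []      = []
  holeView i (x ∷ π) = view i x ∷ holeView (suc i) π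

  -- A word is determined by its letters, the entries that are not fixed points, and its
  -- gaps, the lengths of the runs of fixed points before, between and after them.
  gaps : ℕ → List ℤ → List ℕ
  gaps i []      = 0 ∷ []
  gaps i (x ∷ π) = if isFixed (i , x) then incHead (gaps (suc i) π) else 0 ∷ gaps (suc i) π

  letters : ℕ → List ℤ → List Letter
  letters i π = filterᵇ (λ p → not (isFixed p)) (withPosFrom i π)

  fill : ℕ → List ℕ → List ℤ → List ℤ
  fill i []          τ       = []
  fill i (zero ∷ g)  []      = []
  fill i (zero ∷ g)  (t ∷ τ) = t ∷ fill (suc i) g τ
  fill i (suc s ∷ g) τ       = + i ∷ fill (suc i) (s ∷ g) τ

  gaps-nonempty : ∀ i π → ∃₂ λ s g → gaps i π ≡ s ∷ g
  gaps-nonempty i []      = 0 , [] , refl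
  gaps-nonempty i (x ∷ π) with isFixed (i , x)
  ... | true  with s , g , e ← gaps-nonempty (suc i) π = suc s , g , cong incHead e
  ... | false = 0 , gaps (suc i) π , refl

  interleave-gaps-letters : ∀ i π → interleave (gaps i π) (letters i π) ≡ holeView i π
  interleave-gaps-letters i []      = refl
  interleave-gaps-letters i (x ∷ π) with isFixed (i , x)
  ... | false = cong (just (i , x) ∷_) (interleave-gaps-letters (suc i) π)
  ... | true  with s , g , e ← gaps-nonempty (suc i) π rewrite e =
    cong (nothing ∷_) (trans (cong (λ h → interleave h (letters (suc i) π)) (sym e)) (interleave-gaps-letters (suc i) π))

  fill-gaps-letters : ∀ i π → fill i (gaps i π) (map proj₂ (letters i π)) ≡ π
  fill-gaps-letters i []      = refl
  fill-gaps-letters i (x ∷ π) with isFixed (i , x) in fixed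
  ... | false = cong (x ∷_) (fill-gaps-letters (suc i) π)
  ... | true  with s , g , e ← gaps-nonempty (suc i) π rewrite e =
    cong₂ _∷_ (sym (isFixed-true⁻ i x fixed))
              (trans (cong (λ h → fill (suc i) h (map proj₂ (letters (suc i) π))) (sym e)) (fill-gaps-letters (suc i) π))

  ≺-fixed-fixed : ∀ i → ((+ suc i) ≺ (+ i)) ≡ false
  ≺-fixed-fixed i = +<ᶻ+-false (ℕ.n≤1+n i)

  ≺-fixed-letter : ∀ i y → i ≢ ∣ y ∣ → y ≢ + suc i → (y ≺ (+ i)) ≡ not (exceeds (suc i , y))
  ≺-fixed-letter i -[1+ b ] _ _ = refl
  ≺-fixed-letter i (+ b) i≢b y≢i+1 with ℕ.<-cmp b i
  ... | tri< b<i _ _ = trans (+<ᶻ+-true b<i) (sym (cong not (+<ᶻ+-false (ℕ.m≤n⇒m≤1+n (ℕ.<⇒≤ b<i)))))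
  ... | tri≈ _ b≡i _ = ⊥-elim (i≢b (sym b≡i))
  ... | tri> _ _ i<b with ℕ.m≤n⇒m<n∨m≡n i<b
  ...   | inj₁ i+1<b = trans (+<ᶻ+-false (ℕ.<⇒≤ i<b)) (sym (cong not (+<ᶻ+-true i+1<b)))
  ...   | inj₂ i+1≡b = ⊥-elim (y≢i+1 (cong +_ (sym i+1≡b)))

  ≺-letter-fixed : ∀ i x → ∣ x ∣ ≢ suc i → x ≢ + i → ((+ suc i) ≺ x) ≡ exceeds (i , x)
  ≺-letter-fixed i -[1+ a ] _ _ = refl
  ≺-letter-fixed i (+ a) a≢i+1 x≢i with ℕ.<-cmp a i
  ... | tri< a<i _ _ = trans (+<ᶻ+-false (ℕ.m≤n⇒m≤1+n (ℕ.<⇒≤ a<i))) (sym (+<ᶻ+-false (ℕ.<⇒≤ a<i)))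
  ... | tri≈ _ a≡i _ = ⊥-elim (x≢i (cong +_ a≡i))
  ... | tri> _ _ i<a with ℕ.m≤n⇒m<n∨m≡n i<a
  ...   | inj₁ i+1<a = trans (+<ᶻ+-true i+1<a) (sym (+<ᶻ+-true i<a))
  ...   | inj₂ i+1≡a = ⊥-elim (a≢i+1 (sym i+1≡a))

  ≺-letters : ∀ i x y → x ≢ + i → y ≢ + suc i → (y ≺ x) ≡ descentᴸ (i , x) (suc i , y)
  ≺-letters i (+ a) (+ b) x≢i y≢i+1 with (+ i) <ᶻ (+ a) in i<a | (+ suc i) <ᶻ (+ b) in i+1<b
  ... | true  | true  = refl
  ... | false | false = refl
  ... | true  | false = +<ᶻ+-true {b} {a} (ℕ.≤-<-trans b≤i (+<ᶻ+-true⁻ {i} {a} i<a))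
    where
    b≤i : b ≤ i
    b≤i with ℕ.m≤n⇒m<n∨m≡n (+<ᶻ+-false⁻ {suc i} {b} i+1<b)
    ... | inj₁ b<i+1 = ℕ.≤-pred b<i+1
    ... | inj₂ b≡i+1 = ⊥-elim (y≢i+1 (cong +_ b≡i+1))
  ... | false | true  =
    +<ᶻ+-false {b} {a} (ℕ.<⇒≤ (ℕ.≤-<-trans (+<ᶻ+-false⁻ {i} {a} i<a) (ℕ.<-trans (ℕ.n<1+n i) (+<ᶻ+-true⁻ {suc i} {b} i+1<b))))
  ≺-letters i (+ a) -[1+ b ] _ _ with (+ i) <ᶻ (+ a)
  ... | true  = refl
  ... | false = refl
  ≺-letters i -[1+ a ] (+ b) _ _ with (+ suc i) <ᶻ (+ b)
  ... | true  = refl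
  ... | false = refl
  ≺-letters i -[1+ a ] -[1+ b ] _ _ = refl

  ≺-adjacent : ∀ i x y → ∣ x ∣ ≢ ∣ y ∣ → (y ≺ x) ≡ descentᴹ (view i x) (view (suc i) y)
  ≺-adjacent i x y ∣x∣≢∣y∣ with isFixed (i , x) in fx | isFixed (suc i , y) in fy
  ... | true  | true  rewrite isFixed-true⁻ i x fx | isFixed-true⁻ (suc i) y fy = ≺-fixed-fixed i
  ... | true  | false rewrite isFixed-true⁻ i x fx = ≺-fixed-letter i y ∣x∣≢∣y∣ (isFixed-false⁻ (suc i) y fy)
  ... | false | true  rewrite isFixed-true⁻ (suc i) y fy = ≺-letter-fixed i x ∣x∣≢∣y∣ (isFixed-false⁻ i x fx)
  ... | false | false = ≺-letters i x y (isFixed-false⁻ i x fx) (isFixed-false⁻ (suc i) y fy)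

  AdjacentDistinct : List ℤ → Set
  AdjacentDistinct []          = ⊤
  AdjacentDistinct (x ∷ [])    = ⊤
  AdjacentDistinct (x ∷ y ∷ π) = ∣ x ∣ ≢ ∣ y ∣ × AdjacentDistinct (y ∷ π)

  majFrom≡pmaj-holeView : ∀ i π → AdjacentDistinct π → majFrom i π ≡ pmaj i (holeView i π)
  majFrom≡pmaj-holeView i []          _ = refl
  majFrom≡pmaj-holeView i (x ∷ [])    _ = refl
  majFrom≡pmaj-holeView i (x ∷ y ∷ π) (∣x∣≢∣y∣ , d) =
    cong₂ ℕ._+_ (cong (λ b → pick b i) (≺-adjacent i x y ∣x∣≢∣y∣)) (majFrom≡pmaj-holeView (suc i) (y ∷ π) d)

module Standardisation where

  open import Data.Bool using (Bool; true; false; not; if_then_else_; _∧_)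
  open import Data.Bool.Properties using (not-injective)
  open import Data.Nat as ℕ using (ℕ; zero; suc; _≤_; _<_; z≤n; s≤s; _≤ᵇ_; _<ᵇ_)
  import Data.Nat.Properties as ℕ
  open import Data.Integer.Properties using (+-injective)
  open import Data.Integer as ℤ using (ℤ; +_; -[1+_]; ∣_∣)
  open import Data.List using (List; []; _∷_; map; _++_; length; filterᵇ)
  open import Data.Nat.ListAction using (sum)
  open import Data.List.Properties using (length-map; map-++; map-∘; map-cong; map-cong-local; map-id-local; ∷-injective)
  open import Data.List.Relation.Unary.All as All using (All; []; _∷_)
  open import Data.List.Relation.Unary.AllPairs using (AllPairs; []; _∷_)
  open import Data.List.Relation.Unary.Any using (here; there)
  open import Data.List.Membership.Propositional using (_∈_)
  open import Data.List.Membership.Propositional.Properties using (∈-map⁺; ∈-map⁻)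
  open import Data.List.Relation.Binary.Permutation.Propositional
    using (_↭_; ↭-sym; module PermutationReasoning)
  import Data.List.Relation.Binary.Permutation.Propositional.Properties as ↭
  open import Data.Maybe as Maybe using (Maybe; just; nothing)
  open import Data.Product using (_×_; _,_; proj₁; proj₂; ∃)
  open import Data.Sum using (_⊎_; inj₁; inj₂)
  open import Data.Unit using (⊤)
  open import Function using (_∘_)
  open import Relation.Binary.PropositionalEquality
  open Lists using (filterᵇ-partition-↭; filterᵇ-all; ++-cancelˡ-↭)
  open Ranks
  open Counting
  open Ranges
  open SignedOrder
  open SignedPermutations
  open Compositions using (incHead)
  open Interleaving using (interleave; pick)
  open FixedPoints

  map-proj₂-withPosFrom : ∀ i π → map proj₂ (withPosFrom i π) ≡ π
  map-proj₂-withPosFrom i []      = refl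
  map-proj₂-withPosFrom i (x ∷ π) = cong (x ∷_) (map-proj₂-withPosFrom (suc i) π)

  map-proj₁-withPosFrom : ∀ i π → map proj₁ (withPosFrom i π) ≡ range i (length π)
  map-proj₁-withPosFrom i []      = refl
  map-proj₁-withPosFrom i (x ∷ π) = cong (i ∷_) (map-proj₁-withPosFrom (suc i) π)

  length-withPosFrom : ∀ i π → length (withPosFrom i π) ≡ length π
  length-withPosFrom i []      = refl
  length-withPosFrom i (x ∷ π) = cong suc (length-withPosFrom (suc i) π)

  fixedPoints : ℕ → List ℤ → List Letter
  fixedPoints i π = filterᵇ isFixed (withPosFrom i π)

  letterPositions : ℕ → List ℤ → List ℕ
  letterPositions i π = map proj₁ (letters i π)

  letterValues : ℕ → List ℤ → List ℤ
  letterValues i π = map proj₂ (letters i π)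

  abs↭fixedPoints++letterValues : ∀ i π → map ∣_∣ π ↭ map proj₁ (fixedPoints i π) ++ map ∣_∣ (letterValues i π)
  abs↭fixedPoints++letterValues i π = begin
    map ∣_∣ π                                          ≡⟨ cong (map ∣_∣) (map-proj₂-withPosFrom i π) ⟨
    map ∣_∣ (map proj₂ W)                              ≡⟨ map-∘ W ⟨
    map (∣_∣ ∘ proj₂) W                                ↭⟨ ↭.map⁺ (∣_∣ ∘ proj₂) (filterᵇ-partition-↭ isFixed W) ⟩
    map (∣_∣ ∘ proj₂) (fixedPoints i π ++ letters i π) ≡⟨ map-++ (∣_∣ ∘ proj₂) (fixedPoints i π) (letters i π) ⟩
    map (∣_∣ ∘ proj₂) (fixedPoints i π) ++ map (∣_∣ ∘ proj₂) (letters i π)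
      ≡⟨ cong₂ _++_ (sym (map-cong-local (All.map fixed-abs (filterᵇ-all isFixed W)))) (map-∘ (letters i π)) ⟩
    map proj₁ (fixedPoints i π) ++ map ∣_∣ (letterValues i π) ∎
    where
    open PermutationReasoning
    W : List Letter
    W = withPosFrom i π
    fixed-abs : ∀ {p : Letter} → isFixed p ≡ true → proj₁ p ≡ ∣ proj₂ p ∣
    fixed-abs {j , x} e rewrite isFixed-true⁻ j x e = refl

  range↭fixedPoints++letterPositions : ∀ i π → range i (length π) ↭ map proj₁ (fixedPoints i π) ++ letterPositions i π
  range↭fixedPoints++letterPositions i π = begin
    range i (length π)                         ≡⟨ map-proj₁-withPosFrom i π ⟨
    map proj₁ (withPosFrom i π)                ↭⟨ ↭.map⁺ proj₁ (filterᵇ-partition-↭ isFixed (withPosFrom i π)) ⟩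
    map proj₁ (fixedPoints i π ++ letters i π) ≡⟨ map-++ proj₁ (fixedPoints i π) (letters i π) ⟩
    map proj₁ (fixedPoints i π) ++ letterPositions i π ∎
    where open PermutationReasoning

  -- The fixed points account for the same positions and absolute values, so the
  -- remaining letters occupy exactly the positions their absolute values range over.
  abs-letterValues↭letterPositions : ∀ {n π} → IsSignedPerm n π → map ∣_∣ (letterValues 1 π) ↭ letterPositions 1 π
  abs-letterValues↭letterPositions {n} {π} sp = ++-cancelˡ-↭ (map proj₁ (fixedPoints 1 π)) (begin
    map proj₁ (fixedPoints 1 π) ++ map ∣_∣ (letterValues 1 π) ↭⟨ ↭-sym (abs↭fixedPoints++letterValues 1 π) ⟩
    map ∣_∣ π                                                 ↭⟨ sp ⟩
    range 1 n                                                 ≡⟨ cong (range 1) (length-signedPerm sp) ⟨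
    range 1 (length π)                                        ↭⟨ range↭fixedPoints++letterPositions 1 π ⟩
    map proj₁ (fixedPoints 1 π) ++ letterPositions 1 π        ∎)
    where open PermutationReasoning

  letters-∷ : ∀ i x π → letters i (x ∷ π) ≡ (if isFixed (i , x) then letters (suc i) π else (i , x) ∷ letters (suc i) π)
  letters-∷ i x π with isFixed (i , x)
  ... | true  = refl
  ... | false = refl

  letterPositions-≥ : ∀ i π → All (i ≤_) (letterPositions i π)
  letterPositions-≥ i []      = []
  letterPositions-≥ i (x ∷ π) rewrite letters-∷ i x π with isFixed (i , x)
  ... | true  = All.map ℕ.<⇒≤ (letterPositions-≥ (suc i) π)
  ... | false = ℕ.≤-refl ∷ All.map ℕ.<⇒≤ (letterPositions-≥ (suc i) π)

  letterPositions-increasing : ∀ i π → AllPairs _<_ (letterPositions i π)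
  letterPositions-increasing i []      = []
  letterPositions-increasing i (x ∷ π) rewrite letters-∷ i x π with isFixed (i , x)
  ... | true  = letterPositions-increasing (suc i) π
  ... | false = letterPositions-≥ (suc i) π ∷ letterPositions-increasing (suc i) π

  -- The positions, counted from i, of the letters of fill i g τ.
  positions : ℕ → List ℕ → List ℕ
  positions i []          = []
  positions i (zero ∷ []) = []
  positions i (zero ∷ s ∷ g) = i ∷ positions (suc i) (s ∷ g)
  positions i (suc s ∷ g) = positions (suc i) (s ∷ g)

  letterPositions≡positions-gaps : ∀ i π → letterPositions i π ≡ positions i (gaps i π)
  letterPositions≡positions-gaps i []      = refl
  letterPositions≡positions-gaps i (x ∷ π) rewrite letters-∷ i x π with isFixed (i , x)
  ... | true  with s , g , e ← gaps-nonempty (suc i) π rewrite e =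
    trans (letterPositions≡positions-gaps (suc i) π) (cong (positions (suc i)) e)
  ... | false with s , g , e ← gaps-nonempty (suc i) π rewrite e =
    cong (i ∷_) (trans (letterPositions≡positions-gaps (suc i) π) (cong (positions (suc i)) e))

  reduce≡rank : ∀ τ P → map ∣_∣ τ ↭ P → reduce τ ≡ map (λ x → withSignOf x (rank P ∣ x ∣)) τ
  reduce≡rank τ P τ↭P = map-cong (λ x → cong (withSignOf x) (begin
    count (λ y → ∣ y ∣ ≤ᵇ ∣ x ∣) τ          ≡⟨ count≡countᵇ _ τ ⟩
    countᵇ (λ y → ∣ y ∣ ≤ᵇ ∣ x ∣) τ         ≡⟨ countᵇ-map (_≤ᵇ ∣ x ∣) ∣_∣ τ ⟨
    countᵇ (_≤ᵇ ∣ x ∣) (map ∣_∣ τ)          ≡⟨ countᵇ-↭ _ τ↭P ⟩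
    rank P ∣ x ∣                            ∎)) τ
    where open ≡-Reasoning

  length-gaps : ∀ i π → length (gaps i π) ≡ suc (length (letters i π))
  length-gaps i []      = refl
  length-gaps i (x ∷ π) rewrite letters-∷ i x π with isFixed (i , x)
  ... | false = cong suc (length-gaps (suc i) π)
  ... | true  with s , g , e ← gaps-nonempty (suc i) π rewrite e = trans (cong length (sym e)) (length-gaps (suc i) π)

  sum-gaps : ∀ i π → sum (gaps i π) ℕ.+ length (letters i π) ≡ length π
  sum-gaps i []      = refl
  sum-gaps i (x ∷ π) rewrite letters-∷ i x π with isFixed (i , x)
  ... | false = trans (ℕ.+-suc _ _) (cong suc (sum-gaps (suc i) π))
  ... | true  with s , g , e ← gaps-nonempty (suc i) π rewrite e =
    cong suc (trans (cong (λ h → sum h ℕ.+ length (letters (suc i) π)) (sym e)) (sum-gaps (suc i) π))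

  holeView-deranged : ∀ i w → All (λ p → not (isFixed p) ≡ true) (withPosFrom i w) → holeView i w ≡ map just (withPosFrom i w)
  holeView-deranged i []      []             = refl
  holeView-deranged i (x ∷ w) (not-fixed ∷ nf) with isFixed (i , x)
  ... | false = cong (just (i , x) ∷_) (holeView-deranged (suc i) w nf)

  interleave-map : ∀ {A B : Set} (f : A → B) g u → interleave g (map f u) ≡ map (Maybe.map f) (interleave g u)
  interleave-map f []          u       = refl
  interleave-map f (zero ∷ g)  []      = refl
  interleave-map f (zero ∷ g)  (x ∷ u) = cong (just (f x) ∷_) (interleave-map f g u)
  interleave-map f (suc s ∷ g) u       = cong (nothing ∷_) (interleave-map f (s ∷ g) u)

  ∈-interleave⁻ : ∀ {A : Set} g (u : List A) {x} → x ∈ interleave g u → x ≡ nothing ⊎ ∃ λ a → a ∈ u × x ≡ just a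
  ∈-interleave⁻ (zero ∷ g)  (y ∷ u) (here refl) = inj₂ (y , here refl , refl)
  ∈-interleave⁻ (zero ∷ g)  (y ∷ u) (there x∈) with ∈-interleave⁻ g u x∈
  ... | inj₁ x≡nothing       = inj₁ x≡nothing
  ... | inj₂ (a , a∈u , x≡a) = inj₂ (a , there a∈u , x≡a)
  ∈-interleave⁻ (suc s ∷ g) u       (here refl) = inj₁ refl
  ∈-interleave⁻ (suc s ∷ g) u       (there x∈) = ∈-interleave⁻ (s ∷ g) u x∈

  pmaj-map : ∀ (f : Letter → Letter) i W →
             (∀ {x y} → x ∈ W → y ∈ W → descentᴹ (Maybe.map f x) (Maybe.map f y) ≡ descentᴹ x y) →
             pmaj i (map (Maybe.map f) W) ≡ pmaj i W
  pmaj-map f i []          _ = refl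
  pmaj-map f i (x ∷ [])    _ = refl
  pmaj-map f i (x ∷ y ∷ W) same =
    cong₂ ℕ._+_ (cong (λ b → pick b i) (same (here refl) (there (here refl))))
                (pmaj-map f (suc i) (y ∷ W) λ x∈ y∈ → same (there x∈) (there y∈))

  withPosFrom-map : ∀ i (L : List Letter) (F : ℕ → ℕ) (h : ℤ → ℤ) → map (F ∘ proj₁) L ≡ range i (length L) →
                    withPosFrom i (map h (map proj₂ L)) ≡ map (λ (j , x) → F j , h x) L
  withPosFrom-map i []            F h _ = refl
  withPosFrom-map i ((j , x) ∷ L) F h e =
    cong₂ _∷_ (cong (_, h x) (sym (proj₁ (∷-injective e)))) (withPosFrom-map (suc i) L F h (proj₂ (∷-injective e)))

  signedPerm-adjacentDistinct : ∀ {n π} → IsSignedPerm n π → AdjacentDistinct π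
  signedPerm-adjacentDistinct {n} {π} sp = go π (Unique-resp-↭ (↭⇒↭ₛ (↭-sym sp)) (range-unique 1 n))
    where
    open import Data.List.Relation.Unary.Unique.Propositional using (Unique)
    open import Data.List.Relation.Binary.Permutation.Propositional using (↭⇒↭ₛ)
    open import Data.List.Relation.Binary.Permutation.Setoid.Properties (setoid ℕ) using (Unique-resp-↭)
    go : ∀ π → Unique (map ∣_∣ π) → AdjacentDistinct π
    go []          _                 = _
    go (x ∷ [])    _                 = _
    go (x ∷ y ∷ π) ((x≢y ∷ _) ∷ u)   = x≢y , go (y ∷ π) u

  lift : List ℕ → ℤ → ℤ
  lift P x = withSignOf x (unrank P ∣ x ∣)

  -- The letters of π occupy the positions P and have absolute values P, so dp π relabels
  -- both through the same increasing bijection rank P.  This preserves signs, ≺ between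
  -- letters and whether a letter exceeds its position, hence every descent of π, including
  -- those next to fixed points.
  module OfSignedPerm {n π} (sp : IsSignedPerm n π) where

    L : List Letter
    L = letters 1 π
    τ : List ℤ
    τ = letterValues 1 π
    P : List ℕ
    P = letterPositions 1 π
    g : List ℕ
    g = gaps 1 π

    standardise : ℤ → ℤ
    standardise x = withSignOf x (rank P ∣ x ∣)

    standardiseᴸ : Letter → Letter
    standardiseᴸ (j , x) = rank P j , standardise x

    τ↭P : map ∣_∣ τ ↭ P
    τ↭P = abs-letterValues↭letterPositions sp

    dp≡map-standardise : dp π ≡ map standardise τ
    dp≡map-standardise = reduce≡rank τ P τ↭P

    ∣letter∣∈P : ∀ {a} → a ∈ L → ∣ proj₂ a ∣ ∈ P
    ∣letter∣∈P a∈ = ↭.∈-resp-↭ τ↭P (∈-map⁺ ∣_∣ (∈-map⁺ proj₂ a∈))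

    isNeg-standardise : ∀ {a} → a ∈ L → isNeg (standardise (proj₂ a)) ≡ isNeg (proj₂ a)
    isNeg-standardise {a} a∈ = isNeg-withSignOf (proj₂ a) (rank-pos P (∣letter∣∈P a∈))

    exceeds-standardise : ∀ {a} → a ∈ L → exceeds (standardiseᴸ a) ≡ exceeds a
    exceeds-standardise {j , t} a∈ = begin
      exceeds (rank P j , standardise t)
        ≡⟨ +<ᶻ-via-abs (rank P j) (standardise t) ⟩
      not (isNeg (standardise t)) ∧ (rank P j <ᵇ ∣ standardise t ∣)
        ≡⟨ cong₂ (λ s r → not s ∧ (rank P j <ᵇ r)) (isNeg-standardise a∈) (∣withSignOf∣ t _) ⟩
      not (isNeg t) ∧ (rank P j <ᵇ rank P ∣ t ∣)
        ≡⟨ cong (not (isNeg t) ∧_) (rank-<ᵇ P (∣letter∣∈P a∈)) ⟩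
      not (isNeg t) ∧ (j <ᵇ ∣ t ∣)
        ≡⟨ +<ᶻ-via-abs j t ⟨
      exceeds (j , t) ∎
      where open ≡-Reasoning

    ≺-standardise : ∀ {a b} → a ∈ L → b ∈ L → (standardise (proj₂ b) ≺ standardise (proj₂ a)) ≡ (proj₂ b ≺ proj₂ a)
    ≺-standardise {_ , s} {_ , t} a∈ b∈ = begin
      standardise t ≺ standardise s
        ≡⟨ ≺-via-abs (standardise s) (standardise t) ⟩
      tiebreak (isNeg (standardise t)) (isNeg (standardise s)) (∣ standardise t ∣ <ᵇ ∣ standardise s ∣)
        ≡⟨ cong₂ (λ u v → tiebreak u v (∣ standardise t ∣ <ᵇ ∣ standardise s ∣)) (isNeg-standardise b∈) (isNeg-standardise a∈) ⟩
      tiebreak (isNeg t) (isNeg s) (∣ standardise t ∣ <ᵇ ∣ standardise s ∣)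
        ≡⟨ cong (tiebreak (isNeg t) (isNeg s)) (trans (cong₂ _<ᵇ_ (∣withSignOf∣ t _) (∣withSignOf∣ s _)) (rank-<ᵇ P (∣letter∣∈P a∈))) ⟩
      tiebreak (isNeg t) (isNeg s) (∣ t ∣ <ᵇ ∣ s ∣)
        ≡⟨ ≺-via-abs s t ⟨
      t ≺ s
        ∎
      where open ≡-Reasoning

    descentᴹ-standardise : ∀ {x y} → x ∈ interleave g L → y ∈ interleave g L →
                          descentᴹ (Maybe.map standardiseᴸ x) (Maybe.map standardiseᴸ y) ≡ descentᴹ x y
    descentᴹ-standardise x∈ y∈ with ∈-interleave⁻ g L x∈ | ∈-interleave⁻ g L y∈
    ... | inj₁ refl              | inj₁ refl              = refl
    ... | inj₁ refl              | inj₂ (b , b∈ , refl)   = cong not (exceeds-standardise b∈)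
    ... | inj₂ (a , a∈ , refl)   | inj₁ refl              = exceeds-standardise a∈
    ... | inj₂ (a , a∈ , refl)   | inj₂ (b , b∈ , refl)   =
      cong₃ tiebreak (exceeds-standardise a∈) (exceeds-standardise b∈) (≺-standardise a∈ b∈)
      where
      cong₃ : ∀ (F : Bool → Bool → Bool → Bool) {a b c a′ b′ c′} → a ≡ a′ → b ≡ b′ → c ≡ c′ → F a b c ≡ F a′ b′ c′
      cong₃ F refl refl refl = refl

    withPos-dp : withPos (dp π) ≡ map standardiseᴸ L
    withPos-dp = trans (cong withPos dp≡map-standardise)
      (withPosFrom-map 1 L (rank P) standardise
        (trans (map-∘ L) (trans (map-rank-increasing P (letterPositions-increasing 1 π)) (cong (range 1) (length-map proj₁ L)))))

    maj≺-dp : majFrom 1 π ≡ pmaj 1 (interleave g (withPos (dp π)))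
    maj≺-dp = begin
      majFrom 1 π
        ≡⟨ majFrom≡pmaj-holeView 1 π (signedPerm-adjacentDistinct sp) ⟩
      pmaj 1 (holeView 1 π)
        ≡⟨ cong (pmaj 1) (interleave-gaps-letters 1 π) ⟨
      pmaj 1 (interleave g L)
        ≡⟨ pmaj-map standardiseᴸ 1 (interleave g L) descentᴹ-standardise ⟨
      pmaj 1 (map (Maybe.map standardiseᴸ) (interleave g L))
        ≡⟨ cong (pmaj 1) (interleave-map standardiseᴸ g L) ⟨
      pmaj 1 (interleave g (map standardiseᴸ L))
        ≡⟨ cong (λ w → pmaj 1 (interleave g w)) withPos-dp ⟨
      pmaj 1 (interleave g (withPos (dp π))) ∎
      where open ≡-Reasoning

    count-isNeg-dp : count isNeg π ≡ count isNeg (dp π)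
    count-isNeg-dp = begin
      count isNeg π
        ≡⟨ count≡countᵇ isNeg π ⟩
      countᵇ isNeg π
        ≡⟨ cong (countᵇ isNeg) (map-proj₂-withPosFrom 1 π) ⟨
      countᵇ isNeg (map proj₂ W)
        ≡⟨ countᵇ-map isNeg proj₂ W ⟩
      countᵇ (isNeg ∘ proj₂) W
        ≡⟨ countᵇ-↭ (isNeg ∘ proj₂) (filterᵇ-partition-↭ isFixed W) ⟩
      countᵇ (isNeg ∘ proj₂) (fixedPoints 1 π ++ L)
        ≡⟨ countᵇ-++ (isNeg ∘ proj₂) (fixedPoints 1 π) L ⟩
      countᵇ (isNeg ∘ proj₂) (fixedPoints 1 π) ℕ.+ countᵇ (isNeg ∘ proj₂) L
        ≡⟨ cong (ℕ._+ countᵇ (isNeg ∘ proj₂) L) (countᵇ-none _ (All.map fixed-nonneg (filterᵇ-all isFixed W))) ⟩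
      countᵇ (isNeg ∘ proj₂) L
        ≡⟨ countᵇ-cong (All.tabulate λ a∈ → sym (isNeg-standardise a∈)) ⟩
      countᵇ (isNeg ∘ standardise ∘ proj₂) L
        ≡⟨ countᵇ-map (isNeg ∘ standardise) proj₂ L ⟨
      countᵇ (isNeg ∘ standardise) τ
        ≡⟨ countᵇ-map isNeg standardise τ ⟨
      countᵇ isNeg (map standardise τ)
        ≡⟨ cong (countᵇ isNeg) dp≡map-standardise ⟨
      countᵇ isNeg (dp π)
        ≡⟨ count≡countᵇ isNeg (dp π) ⟨
      count isNeg (dp π) ∎
      where
      open ≡-Reasoning
      W : List Letter
      W = withPosFrom 1 π
      fixed-nonneg : ∀ {p : Letter} → isFixed p ≡ true → isNeg (proj₂ p) ≡ false
      fixed-nonneg {j , x} e rewrite isFixed-true⁻ j x e = refl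

    map-lift-dp : map (lift P) (dp π) ≡ τ
    map-lift-dp = begin
      map (lift P) (dp π)                   ≡⟨ cong (map (lift P)) dp≡map-standardise ⟩
      map (lift P) (map standardise τ)      ≡⟨ map-∘ τ ⟨
      map (lift P ∘ standardise) τ          ≡⟨ map-id-local (All.tabulate lift-standardise) ⟩
      τ                                     ∎
      where
      open ≡-Reasoning
      lift-standardise : ∀ {t} → t ∈ τ → lift P (standardise t) ≡ t
      lift-standardise t∈ with (j , t) , a∈ , refl ← ∈-map⁻ proj₂ t∈ = begin
        withSignOf (standardise t) (unrank P ∣ standardise t ∣)
          ≡⟨ cong (λ r → withSignOf (standardise t) (unrank P r)) (∣withSignOf∣ t _) ⟩
        withSignOf (standardise t) (unrank P (rank P ∣ t ∣))
          ≡⟨ withSignOf-cong (standardise t) t _ (isNeg-standardise a∈) ⟩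
        withSignOf t (unrank P (rank P ∣ t ∣))
          ≡⟨ cong (withSignOf t) (unrank-rank P (letterPositions-increasing 1 π) (∣letter∣∈P a∈)) ⟩
        withSignOf t ∣ t ∣
          ≡⟨ withSignOf-∣∣ t ⟩
        t ∎

  inflate : List ℤ → List ℕ → List ℤ
  inflate σ g = fill 1 g (map (lift (positions 1 g)) σ)

  inflate-dp-gaps : ∀ {n π} → IsSignedPerm n π → π ≡ inflate (dp π) (gaps 1 π)
  inflate-dp-gaps {n} {π} sp = begin
    π
      ≡⟨ fill-gaps-letters 1 π ⟨
    fill 1 g τ
      ≡⟨ cong (fill 1 g) map-lift-dp ⟨
    fill 1 g (map (lift P) (dp π))
      ≡⟨ cong (λ P′ → fill 1 g (map (lift P′) (dp π))) (letterPositions≡positions-gaps 1 π) ⟩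
    inflate (dp π) g ∎
    where
    open ≡-Reasoning
    open OfSignedPerm sp

  zipLetters : List ℕ → List ℤ → List Letter
  zipLetters (j ∷ js) (t ∷ ts) = (j , t) ∷ zipLetters js ts
  zipLetters _        _        = []

  NoneFixed : List ℕ → List ℤ → Set
  NoneFixed (j ∷ js) (t ∷ ts) = t ≢ + j × NoneFixed js ts
  NoneFixed _        _        = ⊤

  gaps-letters-fill : ∀ i g τ → length g ≡ suc (length τ) → NoneFixed (positions i g) τ →
                      gaps i (fill i g τ) ≡ g × letters i (fill i g τ) ≡ zipLetters (positions i g) τ
  gaps-letters-fill i (zero ∷ [])    []      _ _ = refl , refl
  gaps-letters-fill i (zero ∷ s ∷ g) (t ∷ τ) l (t≢i , nf)
    with gaps≡ , letters≡ ← gaps-letters-fill (suc i) (s ∷ g) τ (ℕ.suc-injective l) nf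
    rewrite isFixed-false i t t≢i = cong (0 ∷_) gaps≡ , cong ((i , t) ∷_) letters≡
  gaps-letters-fill i (suc s ∷ g)    τ       l nf
    with gaps≡ , letters≡ ← gaps-letters-fill (suc i) (s ∷ g) τ l nf
    rewrite isFixed-refl i = cong incHead gaps≡ , letters≡

  length-fill : ∀ i g τ → length g ≡ suc (length τ) → length (fill i g τ) ≡ sum g ℕ.+ length τ
  length-fill i (zero ∷ [])    []      _ = refl
  length-fill i (zero ∷ s ∷ g) (t ∷ τ) l =
    trans (cong suc (length-fill (suc i) (s ∷ g) τ (ℕ.suc-injective l))) (sym (ℕ.+-suc _ (length τ)))
  length-fill i (suc s ∷ g)    τ       l = cong suc (length-fill (suc i) (s ∷ g) τ l)

  length-positions : ∀ i g → length (positions i g) ≡ ℕ.pred (length g)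
  length-positions i []             = refl
  length-positions i (zero ∷ [])    = refl
  length-positions i (zero ∷ s ∷ g) = cong suc (length-positions (suc i) (s ∷ g))
  length-positions i (suc s ∷ g)    = length-positions (suc i) (s ∷ g)

  positions-≥ : ∀ i g → All (i ≤_) (positions i g)
  positions-≥ i []             = []
  positions-≥ i (zero ∷ [])    = []
  positions-≥ i (zero ∷ s ∷ g) = ℕ.≤-refl ∷ All.map ℕ.<⇒≤ (positions-≥ (suc i) (s ∷ g))
  positions-≥ i (suc s ∷ g)    = All.map ℕ.<⇒≤ (positions-≥ (suc i) (s ∷ g))

  positions-increasing : ∀ i g → AllPairs _<_ (positions i g)
  positions-increasing i []             = []
  positions-increasing i (zero ∷ [])    = []
  positions-increasing i (zero ∷ s ∷ g) = positions-≥ (suc i) (s ∷ g) ∷ positions-increasing (suc i) (s ∷ g)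
  positions-increasing i (suc s ∷ g)    = positions-increasing (suc i) (s ∷ g)

  map-proj₁-zipLetters : ∀ js ts → length js ≡ length ts → map proj₁ (zipLetters js ts) ≡ js
  map-proj₁-zipLetters []       []       _ = refl
  map-proj₁-zipLetters (j ∷ js) (t ∷ ts) l = cong (j ∷_) (map-proj₁-zipLetters js ts (ℕ.suc-injective l))

  map-proj₂-zipLetters : ∀ js ts → length js ≡ length ts → map proj₂ (zipLetters js ts) ≡ ts
  map-proj₂-zipLetters []       []       _ = refl
  map-proj₂-zipLetters (j ∷ js) (t ∷ ts) l = cong (t ∷_) (map-proj₂-zipLetters js ts (ℕ.suc-injective l))

  module Inflation {k σ} (sp : IsSignedPerm k σ) (deranged : noFixedPoints σ ≡ true) (g : List ℕ) (l : length g ≡ suc k) where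

    P : List ℕ
    P = positions 1 g
    τ : List ℤ
    τ = map (lift P) σ
    π : List ℤ
    π = inflate σ g

    length-P : length P ≡ k
    length-P = trans (length-positions 1 g) (cong ℕ.pred l)

    length-τ : length τ ≡ k
    length-τ = trans (length-map (lift P) σ) (length-signedPerm sp)

    P-increasing : AllPairs _<_ P
    P-increasing = positions-increasing 1 g

    ∣σ∣∈range : ∀ {s} → s ∈ σ → ∣ s ∣ ∈ range 1 (length P)
    ∣σ∣∈range s∈ = subst (λ n → _ ∈ range 1 n) (sym length-P) (↭.∈-resp-↭ sp (∈-map⁺ ∣_∣ s∈))

    unrank-pos : ∀ {j} → j ∈ range 1 (length P) → 1 ≤ unrank P j
    unrank-pos j∈ = All.lookup (positions-≥ 1 g) (unrank-∈ P j∈)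

    lift-not-fixed : ∀ j s → j ∈ range 1 (length P) → s ∈ σ → s ≢ + j → lift P s ≢ + unrank P j
    lift-not-fixed j (+ a)    j∈ s∈ s≢j e = s≢j (cong +_ (begin
      a                     ≡⟨ rank-unrank P P-increasing (∣σ∣∈range s∈) ⟨
      rank P (unrank P a)   ≡⟨ cong (rank P) (+-injective e) ⟩
      rank P (unrank P j)   ≡⟨ rank-unrank P P-increasing j∈ ⟩
      j                     ∎))
      where open ≡-Reasoning
    lift-not-fixed j -[1+ a ] j∈ s∈ s≢j e = neg≢pos (unrank P (suc a)) (unrank-pos j∈) e
      where
      neg≢pos : ∀ x {y} → 1 ≤ y → ℤ.- (+ x) ≢ + y
      neg≢pos zero    {suc y} _ ()
      neg≢pos (suc x) _ ()

    noneFixed-from : ∀ j w → (∀ {s} → s ∈ w → s ∈ σ) → j ℕ.+ length w ≤ suc (length P) → 1 ≤ j →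
                     All (λ p → not (isFixed p) ≡ true) (withPosFrom j w) →
                     NoneFixed (map (unrank P) (range j (length w))) (map (lift P) w)
    noneFixed-from j []      _   _  _  _              = _
    noneFixed-from j (s ∷ w) w⊆σ le 1≤j (nf ∷ nfs) =
      lift-not-fixed j s (∈-range⁺ 1 (length P) 1≤j (ℕ.<-≤-trans (ℕ.m<m+n j (s≤s z≤n)) le)) (w⊆σ (here refl))
                     (isFixed-false⁻ j s (not-injective nf))
      , noneFixed-from (suc j) w (w⊆σ ∘ there) (subst (_≤ suc (length P)) (ℕ.+-suc j (length w)) le) (ℕ.m≤n⇒m≤1+n 1≤j) nfs

    noneFixed : NoneFixed P τ
    noneFixed = subst (λ P′ → NoneFixed P′ τ) (map-unrank-range P)
      (subst (λ n → NoneFixed (map (unrank P) (range 1 n)) τ) (trans (length-signedPerm sp) (sym length-P))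
        (noneFixed-from 1 σ (λ s∈ → s∈) (ℕ.≤-reflexive (cong suc (trans (length-signedPerm sp) (sym length-P)))) ℕ.≤-refl
          (All.tabulate (allᵇ⁻ (λ p → not (isFixed p)) (withPos σ) deranged))))

    l′ : length g ≡ suc (length τ)
    l′ = trans l (cong suc (sym length-τ))

    P≡τ-length : length P ≡ length τ
    P≡τ-length = trans length-P (sym length-τ)

    gaps-inflate : gaps 1 π ≡ g
    gaps-inflate = proj₁ (gaps-letters-fill 1 g τ l′ noneFixed)

    letters-inflate : letters 1 π ≡ zipLetters P τ
    letters-inflate = proj₂ (gaps-letters-fill 1 g τ l′ noneFixed)

    letterPositions-inflate : letterPositions 1 π ≡ P
    letterPositions-inflate = trans (cong (map proj₁) letters-inflate) (map-proj₁-zipLetters P τ P≡τ-length)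

    letterValues-inflate : letterValues 1 π ≡ τ
    letterValues-inflate = trans (cong (map proj₂) letters-inflate) (map-proj₂-zipLetters P τ P≡τ-length)

    ∣τ∣↭P : map ∣_∣ τ ↭ P
    ∣τ∣↭P = begin
      map ∣_∣ (map (lift P) σ)           ≡⟨ map-∘ σ ⟨
      map (∣_∣ ∘ lift P) σ               ≡⟨ map-cong (λ s → ∣withSignOf∣ s _) σ ⟩
      map (unrank P ∘ ∣_∣) σ             ≡⟨ map-∘ σ ⟩
      map (unrank P) (map ∣_∣ σ)         ↭⟨ ↭.map⁺ (unrank P) sp ⟩
      map (unrank P) (range 1 k)         ≡⟨ cong (λ n → map (unrank P) (range 1 n)) length-P ⟨
      map (unrank P) (range 1 (length P)) ≡⟨ map-unrank-range P ⟩
      P                                  ∎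
      where open PermutationReasoning

    inflate-signedPerm : IsSignedPerm (sum g ℕ.+ k) π
    inflate-signedPerm = begin
      map ∣_∣ π
        ↭⟨ abs↭fixedPoints++letterValues 1 π ⟩
      map proj₁ (fixedPoints 1 π) ++ map ∣_∣ (letterValues 1 π)
        ≡⟨ cong (λ v → map proj₁ (fixedPoints 1 π) ++ map ∣_∣ v) letterValues-inflate ⟩
      map proj₁ (fixedPoints 1 π) ++ map ∣_∣ τ
        ↭⟨ ↭.++⁺ˡ (map proj₁ (fixedPoints 1 π)) ∣τ∣↭P ⟩
      map proj₁ (fixedPoints 1 π) ++ P
        ≡⟨ cong (map proj₁ (fixedPoints 1 π) ++_) letterPositions-inflate ⟨
      map proj₁ (fixedPoints 1 π) ++ letterPositions 1 π
        ↭⟨ ↭-sym (range↭fixedPoints++letterPositions 1 π) ⟩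
      range 1 (length π)
        ≡⟨ cong (range 1) (trans (length-fill 1 g τ l′) (cong (sum g ℕ.+_) length-τ)) ⟩
      range 1 (sum g ℕ.+ k) ∎
      where open PermutationReasoning

    dp-inflate : dp π ≡ σ
    dp-inflate = begin
      reduce (letterValues 1 π)
        ≡⟨ reduce≡rank _ _ (abs-letterValues↭letterPositions inflate-signedPerm) ⟩
      map (λ x → withSignOf x (rank (letterPositions 1 π) ∣ x ∣)) (letterValues 1 π)
        ≡⟨ cong₂ (λ P′ v → map (λ x → withSignOf x (rank P′ ∣ x ∣)) v) letterPositions-inflate letterValues-inflate ⟩
      map (λ x → withSignOf x (rank P ∣ x ∣)) (map (lift P) σ)
        ≡⟨ map-∘ σ ⟨
      map (λ s → withSignOf (lift P s) (rank P ∣ lift P s ∣)) σ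
        ≡⟨ map-id-local (All.tabulate standardise-lift) ⟩
      σ ∎
      where
      open ≡-Reasoning
      standardise-lift : ∀ {s} → s ∈ σ → withSignOf (lift P s) (rank P ∣ lift P s ∣) ≡ s
      standardise-lift {s} s∈ = begin
        withSignOf (lift P s) (rank P ∣ lift P s ∣)
          ≡⟨ cong (withSignOf (lift P s)) (trans (cong (rank P) (∣withSignOf∣ s _)) (rank-unrank P P-increasing (∣σ∣∈range s∈))) ⟩
        withSignOf (lift P s) ∣ s ∣
          ≡⟨ withSignOf-cong (lift P s) s ∣ s ∣ (isNeg-withSignOf s (unrank-pos (∣σ∣∈range s∈))) ⟩
        withSignOf s ∣ s ∣
          ≡⟨ withSignOf-∣∣ s ⟩
        s ∎

module LengthParity where

  open import Data.Bool using (Bool; true; false; not; if_then_else_; _∧_)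
  open import Data.Bool.Properties using (not-involutive; T-≡)
  open import Data.Nat as ℕ using (ℕ; zero; suc; _+_; _∸_; _≤_; _<_; z≤n; s≤s; _<ᵇ_; _≤ᵇ_)
  import Data.Nat.Properties as ℕ
  open import Data.Nat.Tactic.RingSolver using (solve-∀)
  open import Data.Integer as ℤ using (ℤ; +_; ∣_∣)
  open import Data.List using (List; []; _∷_; map; _++_; length; filterᵇ)
  open import Data.List.Properties using (length-map; length-++; map-++; map-∘; map-cong; map-id-local; map-cong-local; filter-++; filter-all)
  open import Data.List.Relation.Unary.All as All using (All; []; _∷_)
  import Data.List.Relation.Unary.All.Properties as All
  open import Data.List.Membership.Propositional using (_∈_)
  open import Data.List.Membership.Propositional.Properties using (∈-map⁺; ∈-map⁻; ∈-++⁺ˡ; ∈-++⁺ʳ; ∈-++⁻)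
  open import Data.List.Relation.Binary.Permutation.Propositional
    using (_↭_; module PermutationReasoning)
  import Data.List.Relation.Binary.Permutation.Propositional.Properties as ↭
  open import Data.Product using (_×_; _,_; proj₁; proj₂; ∃; ∃₂)
  open import Data.Sum using (_⊎_; inj₁; inj₂)
  open import Data.Empty using (⊥-elim)
  open import Function using (_∘_)
  open import Function.Bundles using (Equivalence)
  open import Relation.Binary.Definitions using (tri<; tri≈; tri>)
  open import Relation.Nullary.Decidable using (T?)
  open import Relation.Binary.PropositionalEquality
  open BooleanOrder
  open Lists using (map≡id⇒fixed)
  open Ranks
  open Counting
  open Ranges
  open SignedOrder
  open SignedPermutations
  open FixedPoints
  open Standardisation

  -- Deleting the value p: absolute values above p move down by one.
  shift : ℕ → ℕ → ℕ
  shift p a = if p <ᵇ a then a ∸ 1 else a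

  shiftᶻ : ℕ → ℤ → ℤ
  shiftᶻ p x = if p <ᵇ ∣ x ∣ then withSignOf x (∣ x ∣ ∸ 1) else x

  Avoids : ℕ → ℤ → Set
  Avoids p x = ∣ x ∣ ≢ p

  shift-< : ∀ {p a} → a < p → shift p a ≡ a
  shift-< {p} {a} a<p rewrite <ᵇ-false {p} {a} (ℕ.<⇒≤ a<p) = refl

  shift-> : ∀ {p a} → p < a → shift p a ≡ a ∸ 1
  shift-> p<a rewrite <ᵇ-true p<a = refl

  private
    <⇒≤∸1 : ∀ {p a} → p < a → p ≤ a ∸ 1
    <⇒≤∸1 {a = suc a} (s≤s p≤a) = p≤a

    <⊎> : ∀ {a p} → a ≢ p → a < p ⊎ p < a
    <⊎> {a} {p} a≢p with ℕ.<-cmp a p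
    ... | tri< a<p _ _ = inj₁ a<p
    ... | tri≈ _ a≡p _ = ⊥-elim (a≢p a≡p)
    ... | tri> _ _ p<a = inj₂ p<a

  shift-<ᵇ : ∀ {p a b} → a ≢ p → b ≢ p → (shift p a <ᵇ shift p b) ≡ (a <ᵇ b)
  shift-<ᵇ {p} {a} {b} a≢p b≢p with <⊎> a≢p | <⊎> b≢p
  ... | inj₁ a<p | inj₁ b<p rewrite shift-< a<p | shift-< b<p = refl
  ... | inj₂ p<a | inj₂ p<b rewrite shift-> p<a | shift-> p<b = pred-<ᵇ a b p<a p<b
    where
    pred-<ᵇ : ∀ a b → p < a → p < b → ((a ∸ 1) <ᵇ (b ∸ 1)) ≡ (a <ᵇ b)
    pred-<ᵇ (suc a) (suc b) _ _ = refl
  ... | inj₁ a<p | inj₂ p<b rewrite shift-< a<p | shift-> p<b =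
    trans (<ᵇ-true (ℕ.<-≤-trans a<p (<⇒≤∸1 p<b))) (sym (<ᵇ-true (ℕ.<-trans a<p p<b)))
  ... | inj₂ p<a | inj₁ b<p rewrite shift-> p<a | shift-< b<p =
    trans (<ᵇ-false (ℕ.<⇒≤ (ℕ.<-≤-trans b<p (<⇒≤∸1 p<a)))) (sym (<ᵇ-false (ℕ.<⇒≤ (ℕ.<-trans b<p p<a))))

  ∣shiftᶻ∣ : ∀ p x → ∣ shiftᶻ p x ∣ ≡ shift p ∣ x ∣
  ∣shiftᶻ∣ p x with p <ᵇ ∣ x ∣
  ... | true  = ∣withSignOf∣ x (∣ x ∣ ∸ 1)
  ... | false = refl

  isNeg-shiftᶻ : ∀ p x → 1 ≤ p → isNeg (shiftᶻ p x) ≡ isNeg x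
  isNeg-shiftᶻ p x 1≤p with p <ᵇ ∣ x ∣ in p<∣x∣
  ... | true  = isNeg-withSignOf x (ℕ.≤-trans 1≤p (<⇒≤∸1 {p} {∣ x ∣} (<ᵇ-true⁻ p<∣x∣)))
  ... | false = refl

  shiftᶻ-small : ∀ p x → ∣ x ∣ < p → shiftᶻ p x ≡ x
  shiftᶻ-small p x ∣x∣<p rewrite <ᵇ-false {p} {∣ x ∣} (ℕ.<⇒≤ ∣x∣<p) = refl

  shiftᶻ-<ᶻ : ∀ p x y → 1 ≤ p → Avoids p x → Avoids p y → (shiftᶻ p y <ᶻ shiftᶻ p x) ≡ (y <ᶻ x)
  shiftᶻ-<ᶻ p x y 1≤p x≁p y≁p = begin
    shiftᶻ p y <ᶻ shiftᶻ p x
      ≡⟨ <ᶻ-via-abs (shiftᶻ p x) (shiftᶻ p y) ⟩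
    tiebreak (isNeg (shiftᶻ p y)) (isNeg (shiftᶻ p x))
             (if isNeg (shiftᶻ p y) then ∣ shiftᶻ p x ∣ <ᵇ ∣ shiftᶻ p y ∣ else ∣ shiftᶻ p y ∣ <ᵇ ∣ shiftᶻ p x ∣)
      ≡⟨ cong₂ (λ s t → tiebreak s t (if s then ∣ shiftᶻ p x ∣ <ᵇ ∣ shiftᶻ p y ∣ else ∣ shiftᶻ p y ∣ <ᵇ ∣ shiftᶻ p x ∣))
               (isNeg-shiftᶻ p y 1≤p) (isNeg-shiftᶻ p x 1≤p) ⟩
    tiebreak (isNeg y) (isNeg x) (if isNeg y then ∣ shiftᶻ p x ∣ <ᵇ ∣ shiftᶻ p y ∣ else ∣ shiftᶻ p y ∣ <ᵇ ∣ shiftᶻ p x ∣)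
      ≡⟨ cong₂ (λ u v → tiebreak (isNeg y) (isNeg x) (if isNeg y then u else v)) (shifted {x} {y} x≁p y≁p) (shifted {y} {x} y≁p x≁p) ⟩
    tiebreak (isNeg y) (isNeg x) (if isNeg y then ∣ x ∣ <ᵇ ∣ y ∣ else ∣ y ∣ <ᵇ ∣ x ∣)
      ≡⟨ <ᶻ-via-abs x y ⟨
    y <ᶻ x
      ∎
    where
    open ≡-Reasoning
    shifted : ∀ {u v} → Avoids p u → Avoids p v → (∣ shiftᶻ p u ∣ <ᵇ ∣ shiftᶻ p v ∣) ≡ (∣ u ∣ <ᵇ ∣ v ∣)
    shifted {u} {v} u≁p v≁p = trans (cong₂ _<ᵇ_ (∣shiftᶻ∣ p u) (∣shiftᶻ∣ p v)) (shift-<ᵇ u≁p v≁p)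

  count-++ : ∀ (p : ℤ → Bool) α γ → count p (α ++ γ) ≡ count p α + count p γ
  count-++ p []      γ = refl
  count-++ p (x ∷ α) γ = trans (cong (_+_ (⟦ p x ⟧)) (count-++ p α γ)) (sym (ℕ.+-assoc ⟦ p x ⟧ _ _))

  count-+ : ∀ (p q r : ℤ → Bool) {w} → All (λ x → ⟦ p x ⟧ + ⟦ q x ⟧ ≡ ⟦ r x ⟧) w →
            count p w + count q w ≡ count r w
  count-+ p q r {w} pointwise = begin
    count p w + count q w    ≡⟨ cong₂ _+_ (count≡countᵇ p w) (count≡countᵇ q w) ⟩
    countᵇ p w + countᵇ q w  ≡⟨ countᵇ-+ p q r pointwise ⟩
    countᵇ r w               ≡⟨ count≡countᵇ r w ⟨
    count r w                ∎
    where open ≡-Reasoning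

  crossInv : List ℤ → List ℤ → ℕ
  crossInv []      γ = 0
  crossInv (x ∷ α) γ = count (_<ᶻ x) γ + crossInv α γ

  inv-++ : ∀ α γ → inv (α ++ γ) ≡ inv α + inv γ + crossInv α γ
  inv-++ []      γ = sym (ℕ.+-identityʳ (inv γ))
  inv-++ (x ∷ α) γ = begin
    count (_<ᶻ x) (α ++ γ) + inv (α ++ γ)
      ≡⟨ cong₂ _+_ (count-++ (_<ᶻ x) α γ) (inv-++ α γ) ⟩
    count (_<ᶻ x) α + count (_<ᶻ x) γ + (inv α + inv γ + crossInv α γ)
      ≡⟨ ring (count (_<ᶻ x) α) (count (_<ᶻ x) γ) (inv α) (inv γ) (crossInv α γ) ⟩
    count (_<ᶻ x) α + inv α + inv γ + (count (_<ᶻ x) γ + crossInv α γ)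
      ∎
    where
    open ≡-Reasoning
    ring : ∀ a b c d e → a + b + (c + d + e) ≡ a + c + d + (b + e)
    ring = solve-∀

  negAbsSum-++ : ∀ α γ → negAbsSum (α ++ γ) ≡ negAbsSum α + negAbsSum γ
  negAbsSum-++ []      γ = refl
  negAbsSum-++ (x ∷ α) γ = trans (cong (_+_ (if isNeg x then ∣ x ∣ else 0)) (negAbsSum-++ α γ))
                                 (sym (ℕ.+-assoc (if isNeg x then ∣ x ∣ else 0) (negAbsSum α) (negAbsSum γ)))

  crossInv-∷ : ∀ p α β → crossInv α ((+ p) ∷ β) ≡ count ((+ p) <ᶻ_) α + crossInv α β
  crossInv-∷ p []      β = refl
  crossInv-∷ p (x ∷ α) β = begin
    ⟦ (+ p) <ᶻ x ⟧ + count (_<ᶻ x) β + crossInv α (+ p ∷ β)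
      ≡⟨ cong (_+_ (⟦ (+ p) <ᶻ x ⟧ + count (_<ᶻ x) β)) (crossInv-∷ p α β) ⟩
    ⟦ (+ p) <ᶻ x ⟧ + count (_<ᶻ x) β + (count ((+ p) <ᶻ_) α + crossInv α β)
      ≡⟨ ring ⟦ (+ p) <ᶻ x ⟧ (count (_<ᶻ x) β) (count ((+ p) <ᶻ_) α) (crossInv α β) ⟩
    ⟦ (+ p) <ᶻ x ⟧ + count ((+ p) <ᶻ_) α + (count (_<ᶻ x) β + crossInv α β)
      ∎
    where
    open ≡-Reasoning
    ring : ∀ a b c d → a + b + (c + d) ≡ a + c + (b + d)
    ring = solve-∀

  module _ {p : ℕ} (1≤p : 1 ≤ p) where

    count-shiftᶻ : ∀ x γ → Avoids p x → All (Avoids p) γ →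
                   count (_<ᶻ shiftᶻ p x) (map (shiftᶻ p) γ) ≡ count (_<ᶻ x) γ
    count-shiftᶻ x []      _   _          = refl
    count-shiftᶻ x (y ∷ γ) x≁p (y≁p ∷ γ≁p) =
      cong₂ _+_ (cong ⟦_⟧ (shiftᶻ-<ᶻ p x y 1≤p x≁p y≁p)) (count-shiftᶻ x γ x≁p γ≁p)

    inv-shiftᶻ : ∀ w → All (Avoids p) w → inv (map (shiftᶻ p) w) ≡ inv w
    inv-shiftᶻ []      _            = refl
    inv-shiftᶻ (x ∷ w) (x≁p ∷ w≁p) = cong₂ _+_ (count-shiftᶻ x w x≁p w≁p) (inv-shiftᶻ w w≁p)

    crossInv-shiftᶻ : ∀ α γ → All (Avoids p) α → All (Avoids p) γ →
                      crossInv (map (shiftᶻ p) α) (map (shiftᶻ p) γ) ≡ crossInv α γ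
    crossInv-shiftᶻ []      γ _            _   = refl
    crossInv-shiftᶻ (x ∷ α) γ (x≁p ∷ α≁p) γ≁p =
      cong₂ _+_ (count-shiftᶻ x γ x≁p γ≁p) (crossInv-shiftᶻ α γ α≁p γ≁p)

  bigNeg : ℕ → List ℤ → ℕ
  bigNeg p = count (λ x → isNeg x ∧ (p <ᵇ ∣ x ∣))

  negAbsSum-shiftᶻ : ∀ p w → 1 ≤ p → negAbsSum w ≡ negAbsSum (map (shiftᶻ p) w) + bigNeg p w
  negAbsSum-shiftᶻ p []      _   = refl
  negAbsSum-shiftᶻ p (x ∷ w) 1≤p = begin
    negᵃ x + negAbsSum w
      ≡⟨ cong₂ _+_ (entry x) (negAbsSum-shiftᶻ p w 1≤p) ⟩
    negᵃ (shiftᶻ p x) + ⟦ isNeg x ∧ (p <ᵇ ∣ x ∣) ⟧ + (negAbsSum (map (shiftᶻ p) w) + bigNeg p w)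
      ≡⟨ ring (negᵃ (shiftᶻ p x)) ⟦ isNeg x ∧ (p <ᵇ ∣ x ∣) ⟧ (negAbsSum (map (shiftᶻ p) w)) (bigNeg p w) ⟩
    negᵃ (shiftᶻ p x) + negAbsSum (map (shiftᶻ p) w) + (⟦ isNeg x ∧ (p <ᵇ ∣ x ∣) ⟧ + bigNeg p w)
      ∎
    where
    open ≡-Reasoning
    negᵃ : ℤ → ℕ
    negᵃ x = if isNeg x then ∣ x ∣ else 0
    ring : ∀ a b c d → a + b + (c + d) ≡ a + c + (b + d)
    ring = solve-∀
    entry : ∀ x → negᵃ x ≡ negᵃ (shiftᶻ p x) + ⟦ isNeg x ∧ (p <ᵇ ∣ x ∣) ⟧
    entry x rewrite isNeg-shiftᶻ p x 1≤p | ∣shiftᶻ∣ p x with isNeg x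
    ... | false = refl
    ... | true  with p <ᵇ ∣ x ∣ in p<∣x∣
    ...   | true  = pred+1 (<ᵇ-true⁻ p<∣x∣)
      where
      pred+1 : ∀ {a} → p < a → a ≡ a ∸ 1 + 1
      pred+1 {suc a} _ = sym (ℕ.+-comm a 1)
    ...   | false = sym (ℕ.+-identityʳ ∣ x ∣)

  count-above : ∀ p α → count ((+ p) <ᶻ_) α + bigNeg p α ≡ count (λ x → p <ᵇ ∣ x ∣) α
  count-above p α =
    count-+ ((+ p) <ᶻ_) (λ x → isNeg x ∧ (p <ᵇ ∣ x ∣)) (λ x → p <ᵇ ∣ x ∣) {α} (All.tabulate λ {x} _ → entry x)
    where
    entry : ∀ x → ⟦ (+ p) <ᶻ x ⟧ + ⟦ isNeg x ∧ (p <ᵇ ∣ x ∣) ⟧ ≡ ⟦ p <ᵇ ∣ x ∣ ⟧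
    entry x rewrite <ᶻ-via-abs x (+ p) with isNeg x
    ... | false = ℕ.+-identityʳ _
    ... | true  = refl

  count-below : ∀ p β → All (Avoids p) β → count (_<ᶻ (+ p)) β ≡ count (λ x → ∣ x ∣ <ᵇ p) β + bigNeg p β
  count-below p β β≁p =
    sym (count-+ (λ x → ∣ x ∣ <ᵇ p) (λ x → isNeg x ∧ (p <ᵇ ∣ x ∣)) (_<ᶻ (+ p)) {β} (All.map (λ {x} → entry x) β≁p))
    where
    entry : ∀ x → Avoids p x → ⟦ ∣ x ∣ <ᵇ p ⟧ + ⟦ isNeg x ∧ (p <ᵇ ∣ x ∣) ⟧ ≡ ⟦ x <ᶻ (+ p) ⟧
    entry x x≁p rewrite <ᶻ-via-abs (+ p) x with isNeg x
    ... | false = ℕ.+-identityʳ _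
    ... | true  with <⊎> x≁p
    ...   | inj₁ ∣x∣<p rewrite <ᵇ-true ∣x∣<p | <ᵇ-false {p} {∣ x ∣} (ℕ.<⇒≤ ∣x∣<p) = refl
    ...   | inj₂ p<∣x∣ rewrite <ᵇ-true p<∣x∣ | <ᵇ-false {∣ x ∣} {p} (ℕ.<⇒≤ p<∣x∣) = refl

  ℓB-delete : ∀ p α β → 1 ≤ p → All (Avoids p) α → All (Avoids p) β →
              count (λ x → p <ᵇ ∣ x ∣) α ≡ count (λ x → ∣ x ∣ <ᵇ p) β →
              ℓB (α ++ (+ p) ∷ β) ≡ ℓB (map (shiftᶻ p) α ++ map (shiftᶻ p) β) + 2 ℕ.* (count (λ x → ∣ x ∣ <ᵇ p) β + bigNeg p β)
  ℓB-delete p α β 1≤p α≁p β≁p balance = begin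
    ℓB (α ++ (+ p) ∷ β)
      ≡⟨ cong₂ _+_ (trans (inv-++ α (+ p ∷ β)) (cong (_+_ (inv α + (Bp + inv β))) (crossInv-∷ p α β))) (negAbsSum-++ α (+ p ∷ β)) ⟩
    inv α + (Bp + inv β) + (A + crossInv α β) + (negAbsSum α + negAbsSum β)
      ≡⟨ cong₂ _+_ (cong₂ _+_ (cong₂ (λ s t → s + (Bp + t)) (sym (inv-shiftᶻ 1≤p α α≁p)) (sym (inv-shiftᶻ 1≤p β β≁p)))
                              (cong (_+_ (A)) (sym (crossInv-shiftᶻ 1≤p α β α≁p β≁p))))
                   (cong₂ _+_ (negAbsSum-shiftᶻ p α 1≤p) (negAbsSum-shiftᶻ p β 1≤p)) ⟩
    inv α′ + (Bp + inv β′) + (A + crossInv α′ β′) + (negAbsSum α′ + bigNeg p α + (negAbsSum β′ + bigNeg p β))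
      ≡⟨ rearrange (inv α′) (inv β′) (crossInv α′ β′) (negAbsSum α′) (negAbsSum β′) (bigNeg p α) (bigNeg p β) A Bp X
                   (trans (count-above p α) balance) (count-below p β β≁p) ⟩
    inv α′ + inv β′ + crossInv α′ β′ + (negAbsSum α′ + negAbsSum β′) + 2 ℕ.* (X + bigNeg p β)
      ≡⟨ cong (_+ 2 ℕ.* (X + bigNeg p β)) (cong₂ _+_ (inv-++ α′ β′) (negAbsSum-++ α′ β′)) ⟨
    ℓB (α′ ++ β′) + 2 ℕ.* (X + bigNeg p β)
      ∎
    where
    open ≡-Reasoning
    α′ : List ℤ
    α′ = map (shiftᶻ p) α
    β′ : List ℤ
    β′ = map (shiftᶻ p) β
    A : ℕ
    A = count ((+ p) <ᶻ_) α
    Bp : ℕ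
    Bp = count (_<ᶻ (+ p)) β
    X : ℕ
    X = count (λ x → ∣ x ∣ <ᵇ p) β
    rearrange : ∀ Iα Iβ C Nα Nβ Kα Kβ A B X → A + Kα ≡ X → B ≡ X + Kβ →
      Iα + (B + Iβ) + (A + C) + (Nα + Kα + (Nβ + Kβ)) ≡ Iα + Iβ + C + (Nα + Nβ) + 2 ℕ.* (X + Kβ)
    rearrange Iα Iβ C Nα Nβ Kα Kβ A B .(A + Kα) refl refl = ring Iα Iβ C Nα Nβ Kα Kβ A
      where
      ring : ∀ Iα Iβ C Nα Nβ Kα Kβ A →
        Iα + (A + Kα + Kβ + Iβ) + (A + C) + (Nα + Kα + (Nβ + Kβ)) ≡ Iα + Iβ + C + (Nα + Nβ) + 2 ℕ.* (A + Kα + Kβ)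
      ring = solve-∀

  withPosFrom-++ : ∀ i α γ → withPosFrom i (α ++ γ) ≡ withPosFrom i α ++ withPosFrom (i + length α) γ
  withPosFrom-++ i []      γ = cong (λ j → withPosFrom j γ) (sym (ℕ.+-identityʳ i))
  withPosFrom-++ i (x ∷ α) γ = cong ((i , x) ∷_)
    (trans (withPosFrom-++ (suc i) α γ) (cong (λ j → withPosFrom (suc i) α ++ withPosFrom j γ) (sym (ℕ.+-suc i (length α)))))

  letterValues-++ : ∀ i α γ → letterValues i (α ++ γ) ≡ letterValues i α ++ letterValues (i + length α) γ
  letterValues-++ i α γ = begin
    map proj₂ (filterᵇ (not ∘ isFixed) (withPosFrom i (α ++ γ)))
      ≡⟨ cong (map proj₂ ∘ filterᵇ (not ∘ isFixed)) (withPosFrom-++ i α γ) ⟩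
    map proj₂ (filterᵇ (not ∘ isFixed) (withPosFrom i α ++ withPosFrom (i + length α) γ))
      ≡⟨ cong (map proj₂) (filter-++ (T? ∘ not ∘ isFixed) (withPosFrom i α) _) ⟩
    map proj₂ (letters i α ++ letters (i + length α) γ)
      ≡⟨ map-++ proj₂ (letters i α) _ ⟩
    letterValues i α ++ letterValues (i + length α) γ
      ∎
    where open ≡-Reasoning

  letterValues-All : ∀ {P : ℤ → Set} i w → All P w → All P (letterValues i w)
  letterValues-All i []      []         = []
  letterValues-All i (x ∷ w) (px ∷ pw) rewrite letters-∷ i x w with isFixed (i , x)
  ... | true  = letterValues-All (suc i) w pw
  ... | false = px ∷ letterValues-All (suc i) w pw

  isFixed-shiftᶻ-below : ∀ p j x → j < p → Avoids p x → isFixed (j , shiftᶻ p x) ≡ isFixed (j , x)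
  isFixed-shiftᶻ-below p j x j<p x≁p with isFixed (j , x) in fixed
  ... | true rewrite isFixed-true⁻ j x fixed | shiftᶻ-small p (+ j) j<p = isFixed-refl j
  ... | false = isFixed-false j (shiftᶻ p x) not-fixed
    where
    not-fixed : shiftᶻ p x ≢ + j
    not-fixed e with <⊎> x≁p
    ... | inj₁ ∣x∣<p = isFixed-false⁻ j x fixed (trans (sym (shiftᶻ-small p x ∣x∣<p)) e)
    ... | inj₂ p<∣x∣ = ℕ.<-irrefl refl (ℕ.<-≤-trans j<p (subst (p ≤_) ∣shifted∣≡j (<⇒≤∸1 p<∣x∣)))
      where
      ∣shifted∣≡j : ∣ x ∣ ∸ 1 ≡ j
      ∣shifted∣≡j = trans (sym (shift-> p<∣x∣)) (trans (sym (∣shiftᶻ∣ p x)) (cong ∣_∣ e))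

  isFixed-shiftᶻ-above : ∀ p j x → 1 ≤ p → p ≤ j → Avoids p x → isFixed (j , shiftᶻ p x) ≡ isFixed (suc j , x)
  isFixed-shiftᶻ-above p j x 1≤p p≤j x≁p with isFixed (suc j , x) in fixed
  ... | true rewrite isFixed-true⁻ (suc j) x fixed | <ᵇ-true {p} {suc j} (s≤s p≤j) = isFixed-refl j
  ... | false = isFixed-false j (shiftᶻ p x) not-fixed
    where
    not-fixed : shiftᶻ p x ≢ + j
    not-fixed e with <⊎> x≁p
    ... | inj₁ ∣x∣<p =
      ℕ.<-irrefl refl (ℕ.<-≤-trans ∣x∣<p (subst (p ≤_) (trans (cong ∣_∣ (sym e)) (cong ∣_∣ (shiftᶻ-small p x ∣x∣<p))) p≤j))
    ... | inj₂ p<∣x∣ = isFixed-false⁻ (suc j) x fixed (positive x (trans (sym (isNeg-shiftᶻ p x 1≤p)) (cong isNeg e)) ∣x∣≡j+1)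
      where
      ∣x∣≡j+1 : ∣ x ∣ ≡ suc j
      ∣x∣≡j+1 = trans (sym (ℕ.suc-pred ∣ x ∣ ⦃ ℕ.>-nonZero (ℕ.<-≤-trans (s≤s z≤n) p<∣x∣) ⦄))
                      (cong suc (trans (sym (shift-> p<∣x∣)) (trans (sym (∣shiftᶻ∣ p x)) (cong ∣_∣ e))))
      positive : ∀ x → isNeg x ≡ false → ∣ x ∣ ≡ suc j → x ≡ + suc j
      positive (+ a) _ refl = refl

  letterValues-shiftᶻ-below : ∀ p j w → j + length w ≤ p → All (Avoids p) w →
                              letterValues j (map (shiftᶻ p) w) ≡ map (shiftᶻ p) (letterValues j w)
  letterValues-shiftᶻ-below p j []      _  _            = refl
  letterValues-shiftᶻ-below p j (x ∷ w) le (x≁p ∷ w≁p)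
    rewrite letters-∷ j (shiftᶻ p x) (map (shiftᶻ p) w) | letters-∷ j x w
          | isFixed-shiftᶻ-below p j x (ℕ.<-≤-trans (ℕ.m<m+n j (s≤s z≤n)) le) x≁p
    with isFixed (j , x)
  ... | true  = letterValues-shiftᶻ-below p (suc j) w (subst (_≤ p) (ℕ.+-suc j (length w)) le) w≁p
  ... | false = cong (shiftᶻ p x ∷_) (letterValues-shiftᶻ-below p (suc j) w (subst (_≤ p) (ℕ.+-suc j (length w)) le) w≁p)

  letterValues-shiftᶻ-above : ∀ p j w → 1 ≤ p → p ≤ j → All (Avoids p) w →
                              letterValues j (map (shiftᶻ p) w) ≡ map (shiftᶻ p) (letterValues (suc j) w)
  letterValues-shiftᶻ-above p j []      _   _   _            = refl
  letterValues-shiftᶻ-above p j (x ∷ w) 1≤p p≤j (x≁p ∷ w≁p)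
    rewrite letters-∷ j (shiftᶻ p x) (map (shiftᶻ p) w) | letters-∷ (suc j) x w
          | isFixed-shiftᶻ-above p j x 1≤p p≤j x≁p
    with isFixed (suc j , x)
  ... | true  = letterValues-shiftᶻ-above p (suc j) w 1≤p (ℕ.m≤n⇒m≤1+n p≤j) w≁p
  ... | false = cong (shiftᶻ p x ∷_) (letterValues-shiftᶻ-above p (suc j) w 1≤p (ℕ.m≤n⇒m≤1+n p≤j) w≁p)

  reduce-shiftᶻ : ∀ p τ → 1 ≤ p → All (Avoids p) τ → reduce (map (shiftᶻ p) τ) ≡ reduce τ
  reduce-shiftᶻ p τ 1≤p τ≁p = trans (sym (map-∘ τ)) (map-cong-local (All.tabulate entry))
    where
    ≤ᵇ-shift : ∀ {x y} → Avoids p x → Avoids p y →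
               (∣ shiftᶻ p y ∣ ≤ᵇ ∣ shiftᶻ p x ∣) ≡ (∣ y ∣ ≤ᵇ ∣ x ∣)
    ≤ᵇ-shift {x} {y} x≁p y≁p = begin
      ∣ shiftᶻ p y ∣ ≤ᵇ ∣ shiftᶻ p x ∣
        ≡⟨ cong₂ _≤ᵇ_ (∣shiftᶻ∣ p y) (∣shiftᶻ∣ p x) ⟩
      shift p ∣ y ∣ ≤ᵇ shift p ∣ x ∣
        ≡⟨ not-involutive (shift p ∣ y ∣ ≤ᵇ shift p ∣ x ∣) ⟨
      not (not (shift p ∣ y ∣ ≤ᵇ shift p ∣ x ∣))
        ≡⟨ cong not (trans (not-≤ᵇ (shift p ∣ y ∣) (shift p ∣ x ∣)) (shift-<ᵇ {p} {∣ x ∣} {∣ y ∣} x≁p y≁p)) ⟩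
      not (∣ x ∣ <ᵇ ∣ y ∣)
        ≡⟨ cong not (not-≤ᵇ ∣ y ∣ ∣ x ∣) ⟨
      not (not (∣ y ∣ ≤ᵇ ∣ x ∣))
        ≡⟨ not-involutive (∣ y ∣ ≤ᵇ ∣ x ∣) ⟩
      ∣ y ∣ ≤ᵇ ∣ x ∣ ∎
      where open ≡-Reasoning
    entry : ∀ {x} → x ∈ τ →
            withSignOf (shiftᶻ p x) (count (λ y → ∣ y ∣ ≤ᵇ ∣ shiftᶻ p x ∣) (map (shiftᶻ p) τ))
              ≡ withSignOf x (count (λ y → ∣ y ∣ ≤ᵇ ∣ x ∣) τ)
    entry {x} x∈ = trans (withSignOf-cong (shiftᶻ p x) x _ (isNeg-shiftᶻ p x 1≤p)) (cong (withSignOf x) (begin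
      count (λ y → ∣ y ∣ ≤ᵇ ∣ shiftᶻ p x ∣) (map (shiftᶻ p) τ)
        ≡⟨ count≡countᵇ _ (map (shiftᶻ p) τ) ⟩
      countᵇ (λ y → ∣ y ∣ ≤ᵇ ∣ shiftᶻ p x ∣) (map (shiftᶻ p) τ)
        ≡⟨ countᵇ-map _ (shiftᶻ p) τ ⟩
      countᵇ (λ y → ∣ shiftᶻ p y ∣ ≤ᵇ ∣ shiftᶻ p x ∣) τ
        ≡⟨ countᵇ-cong (All.map (λ {y} → ≤ᵇ-shift {x} {y} (All.lookup τ≁p x∈)) τ≁p) ⟩
      countᵇ (λ y → ∣ y ∣ ≤ᵇ ∣ x ∣) τ
        ≡⟨ count≡countᵇ _ τ ⟨
      count (λ y → ∣ y ∣ ≤ᵇ ∣ x ∣) τ ∎))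
      where open ≡-Reasoning

  NoFixedPointFrom : ℕ → List ℤ → Set
  NoFixedPointFrom i π = All (λ p → not (isFixed p) ≡ true) (withPosFrom i π)

  firstFixedPoint : ∀ i π → NoFixedPointFrom i π ⊎
                    ∃ λ α → ∃₂ λ x β → π ≡ α ++ x ∷ β × isFixed (i + length α , x) ≡ true
  firstFixedPoint i []      = inj₁ []
  firstFixedPoint i (x ∷ π) with isFixed (i , x) in fixed
  ... | true  = inj₂ ([] , x , π , refl , subst (λ j → isFixed (j , x) ≡ true) (sym (ℕ.+-identityʳ i)) fixed)
  ... | false with firstFixedPoint (suc i) π
  ...   | inj₁ none = inj₁ (cong not fixed ∷ none)
  ...   | inj₂ (α , y , β , refl , fixed′) =
    inj₂ (x ∷ α , y , β , refl , subst (λ j → isFixed (j , y) ≡ true) (sym (ℕ.+-suc i (length α))) fixed′)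

  dp-deranged : ∀ {n π} → IsSignedPerm n π → NoFixedPointFrom 1 π → dp π ≡ π
  dp-deranged {n} {π} sp none = begin
    dp π                      ≡⟨ dp≡map-standardise ⟩
    map standardise τ         ≡⟨ map-id-local (All.tabulate standardise-id) ⟩
    τ                         ≡⟨ cong (map proj₂) letters≡ ⟩
    map proj₂ (withPos π)     ≡⟨ map-proj₂-withPosFrom 1 π ⟩
    π                         ∎
    where
    open ≡-Reasoning
    open OfSignedPerm sp
    letters≡ : letters 1 π ≡ withPos π
    letters≡ = filter-all (T? ∘ not ∘ isFixed) (All.map (Equivalence.from T-≡) none)
    P≡range : P ≡ range 1 (length π)
    P≡range = trans (cong (map proj₁) letters≡) (map-proj₁-withPosFrom 1 π)
    rank-id : map (rank P) P ≡ P
    rank-id = begin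
      map (rank P) P
        ≡⟨ map-rank-increasing P (letterPositions-increasing 1 π) ⟩
      range 1 (length P)
        ≡⟨ cong (range 1) (trans (length-map proj₁ L) (trans (cong length letters≡) (length-withPosFrom 1 π))) ⟩
      range 1 (length π)
        ≡⟨ P≡range ⟨
      P ∎
    standardise-id : ∀ {t} → t ∈ τ → standardise t ≡ t
    standardise-id t∈ with (j , t) , a∈ , refl ← ∈-map⁻ proj₂ t∈ =
      trans (cong (withSignOf t) (map≡id⇒fixed (rank P) rank-id (∣letter∣∈P a∈))) (withSignOf-∣∣ t)

  map-shift-range : ∀ p j m → p ≤ j → map (shift p) (range (suc j) m) ≡ range j m
  map-shift-range p j zero    _   = refl
  map-shift-range p j (suc m) p≤j = cong₂ _∷_ (shift-> (s≤s p≤j)) (map-shift-range p (suc j) m (ℕ.m≤n⇒m≤1+n p≤j))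

  module Deletion {n} (α β : List ℤ) (sp : IsSignedPerm (suc n) (α ++ (+ suc (length α)) ∷ β)) where

    p : ℕ
    p = suc (length α)
    R₁ : List ℕ
    R₁ = range 1 (length α)
    R₂ : List ℕ
    R₂ = range (suc p) (length β)

    1≤p : 1 ≤ p
    1≤p = s≤s z≤n

    length-αβ : length α + length β ≡ n
    length-αβ = ℕ.suc-injective (begin
      suc (length α + length β)   ≡⟨ ℕ.+-suc (length α) (length β) ⟨
      length α + suc (length β)   ≡⟨ length-++ α ⟨
      length (α ++ + p ∷ β)       ≡⟨ length-signedPerm sp ⟩
      suc n                       ∎)
      where open ≡-Reasoning

    ∣αβ∣↭ : map ∣_∣ α ++ map ∣_∣ β ↭ R₁ ++ R₂
    ∣αβ∣↭ = ↭.drop-∷ (begin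
      p ∷ map ∣_∣ α ++ map ∣_∣ β       ↭⟨ ↭.shift p (map ∣_∣ α) (map ∣_∣ β) ⟨
      map ∣_∣ α ++ p ∷ map ∣_∣ β       ≡⟨ map-++ ∣_∣ α (+ p ∷ β) ⟨
      map ∣_∣ (α ++ + p ∷ β)           ↭⟨ sp ⟩
      range 1 (suc n)                  ≡⟨ cong (range 1) (trans (sym (length-signedPerm sp)) (length-++ α)) ⟩
      range 1 (length α + suc (length β)) ≡⟨ range-++ 1 (length α) (suc (length β)) ⟩
      R₁ ++ p ∷ R₂                     ↭⟨ ↭.shift p R₁ R₂ ⟩
      p ∷ R₁ ++ R₂                     ∎)
      where open PermutationReasoning

    avoids : ∀ {a} → a ∈ map ∣_∣ α ++ map ∣_∣ β → a ≢ p
    avoids a∈ refl with ∈-++⁻ R₁ (↭.∈-resp-↭ ∣αβ∣↭ a∈)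
    ... | inj₁ p∈R₁ = ℕ.<-irrefl refl (proj₂ (∈-range⁻ 1 (length α) p∈R₁))
    ... | inj₂ p∈R₂ = ℕ.<-irrefl refl (proj₁ (∈-range⁻ (suc p) (length β) p∈R₂))

    α≁p : All (Avoids p) α
    α≁p = All.tabulate λ x∈ → avoids (∈-++⁺ˡ (∈-map⁺ ∣_∣ x∈))

    β≁p : All (Avoids p) β
    β≁p = All.tabulate λ x∈ → avoids (∈-++⁺ʳ (map ∣_∣ α) (∈-map⁺ ∣_∣ x∈))

    -- Both sides count the values below p that are missing from the first |α| positions.
    balance : count (λ x → p <ᵇ ∣ x ∣) α ≡ count (λ x → ∣ x ∣ <ᵇ p) β
    balance = ℕ.+-cancelˡ-≡ (count below α) _ _ (trans split-α (sym split-αβ))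
      where
      below : ℤ → Bool
      below = λ x → ∣ x ∣ <ᵇ p
      split-α : count below α + count (λ x → p <ᵇ ∣ x ∣) α ≡ length α
      split-α = begin
        count below α + count (λ x → p <ᵇ ∣ x ∣) α
          ≡⟨ count-+ below (λ x → p <ᵇ ∣ x ∣) (λ _ → true) {α} (All.map (λ {x} → one-side x) α≁p) ⟩
        count (λ _ → true) α
          ≡⟨ count≡countᵇ _ α ⟩
        countᵇ (λ _ → true) α
          ≡⟨ countᵇ-all (λ _ → true) {α} (All.tabulate λ _ → refl) ⟩
        length α ∎
        where
        open ≡-Reasoning
        one-side : ∀ x → Avoids p x → ⟦ ∣ x ∣ <ᵇ p ⟧ + ⟦ p <ᵇ ∣ x ∣ ⟧ ≡ 1
        one-side x x≁p with <⊎> x≁p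
        ... | inj₁ ∣x∣<p rewrite <ᵇ-true ∣x∣<p | <ᵇ-false {p} {∣ x ∣} (ℕ.<⇒≤ ∣x∣<p) = refl
        ... | inj₂ p<∣x∣ rewrite <ᵇ-true p<∣x∣ | <ᵇ-false {∣ x ∣} {p} (ℕ.<⇒≤ p<∣x∣) = refl
      split-αβ : count below α + count below β ≡ length α
      split-αβ = begin
        count below α + count below β                        ≡⟨ count-++ below α β ⟨
        count below (α ++ β)                                 ≡⟨ count≡countᵇ below (α ++ β) ⟩
        countᵇ below (α ++ β)                                ≡⟨ countᵇ-map (_<ᵇ p) ∣_∣ (α ++ β) ⟨
        countᵇ (_<ᵇ p) (map ∣_∣ (α ++ β))                    ≡⟨ cong (countᵇ (_<ᵇ p)) (map-++ ∣_∣ α β) ⟩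
        countᵇ (_<ᵇ p) (map ∣_∣ α ++ map ∣_∣ β)              ≡⟨ countᵇ-↭ (_<ᵇ p) ∣αβ∣↭ ⟩
        countᵇ (_<ᵇ p) (R₁ ++ R₂)                            ≡⟨ countᵇ-++ (_<ᵇ p) R₁ R₂ ⟩
        countᵇ (_<ᵇ p) R₁ + countᵇ (_<ᵇ p) R₂
          ≡⟨ cong₂ _+_ (countᵇ-all _ (All.tabulate λ a∈ → <ᵇ-true (proj₂ (∈-range⁻ 1 (length α) a∈))))
                       (countᵇ-none _ (All.tabulate λ a∈ → <ᵇ-false (ℕ.<⇒≤ (proj₁ (∈-range⁻ (suc p) (length β) a∈))))) ⟩
        length R₁ + 0                                        ≡⟨ trans (ℕ.+-identityʳ _) (length-range 1 (length α)) ⟩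
        length α                                             ∎
        where open ≡-Reasoning

    deleted : List ℤ
    deleted = map (shiftᶻ p) α ++ map (shiftᶻ p) β

    deleted-signedPerm : IsSignedPerm n deleted
    deleted-signedPerm = begin
      map ∣_∣ deleted
        ≡⟨ map-++ ∣_∣ (map (shiftᶻ p) α) (map (shiftᶻ p) β) ⟩
      map ∣_∣ (map (shiftᶻ p) α) ++ map ∣_∣ (map (shiftᶻ p) β)
        ≡⟨ cong₂ _++_ (∣shifted∣ α) (∣shifted∣ β) ⟩
      map (shift p) (map ∣_∣ α) ++ map (shift p) (map ∣_∣ β)
        ≡⟨ map-++ (shift p) (map ∣_∣ α) (map ∣_∣ β) ⟨
      map (shift p) (map ∣_∣ α ++ map ∣_∣ β)
        ↭⟨ ↭.map⁺ (shift p) ∣αβ∣↭ ⟩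
      map (shift p) (R₁ ++ R₂)
        ≡⟨ map-++ (shift p) R₁ R₂ ⟩
      map (shift p) R₁ ++ map (shift p) R₂
        ≡⟨ cong₂ _++_ R₁-fixed (map-shift-range p p (length β) ℕ.≤-refl) ⟩
      R₁ ++ range p (length β)
        ≡⟨ range-++ 1 (length α) (length β) ⟨
      range 1 (length α + length β)
        ≡⟨ cong (range 1) length-αβ ⟩
      range 1 n ∎
      where
      open PermutationReasoning
      ∣shifted∣ : ∀ w → map ∣_∣ (map (shiftᶻ p) w) ≡ map (shift p) (map ∣_∣ w)
      ∣shifted∣ w = trans (sym (map-∘ w)) (trans (map-cong (∣shiftᶻ∣ p) w) (map-∘ w))
      R₁-fixed : map (shift p) R₁ ≡ R₁
      R₁-fixed = map-id-local (All.tabulate λ a∈ → shift-< (proj₂ (∈-range⁻ 1 (length α) a∈)))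

    letterValues-π : letterValues 1 (α ++ + p ∷ β) ≡ letterValues 1 α ++ letterValues (suc p) β
    letterValues-π = begin
      letterValues 1 (α ++ + p ∷ β)
        ≡⟨ letterValues-++ 1 α (+ p ∷ β) ⟩
      letterValues 1 α ++ letterValues p (+ p ∷ β)
        ≡⟨ cong (λ ls → letterValues 1 α ++ map proj₂ ls) (letters-∷ p (+ p) β) ⟩
      letterValues 1 α ++ map proj₂ (if isFixed (p , + p) then letters (suc p) β else (p , + p) ∷ letters (suc p) β)
        ≡⟨ cong (λ b → letterValues 1 α ++ map proj₂ (if b then letters (suc p) β else (p , + p) ∷ letters (suc p) β)) (isFixed-refl p) ⟩
      letterValues 1 α ++ letterValues (suc p) β ∎
      where open ≡-Reasoning

    letterValues-deleted : letterValues 1 deleted ≡ map (shiftᶻ p) (letterValues 1 α ++ letterValues (suc p) β)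
    letterValues-deleted = begin
      letterValues 1 deleted
        ≡⟨ letterValues-++ 1 (map (shiftᶻ p) α) (map (shiftᶻ p) β) ⟩
      letterValues 1 (map (shiftᶻ p) α) ++ letterValues (suc (length (map (shiftᶻ p) α))) (map (shiftᶻ p) β)
        ≡⟨ cong (λ j → letterValues 1 (map (shiftᶻ p) α) ++ letterValues (suc j) (map (shiftᶻ p) β)) (length-map (shiftᶻ p) α) ⟩
      letterValues 1 (map (shiftᶻ p) α) ++ letterValues p (map (shiftᶻ p) β)
        ≡⟨ cong₂ _++_ (letterValues-shiftᶻ-below p 1 α ℕ.≤-refl α≁p) (letterValues-shiftᶻ-above p p β 1≤p ℕ.≤-refl β≁p) ⟩
      map (shiftᶻ p) (letterValues 1 α) ++ map (shiftᶻ p) (letterValues (suc p) β)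
        ≡⟨ map-++ (shiftᶻ p) (letterValues 1 α) (letterValues (suc p) β) ⟨
      map (shiftᶻ p) (letterValues 1 α ++ letterValues (suc p) β)
        ∎
      where open ≡-Reasoning

    dp-deleted : dp deleted ≡ dp (α ++ + p ∷ β)
    dp-deleted = begin
      reduce (letterValues 1 deleted)                                  ≡⟨ cong reduce letterValues-deleted ⟩
      reduce (map (shiftᶻ p) (letterValues 1 α ++ letterValues (suc p) β))
        ≡⟨ reduce-shiftᶻ p _ 1≤p (All.++⁺ (letterValues-All 1 α α≁p) (letterValues-All (suc p) β β≁p)) ⟩
      reduce (letterValues 1 α ++ letterValues (suc p) β)              ≡⟨ cong reduce letterValues-π ⟨
      reduce (letterValues 1 (α ++ + p ∷ β))                           ∎
      where open ≡-Reasoning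

  ℓB-dp : ∀ {n π} → IsSignedPerm n π → ∃ λ c → ℓB π ≡ ℓB (dp π) + 2 ℕ.* c
  ℓB-dp {zero} {[]} _ = 0 , refl
  ℓB-dp {zero} {x ∷ π} sp with () ← length-signedPerm {π = x ∷ π} sp
  ℓB-dp {suc n} {π} sp with firstFixedPoint 1 π
  ... | inj₁ none = 0 , trans (cong ℓB (sym (dp-deranged sp none))) (sym (ℕ.+-identityʳ _))
  ... | inj₂ (α , x , β , refl , fixed) with refl ← isFixed-true⁻ (suc (length α)) x fixed =
    c + X , (begin
      ℓB (α ++ + p ∷ β)
        ≡⟨ ℓB-delete p α β 1≤p α≁p β≁p balance ⟩
      ℓB deleted + 2 ℕ.* X
        ≡⟨ cong (_+ 2 ℕ.* X) (trans ℓB-deleted (cong (λ σ → ℓB σ + 2 ℕ.* c) dp-deleted)) ⟩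
      ℓB (dp (α ++ + p ∷ β)) + 2 ℕ.* c + 2 ℕ.* X
        ≡⟨ ring (ℓB (dp (α ++ + p ∷ β))) c X ⟩
      ℓB (dp (α ++ + p ∷ β)) + 2 ℕ.* (c + X)
        ∎)
    where
    open ≡-Reasoning
    open Deletion α β sp
    X : ℕ
    X = count (λ x → ∣ x ∣ <ᵇ p) β + bigNeg p β
    c : ℕ
    c = proj₁ (ℓB-dp deleted-signedPerm)
    ℓB-deleted : ℓB deleted ≡ ℓB (dp deleted) + 2 ℕ.* c
    ℓB-deleted = proj₂ (ℓB-dp deleted-signedPerm)
    ring : ∀ a c x → a + 2 ℕ.* c + 2 ℕ.* x ≡ a + 2 ℕ.* (c + x)
    ring = solve-∀

module Fibre {n k : ℕ} (k≤n : k ≤ n) {σ : List ℤ} (derangement : IsDerangementB k σ) where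

  open import Data.Bool using (Bool; true; T; not)
  open import Data.Bool.Properties using (∧-conicalˡ; ∧-conicalʳ)
  open import Data.Nat as ℕ using (suc; _∸_)
  import Data.Nat.Properties as ℕ
  open import Data.Nat.ListAction using (sum)
  open import Data.Integer as ℤ using (+_; -_; _+_; _^_)
  import Data.Integer.Properties as ℤ
  open import Data.Integer.Tactic.RingSolver using (solve-∀)
  open import Data.List using (map; length; filterᵇ)
  open import Data.List.Properties using (length-map; map-∘; map-id-local; ≡-dec)
  open import Data.List.Relation.Unary.All as All using (All)
  open import Data.List.Membership.Propositional using (_∈_)
  open import Data.List.Membership.Propositional.Properties using (∈-map⁺; ∈-map⁻; ∈-filter⁺; ∈-filter⁻)
  open import Data.List.Relation.Binary.Permutation.Propositional using (_↭_)
  open import Data.List.Relation.Unary.Unique.Propositional using (Unique)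
  import Data.List.Relation.Unary.Unique.Propositional.Properties as Unique
  open import Data.Maybe using (just)
  open import Data.Product using (_,_; proj₁; proj₂)
  open import Function using (_∘_)
  open import Function.Bundles using (mk⇔)
  open import Relation.Nullary using (yes; no)
  open import Relation.Nullary.Decidable using (T?; ⌊_⌋)
  open import Relation.Binary.PropositionalEquality
  open Lists
  open QBinomial
  open Compositions
  open SignedPermutations
  open FixedPoints
  open Standardisation
  open LengthParity using (ℓB-dp)
  open Interleaving using (interleave)

  signedPerm : IsSignedPerm k σ
  signedPerm = isSignedPerm⇒IsSignedPerm k σ (∧-conicalˡ _ _ derangement)

  deranged : noFixedPoints σ ≡ true
  deranged = ∧-conicalʳ _ _ derangement

  m : ℕ
  m = n ∸ k

  m+k≡n : m ℕ.+ k ≡ n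
  m+k≡n = ℕ.m∸n+n≡m k≤n

  length-σ : length σ ≡ k
  length-σ = length-signedPerm signedPerm

  comps : List (List ℕ)
  comps = compositions m k

  module Inflated {g} (g∈ : g ∈ comps) = Inflation signedPerm deranged g (proj₁ (All.lookup (compositions-sound m k) g∈))

  inflate-signedPerm-n : ∀ {g} → g ∈ comps → IsSignedPerm n (inflate σ g)
  inflate-signedPerm-n {g} g∈ = subst (λ N → IsSignedPerm N (inflate σ g)) sum+k≡n (Inflated.inflate-signedPerm g∈)
    where
    sum+k≡n : sum g ℕ.+ k ≡ n
    sum+k≡n = trans (cong (ℕ._+ k) (proj₂ (All.lookup (compositions-sound m k) g∈))) m+k≡n

  gaps-composition : ∀ {π} → IsSignedPerm n π → dp π ≡ σ → IsComposition m k (gaps 1 π)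
  gaps-composition {π} sp dp≡σ = trans (length-gaps 1 π) (cong suc length-letters) , sum≡m
    where
    length-letters : length (letters 1 π) ≡ k
    length-letters = begin
      length (letters 1 π)                 ≡⟨ length-map proj₂ (letters 1 π) ⟨
      length (letterValues 1 π)            ≡⟨ length-map _ (letterValues 1 π) ⟨
      length (dp π)                        ≡⟨ cong length dp≡σ ⟩
      length σ                             ≡⟨ length-σ ⟩
      k                                    ∎
      where open ≡-Reasoning
    sum≡m : sum (gaps 1 π) ≡ m
    sum≡m = begin
      sum (gaps 1 π)                                  ≡⟨ ℕ.m+n∸n≡m (sum (gaps 1 π)) k ⟨
      sum (gaps 1 π) ℕ.+ k ∸ k                        ≡⟨ cong (λ l → sum (gaps 1 π) ℕ.+ l ∸ k) length-letters ⟨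
      sum (gaps 1 π) ℕ.+ length (letters 1 π) ∸ k      ≡⟨ cong (_∸ k) (trans (sum-gaps 1 π) (length-signedPerm sp)) ⟩
      n ∸ k                                           ∎
      where open ≡-Reasoning

  inFibre : List ℤ → Bool
  inFibre π = ⌊ ≡-dec ℤ._≟_ (dp π) σ ⌋

  fibre : List (List ℤ)
  fibre = filterᵇ inFibre (B n)

  inFibre-true⁻ : ∀ π → T (inFibre π) → dp π ≡ σ
  inFibre-true⁻ π t with ≡-dec ℤ._≟_ (dp π) σ
  ... | yes dp≡σ = dp≡σ

  inFibre-true : ∀ π → dp π ≡ σ → T (inFibre π)
  inFibre-true π dp≡σ with ≡-dec ℤ._≟_ (dp π) σ
  ... | yes _    = _
  ... | no dp≢σ = dp≢σ dp≡σ

  fibre↭inflations : fibre ↭ map (inflate σ) comps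
  fibre↭inflations = unique-same-∈⇒↭ unique-fibre unique-inflations (mk⇔ to from)
    where
    unique-fibre : Unique fibre
    unique-fibre = Unique.filter⁺ (T? ∘ inFibre) (B-unique n)
    gaps-inflations : map (gaps 1) (map (inflate σ) comps) ≡ comps
    gaps-inflations = trans (sym (map-∘ comps)) (map-id-local (All.tabulate Inflated.gaps-inflate))
    unique-inflations : Unique (map (inflate σ) comps)
    unique-inflations = Unique.map⁻ {f = gaps 1} (subst Unique (sym gaps-inflations) (compositions-unique m k))
    to : ∀ {π} → π ∈ fibre → π ∈ map (inflate σ) comps
    to {π} π∈ with π∈B , t ← ∈-filter⁻ (T? ∘ inFibre) {xs = B n} π∈ = subst (_∈ map (inflate σ) comps) (sym π≡) g∈
      where
      sp : IsSignedPerm n π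
      sp = ∈-B⁻ π∈B
      dp≡σ : dp π ≡ σ
      dp≡σ = inFibre-true⁻ π t
      π≡ : π ≡ inflate σ (gaps 1 π)
      π≡ = trans (inflate-dp-gaps sp) (cong (λ τ → inflate τ (gaps 1 π)) dp≡σ)
      g∈ : inflate σ (gaps 1 π) ∈ map (inflate σ) comps
      g∈ = ∈-map⁺ (inflate σ) (compositions-complete m k (gaps 1 π) (gaps-composition sp dp≡σ))
    from : ∀ {π} → π ∈ map (inflate σ) comps → π ∈ fibre
    from π∈ with g , g∈ , refl ← ∈-map⁻ (inflate σ) π∈ =
      ∈-filter⁺ (T? ∘ inFibre) (∈-B⁺ (inflate-signedPerm-n g∈)) (inFibre-true (inflate σ g) (Inflated.dp-inflate g∈))

  module Weights (q : ℤ) where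

    Q : ℤ
    Q = q * q
    C : ℤ
    C = (- (+ 1)) ^ ℓB σ * q ^ count isNeg σ

    weight-factor : ∀ π c M → ℓB π ≡ ℓB σ ℕ.+ 2 ℕ.* c → fmaj π ≡ 2 ℕ.* M ℕ.+ count isNeg σ →
                    weight q π ≡ C * Q ^ M
    weight-factor π c M ℓB≡ fmaj≡ = begin
      (- (+ 1)) ^ ℓB π * q ^ fmaj π
        ≡⟨ cong₂ (λ a b → (- (+ 1)) ^ a * q ^ b) ℓB≡ fmaj≡ ⟩
      (- (+ 1)) ^ (ℓB σ ℕ.+ 2 ℕ.* c) * q ^ (2 ℕ.* M ℕ.+ count isNeg σ)
        ≡⟨ cong₂ _*_ (ℤ.^-distribˡ-+-* (- (+ 1)) (ℓB σ) (2 ℕ.* c)) (ℤ.^-distribˡ-+-* q (2 ℕ.* M) (count isNeg σ)) ⟩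
      (- (+ 1)) ^ ℓB σ * (- (+ 1)) ^ (2 ℕ.* c) * (q ^ (2 ℕ.* M) * q ^ count isNeg σ)
        ≡⟨ cong₂ (λ a b → (- (+ 1)) ^ ℓB σ * a * (b * q ^ count isNeg σ)) (even-power (- (+ 1)) c) (even-power q M) ⟩
      (- (+ 1)) ^ ℓB σ * (- (+ 1) * - (+ 1)) ^ c * (Q ^ M * q ^ count isNeg σ)
        ≡⟨ cong (λ a → (- (+ 1)) ^ ℓB σ * a * (Q ^ M * q ^ count isNeg σ)) (ℤ.^-zeroˡ c) ⟩
      (- (+ 1)) ^ ℓB σ * + 1 * (Q ^ M * q ^ count isNeg σ)
        ≡⟨ ring ((- (+ 1)) ^ ℓB σ) (Q ^ M) (q ^ count isNeg σ) ⟩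
      C * Q ^ M
        ∎
      where
      open ≡-Reasoning
      even-power : ∀ x c → x ^ (2 ℕ.* c) ≡ (x * x) ^ c
      even-power x c = trans (sym (ℤ.^-*-assoc x 2 c)) (cong (_^ c) (cong (x *_) (ℤ.*-identityʳ x)))
      ring : ∀ S X N → S * + 1 * (X * N) ≡ S * N * X
      ring = solve-∀

    weight-inflate : ∀ {g} → g ∈ comps → weight q (inflate σ g) ≡ C * Q ^ pmaj 1 (interleave g (withPos σ))
    weight-inflate {g} g∈ with c , ℓB≡ ← ℓB-dp (inflate-signedPerm-n g∈) =
      weight-factor π c (pmaj 1 (interleave g (withPos σ)))
        (trans ℓB≡ (cong (λ τ → ℓB τ ℕ.+ 2 ℕ.* c) (Inflated.dp-inflate g∈))) fmaj≡
      where
      π : List ℤ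
      π = inflate σ g
      sp : IsSignedPerm n π
      sp = inflate-signedPerm-n g∈
      open OfSignedPerm sp using (maj≺-dp; count-isNeg-dp)
      fmaj≡ : fmaj π ≡ 2 ℕ.* pmaj 1 (interleave g (withPos σ)) ℕ.+ count isNeg σ
      fmaj≡ = cong₂ (λ M ν → 2 ℕ.* M ℕ.+ ν)
        (trans maj≺-dp (cong₂ (λ h τ → pmaj 1 (interleave h (withPos τ))) (Inflated.gaps-inflate g∈) (Inflated.dp-inflate g∈)))
        (trans count-isNeg-dp (cong (count isNeg) (Inflated.dp-inflate g∈)))

    weight-σ : weight q σ ≡ C * Q ^ pmaj 1 (map just (withPos σ))
    weight-σ = weight-factor σ 0 (pmaj 1 (map just (withPos σ)))
      (sym (ℕ.+-identityʳ (ℓB σ))) (cong (λ M → 2 ℕ.* M ℕ.+ count isNeg σ) maj≺-σ)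
      where
      maj≺-σ : maj≺ σ ≡ pmaj 1 (map just (withPos σ))
      maj≺-σ = trans (majFrom≡pmaj-holeView 1 σ (signedPerm-adjacentDistinct signedPerm))
        (cong (pmaj 1) (holeView-deranged 1 σ (All.tabulate (allᵇ⁻ (λ p → not (isFixed p)) (withPos σ) deranged))))

    lhsSum≡weight*qbinom : lhsSum n σ q ≡ weight q σ * qbinom Q m k
    lhsSum≡weight*qbinom = begin
      ∑ (weight q) fibre
        ≡⟨ ∑-↭ (weight q) fibre↭inflations ⟩
      ∑ (weight q) (map (inflate σ) comps)
        ≡⟨ ∑-map (weight q) (inflate σ) comps ⟩
      ∑ (weight q ∘ inflate σ) comps
        ≡⟨ ∑-cong (All.tabulate weight-inflate) ⟩
      ∑ (λ g → C * Q ^ pmaj 1 (interleave g (withPos σ))) comps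
        ≡⟨ ∑-*ˡ C (λ g → Q ^ pmaj 1 (interleave g (withPos σ))) comps ⟩
      C * ∑ (λ g → Q ^ pmaj 1 (interleave g (withPos σ))) (compositions m k)
        ≡⟨ cong (λ l → C * ∑ (λ g → Q ^ pmaj 1 (interleave g (withPos σ))) (compositions m l)) length-withPos ⟨
      C * ∑ (λ g → Q ^ pmaj 1 (interleave g (withPos σ))) (compositions m (length (withPos σ)))
        ≡⟨ cong (C *_) (∑-pmaj-interleave m (withPos σ)) ⟩
      C * (Q ^ pmaj 1 (map just (withPos σ)) * qbinom Q m (length (withPos σ)))
        ≡⟨ cong (λ l → C * (Q ^ pmaj 1 (map just (withPos σ)) * qbinom Q m l)) length-withPos ⟩
      C * (Q ^ pmaj 1 (map just (withPos σ)) * qbinom Q m k)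
        ≡⟨ ℤ.*-assoc C _ _ ⟨
      C * Q ^ pmaj 1 (map just (withPos σ)) * qbinom Q m k
        ≡⟨ cong (_* qbinom Q m k) weight-σ ⟨
      weight q σ * qbinom Q m k
        ∎
      where
      open ≡-Reasoning
      open GeneratingFunction compatibleᴸ Q using (∑-pmaj-interleave)
      length-withPos : length (withPos σ) ≡ k
      length-withPos = trans (length-withPosFrom 1 σ) length-σ

open import Relation.Binary.PropositionalEquality using (cong; trans; module ≡-Reasoning)
open import Data.Integer.Tactic.RingSolver using (solve-∀)

proposition3p6 : (n k : ℕ) → k ≤ n → (σ : List ℤ) → IsDerangementB k σ →
    (q : ℤ) →
    lhsSum n σ q * qfact k (q * q) * qfact (n ∸ k) (q * q)
      ≡ weight q σ * qfact n (q * q)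
proposition3p6 n k k≤n σ derangement q = begin
  lhsSum n σ q * qfact k Q * qfact m Q
    ≡⟨ cong (λ s → s * qfact k Q * qfact m Q) lhsSum≡weight*qbinom ⟩
  weight q σ * qbinom Q m k * qfact k Q * qfact m Q
    ≡⟨ ring (weight q σ) (qbinom Q m k) (qfact k Q) (qfact m Q) ⟩
  weight q σ * (qbinom Q m k * qfact m Q * qfact k Q)
    ≡⟨ cong (weight q σ *_) (trans (qbinom-qfact Q m k) (cong (λ N → qfact N Q) m+k≡n)) ⟩
  weight q σ * qfact n Q
    ∎
  where
  open ≡-Reasoning
  open Fibre k≤n {σ} derangement
  open Weights q
  open QBinomial using (qbinom; qbinom-qfact)
  ring : ∀ w b f g → w * b * f * g ≡ w * (b * g * f)
  ring = solve-∀
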